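{- Let $D\ge3$ and $n\ge2D$, let $\Gamma=(X,\mathcal{R})$ be the Johnson graph $J(n,D)$, and fix $x\in X$. Then $\Gamma$ does not support a uniform structure with respect to $x$.
   Context: Johnson graph $J(n,D)$: vertices are the $D$-subsets of an $n$-set, adjacent iff their intersection has size $D-1$. For a graph with distance $\partial$ and fixed $x$ of eccentricity $\varepsilon$: $V=\mathbb{C}^X$, $A$ the adjacency matrix, $E_i^*$ the diagonal $0/1$ matrix with $(y,y)$-entry $1$ iff $\partial(x,y)=i$; $L=\sum_{i=1}^{\varepsilon}E^*_{i-1}AE^*_i$, $R=\sum_{i=0}^{\varepsilon-1}E^*_{i+1}AE^*_i=L^\top$. $\Gamma_f$ is the graph on $X$ whose edges are the edges $yz$ of $\Gamma$ with $\partial(x,y)\ne\partial(x,z)$ (bipartite with lowering/raising matrices $L,R$). A parameter matrix is a tridiagonal complex $U=(e_{ij})_{1\le i,j\le\varepsilon}$ with $e_{ii}=1$, with $e_{i,i-1}\ne0$ for all $2\le i\le\varepsilon$ or $e_{i-1,i}\ne0$ for all $2\le i\le\varepsilon$, and every principal submatrix $(e_{ij})_{s\le i,j\le t}$ nonsingular; $e_i^-=e_{i,i-1}$, $e_i^+=e_{i,i+1}$, $e_1^-=e_\varepsilon^+=0$. A bipartite graph admits a uniform structure w.r.t. $x$ if there exist such $U$ and $f\in\mathbb{C}^\varepsilon$ with $e_i^-RL^2+LRL+e_i^+L^2R=f_iL$ on $E_i^*V$ for all $1\le i\le\varepsilon$; a non-bipartite $\Gamma$ supports a uniform structure w.r.t.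 $x$ if $\Gamma_f$ admits one. -}

module Defs where

open import Level using (Level; _⊔_) renaming (suc to lsuc)
open import Data.Nat as ℕ using (ℕ; zero; suc; _∸_; _≤_; _<_)
import Data.Nat.Properties as ℕP
open import Data.Bool as B using (Bool; true; false; if_then_else_; _∧_; _∨_; not)
open import Data.Bool.Properties using () renaming (_≟_ to _≟B_)
open import Data.Fin using (Fin; toℕ; punchIn) renaming (zero to fzero; suc to fsuc)
open import Data.Fin.Subset using (Subset; _∩_; ∣_∣)
open import Data.Vec using (Vec; []; _∷_)
open import Data.Vec.Properties using (≡-dec)
open import Data.List using (List; []; _∷_; _++_; map; mapMaybe; foldr; length; _∷ʳ_)
open import Data.Maybe using (Maybe; just; nothing)
open import Data.Product using (Σ; ∃; _×_; _,_; proj₁)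
open import Data.Sum using (_⊎_)
open import Relation.Nullary using (¬_; yes; no; does)
open import Relation.Binary.PropositionalEquality using (_≡_)
open import Algebra.Bundles using (CommutativeRing)

-- Ground field: an algebraically closed field of characteristic zero
-- (stand-in for ℂ, which is not available constructively)

module RingOps {c ℓ} (R : CommutativeRing c ℓ) where
  open CommutativeRing R
  _•_ : ℕ → Carrier → Carrier
  zero  • x = 0#
  suc n • x = x + (n • x)
  evalPoly : List Carrier → Carrier → Carrier
  evalPoly cs r = foldr (λ a acc → a + r * acc) 0# cs

record ACField (c ℓ : Level) : Set (lsuc (c ⊔ ℓ)) where
  field
    cring : CommutativeRing c ℓ
  open CommutativeRing cring public
  open RingOps cring public
  field
    0≉1        : ¬ (0# ≈ 1#)
    inverse    : ∀ a → ¬ (a ≈ 0#) → ∃ λ b → a * b ≈ 1#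
    charZero   : ∀ m → ¬ (suc m • 1# ≈ 0#)
    -- every monic polynomial a₀ + a₁ t + … + a_{d-1} t^{d-1} + t^d, d ≥ 1, has a root
    algClosed  : ∀ (a : Carrier) (as : List Carrier) →
                 ∃ λ r → evalPoly ((a ∷ as) ∷ʳ 1#) r ≈ 0#

-- Finite simple graphs given by an explicit vertex list (each vertex once)
-- with boolean vertex-equality and adjacency.

record Graph : Set₁ where
  field
    Vtx   : Set
    verts : List Vtx
    eqV   : Vtx → Vtx → Bool
    adj   : Vtx → Vtx → Bool

module _ (Γ : Graph) where
  open Graph Γ

  anyV : (Vtx → Bool) → Bool
  anyV p = foldr (λ v acc → p v ∨ acc) false verts

  reach : Vtx → ℕ → Vtx → Bool
  reach x zero    y = eqV x y
  reach x (suc k) y = reach x k y ∨ anyV (λ w → reach x k w ∧ adj w y)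

  -- least k < bound with p k, (bound if none)
  firstTrue : (ℕ → Bool) → ℕ → ℕ
  firstTrue p zero    = zero
  firstTrue p (suc b) = if p 0 then 0 else suc (firstTrue (λ k → p (suc k)) b)

  -- path-length distance ∂(x,y) (graphs considered here are connected)
  dist : Vtx → Vtx → ℕ
  dist x y = firstTrue (λ k → reach x k y) (length verts)

  ecc : Vtx → ℕ
  ecc x = foldr (λ y acc → dist x y ℕ.⊔ acc) 0 verts

  Bipartite : Set
  Bipartite = Σ (Vtx → Bool) λ col → ∀ y z → adj y z ≡ true → ¬ (col y ≡ col z)

  flatGraph : Vtx → Graph
  flatGraph x = record
    { Vtx = Vtx ; verts = verts ; eqV = eqV
    ; adj = λ y z → adj y z ∧ not (does (dist x y ℕ.≟ dist x z)) }

module _ {c ℓ} (K : ACField c ℓ) where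
  open ACField K

  sumFin : ∀ m → (Fin m → Carrier) → Carrier
  sumFin zero    f = 0#
  sumFin (suc m) f = f fzero + sumFin m (λ j → f (fsuc j))

  sign : ℕ → Carrier
  sign zero    = 1#
  sign (suc k) = - sign k

  det : ∀ m → (Fin m → Fin m → Carrier) → Carrier
  det zero    M = 1#
  det (suc m) M = sumFin (suc m) λ j →
    sign (toℕ j) * (M fzero j * det m (λ a b → M (fsuc a) (punchIn j b)))

  Nonsingular : ∀ m → (Fin m → Fin m → Carrier) → Set ℓ
  Nonsingular m M = ¬ (det m M ≈ 0#)

  -- Parameter matrix of size ε, indexed 1..ε (entries outside are ignored)
  record ParameterMatrix (ε : ℕ) (U : ℕ → ℕ → Carrier) : Set ℓ where
    field
      diag       : ∀ i → 1 ≤ i → i ≤ ε → U i i ≈ 1#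
      tridiag    : ∀ i j → 1 ≤ i → i ≤ ε → 1 ≤ j → j ≤ ε →
                   suc (suc i) ≤ j ⊎ suc (suc j) ≤ i → U i j ≈ 0#
      offdiag    : (∀ i → 2 ≤ i → i ≤ ε → ¬ (U i (i ∸ 1) ≈ 0#))
                 ⊎ (∀ i → 2 ≤ i → i ≤ ε → ¬ (U (i ∸ 1) i ≈ 0#))
      principal  : ∀ s t → 1 ≤ s → s ≤ t → t ≤ ε →
                   Nonsingular (suc (t ∸ s)) (λ a b → U (s ℕ.+ toℕ a) (s ℕ.+ toℕ b))

  eMinus : ℕ → (ℕ → ℕ → Carrier) → ℕ → Carrier
  eMinus ε U i = if does (i ℕ.≟ 1) then 0# else U i (i ∸ 1)

  ePlus : ℕ → (ℕ → ℕ → Carrier) → ℕ → Carrier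
  ePlus ε U i = if does (i ℕ.≟ ε) then 0# else U i (suc i)

  module _ (Γ : Graph) (x : Graph.Vtx Γ) where
    open Graph Γ

    Mat : Set c
    Mat = Vtx → Vtx → Carrier

    sumV : (Vtx → Carrier) → Carrier
    sumV f = foldr (λ v acc → f v + acc) 0# verts

    infixl 6 _⊕_
    infixl 7 _⊗_
    infixr 8 _·_

    _⊗_ : Mat → Mat → Mat
    (M ⊗ N) y z = sumV (λ w → M y w * N w z)

    _⊕_ : Mat → Mat → Mat
    (M ⊕ N) y z = M y z + N y z

    _·_ : Carrier → Mat → Mat
    (a · M) y z = a * M y z

    Estar : ℕ → Mat
    Estar i y z = if eqV y z ∧ does (dist Γ x y ℕ.≟ i) then 1# else 0#

    -- L = Σ_{i=1}^{ε} E*_{i-1} A E*_i, entrywise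
    Lmat : Mat
    Lmat y z = if adj y z ∧ does (suc (dist Γ x y) ℕ.≟ dist Γ x z) then 1# else 0#

    Rmat : Mat
    Rmat y z = Lmat z y

    -- Γ admits a uniform structure w.r.t. x:
    -- e_i^- R L² + L R L + e_i^+ L² R = f_i L on E_i^* V for 1 ≤ i ≤ ε,
    -- i.e. both sides agree after right multiplication by E_i^*.
    AdmitsUniform : Set (c ⊔ ℓ)
    AdmitsUniform =
      Σ (ℕ → ℕ → Carrier) λ U → Σ (ℕ → Carrier) λ f →
        ParameterMatrix (ecc Γ x) U ×
        (∀ i → 1 ≤ i → i ≤ ecc Γ x → ∀ y z →
          (((eMinus (ecc Γ x) U i · (Rmat ⊗ (Lmat ⊗ Lmat)))
             ⊕ (Lmat ⊗ (Rmat ⊗ Lmat))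
             ⊕ (ePlus (ecc Γ x) U i · (Lmat ⊗ (Lmat ⊗ Rmat)))) ⊗ Estar i) y z
          ≈ ((f i · Lmat) ⊗ Estar i) y z)

  SupportsUniform : (Γ : Graph) → Graph.Vtx Γ → Set (c ⊔ ℓ)
  SupportsUniform Γ x =
    (Bipartite Γ → AdmitsUniform Γ x) × (¬ Bipartite Γ → AdmitsUniform (flatGraph Γ x) x)

allSubsets : ∀ n → List (Subset n)
allSubsets zero    = [] ∷ []
allSubsets (suc n) = map (true ∷_) (allSubsets n) ++ map (false ∷_) (allSubsets n)

JVtx : ℕ → ℕ → Set
JVtx n D = Σ (Subset n) λ s → ∣ s ∣ ≡ D

Johnson : ℕ → ℕ → Graph
Johnson n D = record
  { Vtx   = JVtx n D
  ; verts = mapMaybe keep (allSubsets n)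
  ; eqV   = λ y z → does (≡-dec _≟B_ (proj₁ y) (proj₁ z))
  ; adj   = λ y z → does (∣ proj₁ y ∩ proj₁ z ∣ ℕ.≟ D ∸ 1)
  }
  where
  keep : Subset n → Maybe (JVtx n D)
  keep s with ∣ s ∣ ℕ.≟ D
  ... | yes p = just (s , p)
  ... | no _  = nothing

-- Put the vertices of J(n,D) in the coordinates y ↦ y xor x.  The layer of y is ℓ y = |y ∖ x|, and an
-- edge of Γ_f raising the layer adds one element inside x and one outside x; so L is the tensor
-- product of the raising maps of the subset lattices of x and of its complement, and the numbers of
-- RLL-, LRL- and LLR-walks between two vertices factor into walk counts in two Boolean lattices.
-- At layer k+1 (1 ≤ k ≤ D-2) the identity e⁻ RLL + LRL + e⁺ LLR = f L, read at two non-adjacent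
-- pairs (y, z), gives 4e⁻ + 4 + 4e⁺ = 0 and 4k e⁻ + 2D + 4(D-k-1) e⁺ = 0.  For odd D = 2k+1 these
-- force 2 = 0; for even D = 2k+2 they force e⁻ = 0 at layer k+1 and e⁺ = 0 at layer k+2, against
-- the off-diagonal condition on a parameter matrix.  J(n,D) has triangles, so only Γ_f matters.

module Submission where

open import Defs
open import Level using (Level)

module BooleanLattice where

  open import Data.Nat as ℕ using (ℕ; zero; suc; _+_; _*_; _∸_; _≤_; z≤n; s≤s; _≡ᵇ_)
  open import Data.Nat.Properties
  open import Data.Bool as B using (Bool; true; false; if_then_else_; _∧_; _∨_; not; _xor_)
  open import Data.Bool.Properties using (∧-comm; ∧-identityʳ; ∧-zeroʳ; ∨-identityʳ) renaming (_≟_ to _≟B_)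
  open import Data.Fin using (Fin) renaming (zero to fzero; suc to fsuc)
  open import Data.Fin.Subset using (∣_∣; _∩_)
  open import Data.Vec as Vec using (Vec; []; _∷_; lookup)
  open import Data.Vec.Properties using (≡-dec; lookup-map; lookup-zipWith)
  open import Data.Product using (Σ; _×_; _,_; proj₁; proj₂)
  open import Data.Empty using (⊥-elim)
  open import Relation.Binary.PropositionalEquality
  open import Relation.Nullary using (¬_; does; contradiction)
  open import Data.Nat.Solver using (module +-*-Solver)
  open +-*-Solver using (solve; _:+_; _:*_; _:=_; con)
  open import Algebra.Properties.CommutativeSemigroup +-commutativeSemigroup using () renaming (interchange to +-interchange)

  ⟦_⟧ : Bool → ℕ
  ⟦ true ⟧ = 1
  ⟦ false ⟧ = 0

  ΣF : ∀ n → (Fin n → ℕ) → ℕ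
  ΣF zero f = 0
  ΣF (suc n) f = f fzero + ΣF n (λ k → f (fsuc k))

  count : ∀ {n} → (Fin n → Bool) → ℕ
  count {n} p = ΣF n (λ k → ⟦ p k ⟧)

  ΣS : ∀ n → (Vec Bool n → ℕ) → ℕ
  ΣS zero F = F []
  ΣS (suc n) F = ΣS n (λ s → F (true ∷ s)) + ΣS n (λ s → F (false ∷ s))

  set : ∀ {n} → Vec Bool n → Fin n → Bool → Vec Bool n
  set (x ∷ xs) fzero b = b ∷ xs
  set (x ∷ xs) (fsuc i) b = x ∷ set xs i b

  eqF : ∀ {n} → Fin n → Fin n → Bool
  eqF fzero fzero = true
  eqF fzero (fsuc _) = false
  eqF (fsuc _) fzero = false
  eqF (fsuc i) (fsuc j) = eqF i j

  eqF-refl : ∀ {n} (i : Fin n) → eqF i i ≡ true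
  eqF-refl fzero = refl
  eqF-refl (fsuc i) = eqF-refl i

  eqF-≡ : ∀ {n} (i j : Fin n) → eqF i j ≡ true → i ≡ j
  eqF-≡ fzero fzero _ = refl
  eqF-≡ fzero (fsuc j) ()
  eqF-≡ (fsuc i) fzero ()
  eqF-≡ (fsuc i) (fsuc j) e = cong fsuc (eqF-≡ i j e)

  eqF-sym : ∀ {n} (i j : Fin n) → eqF i j ≡ eqF j i
  eqF-sym fzero fzero = refl
  eqF-sym fzero (fsuc j) = refl
  eqF-sym (fsuc i) fzero = refl
  eqF-sym (fsuc i) (fsuc j) = eqF-sym i j

  lookup-set : ∀ {n} (V : Vec Bool n) (i k : Fin n) (b : Bool) →
    lookup (set V i b) k ≡ (if eqF i k then b else lookup V k)
  lookup-set (x ∷ V) fzero fzero b = refl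
  lookup-set (x ∷ V) fzero (fsuc k) b = refl
  lookup-set (x ∷ V) (fsuc i) fzero b = refl
  lookup-set (x ∷ V) (fsuc i) (fsuc k) b = lookup-set V i k b

  lookup-set-same : ∀ {n} (V : Vec Bool n) i b → lookup (set V i b) i ≡ b
  lookup-set-same V i b = trans (lookup-set V i i b) (cong (λ t → if t then b else lookup V i) (eqF-refl i))

  lookup-set-other : ∀ {n} (V : Vec Bool n) i k b → eqF i k ≡ false → lookup (set V i b) k ≡ lookup V k
  lookup-set-other V i k b e = trans (lookup-set V i k b) (cong (λ t → if t then b else lookup V k) e)

  lookup-set² : ∀ {n} (S : Vec Bool n) a x d y k →
    lookup (set (set S a x) d y) k ≡ (if eqF d k then y else (if eqF a k then x else lookup S k))
  lookup-set² S a x d y k = trans (lookup-set (set S a x) d k y) (cong (if eqF d k then y else_) (lookup-set S a k x))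

  lookup-set³ : ∀ {n} (S : Vec Bool n) q x r y s z k →
    lookup (set (set (set S q x) r y) s z) k ≡ (if eqF s k then z else (if eqF r k then y else (if eqF q k then x else lookup S k)))
  lookup-set³ S q x r y s z k = trans (lookup-set (set (set S q x) r y) s k z) (cong (if eqF s k then z else_) (lookup-set² S q x r y k))

  set-set : ∀ {m} (W : Vec Bool m) i b1 b2 → set (set W i b1) i b2 ≡ set W i b2
  set-set (w ∷ W) fzero b1 b2 = refl
  set-set (w ∷ W) (fsuc i) b1 b2 = cong (w ∷_) (set-set W i b1 b2)

  set-id : ∀ {m} (W : Vec Bool m) i b → lookup W i ≡ b → set W i b ≡ W
  set-id (w ∷ W) fzero b e = cong (_∷ W) (sym e)
  set-id (w ∷ W) (fsuc i) b e = cong (w ∷_) (set-id W i b e)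

  vec-ext : ∀ {n} (u v : Vec Bool n) → (∀ k → lookup u k ≡ lookup v k) → u ≡ v
  vec-ext [] [] _ = refl
  vec-ext (a ∷ u) (b ∷ v) e = cong₂ _∷_ (e fzero) (vec-ext u v (λ k → e (fsuc k)))

  ∧-true₁ : ∀ {a b} → (a ∧ b) ≡ true → a ≡ true
  ∧-true₁ {true} _ = refl

  ∧-true₂ : ∀ {a b} → (a ∧ b) ≡ true → b ≡ true
  ∧-true₂ {true} {true} _ = refl

  not-true : ∀ {a} → not a ≡ true → a ≡ false
  not-true {false} _ = refl

  ≡ᵇ-refl : ∀ m → (m ≡ᵇ m) ≡ true
  ≡ᵇ-refl zero = refl
  ≡ᵇ-refl (suc m) = ≡ᵇ-refl m

  does-≢ : ∀ m k → ¬ (m ≡ k) → does (m ℕ.≟ k) ≡ false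
  does-≢ m k ne with m ≡ᵇ k in e
  ... | false = refl
  ... | true = ⊥-elim (ne (≡ᵇ⇒≡ m k (subst B.T (sym e) _)))

  does-true : ∀ m k → does (m ℕ.≟ k) ≡ true → m ≡ k
  does-true m k e = ≡ᵇ⇒≡ m k (subst B.T (sym e) _)

  ⟦∧⟧ : ∀ a b → ⟦ a ∧ b ⟧ ≡ ⟦ a ⟧ * ⟦ b ⟧
  ⟦∧⟧ true true = refl
  ⟦∧⟧ true false = refl
  ⟦∧⟧ false b = refl

  ⟦split⟧ : ∀ a b → ⟦ a ⟧ ≡ ⟦ a ∧ b ⟧ + ⟦ a ∧ not b ⟧
  ⟦split⟧ true true = refl
  ⟦split⟧ true false = refl
  ⟦split⟧ false b = refl

  ⟦⟧≡0 : ∀ b → ⟦ b ⟧ ≡ 0 → b ≡ false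
  ⟦⟧≡0 false _ = refl

  ΣF-cong : ∀ n {f g : Fin n → ℕ} → (∀ k → f k ≡ g k) → ΣF n f ≡ ΣF n g
  ΣF-cong zero e = refl
  ΣF-cong (suc n) e = cong₂ _+_ (e fzero) (ΣF-cong n (λ k → e (fsuc k)))

  ΣF-+ : ∀ n (f g : Fin n → ℕ) → ΣF n (λ k → f k + g k) ≡ ΣF n f + ΣF n g
  ΣF-+ zero f g = refl
  ΣF-+ (suc n) f g =
    trans (cong (f fzero + g fzero +_) (ΣF-+ n (λ k → f (fsuc k)) (λ k → g (fsuc k))))
          (+-interchange (f fzero) (g fzero) _ _)

  ΣF-*ˡ : ∀ n m (f : Fin n → ℕ) → ΣF n (λ k → m * f k) ≡ m * ΣF n f
  ΣF-*ˡ zero m f = sym (*-zeroʳ m)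
  ΣF-*ˡ (suc n) m f = trans (cong (m * f fzero +_) (ΣF-*ˡ n m _)) (sym (*-distribˡ-+ m (f fzero) _))

  ΣF-*ʳ : ∀ n m (f : Fin n → ℕ) → ΣF n (λ k → f k * m) ≡ ΣF n f * m
  ΣF-*ʳ n m f = trans (ΣF-cong n (λ k → *-comm (f k) m)) (trans (ΣF-*ˡ n m f) (*-comm m _))

  ΣF-zero : ∀ n → ΣF n (λ _ → 0) ≡ 0
  ΣF-zero zero = refl
  ΣF-zero (suc n) = ΣF-zero n

  ΣF-zero' : ∀ n (f : Fin n → ℕ) → (∀ k → f k ≡ 0) → ΣF n f ≡ 0
  ΣF-zero' n f e = trans (ΣF-cong n e) (ΣF-zero n)

  ΣF-zero⇒ : ∀ n (f : Fin n → ℕ) → ΣF n f ≡ 0 → ∀ k → f k ≡ 0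
  ΣF-zero⇒ (suc n) f e fzero = m+n≡0⇒m≡0 (f fzero) e
  ΣF-zero⇒ (suc n) f e (fsuc k) = ΣF-zero⇒ n (λ k → f (fsuc k)) (m+n≡0⇒n≡0 (f fzero) e) k

  ΣF-point : ∀ n (p : Fin n) (f : Fin n → ℕ) → ΣF n (λ k → ⟦ eqF p k ⟧ * f k) ≡ f p
  ΣF-point (suc n) fzero f = trans (cong (f fzero + 0 +_) (ΣF-zero n)) (trans (+-identityʳ _) (+-identityʳ _))
  ΣF-point (suc n) (fsuc p) f = ΣF-point n p (λ k → f (fsuc k))

  ΣF-point′ : ∀ n (g : Fin n → Bool) a → ΣF n (λ d → ⟦ g d ⟧ * ⟦ eqF a d ⟧) ≡ ⟦ g a ⟧
  ΣF-point′ n g a = trans (ΣF-cong n (λ d → *-comm ⟦ g d ⟧ _)) (trans (ΣF-point n a (λ d → ⟦ g d ⟧)) refl)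

  ΣF-split : ∀ n (p : Fin n) (f : Fin n → ℕ) → ΣF n f ≡ f p + ΣF n (λ k → ⟦ not (eqF p k) ⟧ * f k)
  ΣF-split (suc n) fzero f = cong (f fzero +_) (ΣF-cong n (λ k → sym (+-identityʳ _)))
  ΣF-split (suc n) (fsuc p) f =
    trans (cong (f fzero +_) (ΣF-split n p (λ k → f (fsuc k))))
          (solve 3 (λ a b r → a :+ (b :+ r) := b :+ ((a :+ con 0) :+ r)) refl (f fzero) (f (fsuc p)) _)

  ΣF-update : ∀ n (i : Fin n) (f g : Fin n → ℕ) → (∀ k → eqF i k ≡ false → f k ≡ g k) →
    ΣF n f + g i ≡ ΣF n g + f i
  ΣF-update n i f g e = begin
      ΣF n f + g i
    ≡⟨ cong (_+ g i) (ΣF-split n i f) ⟩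
      (f i + ΣF n (λ k → ⟦ not (eqF i k) ⟧ * f k)) + g i
    ≡⟨ cong (λ t → (f i + t) + g i) (ΣF-cong n (λ k → away k (eqF i k) refl)) ⟩
      (f i + ΣF n (λ k → ⟦ not (eqF i k) ⟧ * g k)) + g i
    ≡⟨ solve 3 (λ a r b → (a :+ r) :+ b := (b :+ r) :+ a) refl (f i) _ (g i) ⟩
      (g i + ΣF n (λ k → ⟦ not (eqF i k) ⟧ * g k)) + f i
    ≡⟨ cong (_+ f i) (sym (ΣF-split n i g)) ⟩
      ΣF n g + f i ∎
    where
    open ≡-Reasoning
    away : ∀ k b → eqF i k ≡ b → ⟦ not b ⟧ * f k ≡ ⟦ not b ⟧ * g k
    away k true _ = refl
    away k false eq = cong (_+ 0) (e k eq)

  split-guard : ∀ n (g : Fin n → Bool) (h : Fin n → ℕ) p → g p ≡ true →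
    ΣF n (λ a → ⟦ g a ⟧ * h a) ≡ h p + ΣF n (λ a → ⟦ g a ∧ not (eqF p a) ⟧ * h a)
  split-guard n g h p gp = trans (ΣF-split n p (λ a → ⟦ g a ⟧ * h a))
    (cong₂ _+_ (trans (cong (λ t → ⟦ t ⟧ * h p) gp) (+-identityʳ (h p)))
      (ΣF-cong n (λ a → trans (sym (*-assoc ⟦ not (eqF p a) ⟧ ⟦ g a ⟧ (h a))) (cong (_* h a) (trans (*-comm ⟦ not (eqF p a) ⟧ ⟦ g a ⟧) (sym (⟦∧⟧ (g a) (not (eqF p a)))))))))

  ΣF-const1 : ∀ n (g : Fin n → Bool) → ΣF n (λ a → ⟦ g a ⟧ * 1) ≡ count g
  ΣF-const1 n g = ΣF-cong n (λ a → *-identityʳ _)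

  ΣF-two-points : ∀ n (g : Fin n → Bool) a p → eqF a p ≡ false →
    ΣF n (λ d → ⟦ g d ⟧ * ⟦ eqF a d ∨ eqF p d ⟧) ≡ ⟦ g a ⟧ + ⟦ g p ⟧
  ΣF-two-points n g a p ne = trans (ΣF-cong n h) (trans (ΣF-+ n _ _) (cong₂ _+_ (ΣF-point′ n g a) (ΣF-point′ n g p)))
    where
    bl : ∀ x y → (x ≡ true → y ≡ false) → ⟦ x ∨ y ⟧ ≡ ⟦ x ⟧ + ⟦ y ⟧
    bl true y f rewrite f refl = refl
    bl false y f = refl
    h : ∀ d → ⟦ g d ⟧ * ⟦ eqF a d ∨ eqF p d ⟧ ≡ ⟦ g d ⟧ * ⟦ eqF a d ⟧ + ⟦ g d ⟧ * ⟦ eqF p d ⟧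
    h d = trans (cong (⟦ g d ⟧ *_) (bl (eqF a d) (eqF p d) (λ e → case (eqF-≡ a d e)))) (*-distribˡ-+ ⟦ g d ⟧ _ _)
      where
      case : a ≡ d → eqF p d ≡ false
      case refl = trans (eqF-sym p a) ne

  ΣF-cong-guarded : ∀ n (g : Fin n → Bool) (h h' : Fin n → ℕ) → (∀ k → g k ≡ true → h k ≡ h' k) →
    ΣF n (λ k → ⟦ g k ⟧ * h k) ≡ ΣF n (λ k → ⟦ g k ⟧ * h' k)
  ΣF-cong-guarded n g h h' e = ΣF-cong n f
    where
    f : ∀ k → ⟦ g k ⟧ * h k ≡ ⟦ g k ⟧ * h' k
    f k with g k in eq
    ... | true = cong (λ t → t + 0) (e k eq)
    ... | false = refl

  ΣF-distr : ∀ n (A : Fin n → ℕ) (g h : Fin n → ℕ) →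
    ΣF n (λ a → A a * g a) + ΣF n (λ a → A a * h a) ≡ ΣF n (λ a → A a * (1 * g a + h a))
  ΣF-distr n A g h = trans (sym (ΣF-+ n _ _)) (ΣF-cong n (λ a → trans (sym (*-distribˡ-+ (A a) (g a) (h a))) (cong (λ t → A a * (t + h a)) (sym (*-identityˡ (g a))))))

  count-cong : ∀ {n} {P Q : Fin n → Bool} → (∀ k → P k ≡ Q k) → count P ≡ count Q
  count-cong {n} e = ΣF-cong n (λ k → cong ⟦_⟧ (e k))

  count-split : ∀ {n} (P Q : Fin n → Bool) → count P ≡ count (λ k → P k ∧ Q k) + count (λ k → P k ∧ not (Q k))
  count-split {n} P Q = trans (ΣF-cong n (λ k → ⟦split⟧ (P k) (Q k))) (ΣF-+ n _ _)

  count-zero : ∀ {n} (P : Fin n → Bool) → (∀ k → P k ≡ false) → count P ≡ 0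
  count-zero {n} P e = ΣF-zero' n _ (λ k → cong ⟦_⟧ (e k))

  count-zero⇒ : ∀ {n} (P : Fin n → Bool) → count P ≡ 0 → ∀ k → P k ≡ false
  count-zero⇒ {n} P e k = ⟦⟧≡0 (P k) (ΣF-zero⇒ n _ e k)

  count-pos : ∀ {n} (P : Fin n → Bool) k → P k ≡ true → (count P ≡ᵇ 0) ≡ false
  count-pos P k e with count P in eq
  ... | zero = contradiction (trans (sym (count-zero⇒ P eq k)) e) λ ()
  ... | suc _ = refl

  count-mono : ∀ {n} (P Q : Fin n → Bool) → (∀ k → P k ≡ true → Q k ≡ true) → count P ≤ count Q
  count-mono {zero} P Q h = z≤n
  count-mono {suc n} P Q h = +-mono-≤ (hd (P fzero) (Q fzero) (h fzero)) (count-mono (λ k → P (fsuc k)) (λ k → Q (fsuc k)) (λ k → h (fsuc k)))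
    where
    hd : ∀ a b → (a ≡ true → b ≡ true) → ⟦ a ⟧ ≤ ⟦ b ⟧
    hd true b f rewrite f refl = s≤s z≤n
    hd false b f = z≤n

  count-remove : ∀ {n} (g : Fin n → Bool) p → g p ≡ true → count g ≡ suc (count (λ a → g a ∧ not (eqF p a)))
  count-remove {n} g p gp = trans (ΣF-cong n (λ a → sym (*-identityʳ ⟦ g a ⟧))) (trans (split-guard n g (λ _ → 1) p gp) (cong suc (ΣF-cong n (λ a → *-identityʳ _))))

  count-set : ∀ {n} (V : Vec Bool n) i b → count (lookup (set V i b)) + ⟦ lookup V i ⟧ ≡ count (lookup V) + ⟦ b ⟧
  count-set {n} V i b = trans (ΣF-update n i (λ k → ⟦ lookup (set V i b) k ⟧) (λ k → ⟦ lookup V k ⟧) h) (cong (λ t → count (lookup V) + ⟦ t ⟧) (lookup-set-same V i b))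
    where
    h : ∀ k → eqF i k ≡ false → ⟦ lookup (set V i b) k ⟧ ≡ ⟦ lookup V k ⟧
    h k e = cong ⟦_⟧ (lookup-set-other V i k b e)

  find : ∀ {n} (P : Fin n → Bool) → ¬ (count P ≡ 0) → Σ (Fin n) (λ k → P k ≡ true)
  find {zero} P ne = ⊥-elim (ne refl)
  find {suc n} P ne with P fzero in e
  ... | true = fzero , e
  ... | false = let r = find (λ k → P (fsuc k)) ne in fsuc (proj₁ r) , proj₂ r

  witness : ∀ {n} (P : Fin n → Bool) → 1 ≤ count P → Σ (Fin n) (λ k → P k ≡ true)
  witness P le = find P (λ z → contradiction (subst (1 ≤_) z le) λ ())

  twoWitnesses : ∀ {n} (P : Fin n → Bool) → 2 ≤ count P → Σ (Fin n) (λ r → Σ (Fin n) (λ s → (P r ≡ true) × (P s ≡ true) × (eqF r s ≡ false)))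
  twoWitnesses P le = r , s , pr , ∧-true₁ ps , not-true (∧-true₂ {P s} ps)
    where
    er = witness P (≤-trans (s≤s z≤n) le)
    r = proj₁ er
    pr = proj₂ er
    es = witness (λ k → P k ∧ not (eqF r k)) (≤-pred (subst (2 ≤_) (count-remove P r pr) le))
    s = proj₁ es
    ps = proj₂ es

  card≡count : ∀ {n} (s : Vec Bool n) → ∣ s ∣ ≡ count (lookup s)
  card≡count [] = refl
  card≡count (true ∷ s) = cong suc (card≡count s)
  card≡count (false ∷ s) = card≡count s

  card∩≡count : ∀ {n} (s t : Vec Bool n) → ∣ s ∩ t ∣ ≡ count (λ k → lookup s k ∧ lookup t k)
  card∩≡count [] [] = refl
  card∩≡count (true ∷ s) (true ∷ t) = cong suc (card∩≡count s t)
  card∩≡count (true ∷ s) (false ∷ t) = card∩≡count s t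
  card∩≡count (false ∷ s) (b ∷ t) = card∩≡count s t

  notV : ∀ {n} → Vec Bool n → Vec Bool n
  notV = Vec.map not

  lookup-notV : ∀ {n} (c : Vec Bool n) k → lookup (notV c) k ≡ not (lookup c k)
  lookup-notV c k = lookup-map k not c

  xorV : ∀ {n} → Vec Bool n → Vec Bool n → Vec Bool n
  xorV = Vec.zipWith _xor_

  eqF-apart : ∀ {n} (c : Vec Bool n) i j → lookup c i ≡ true → lookup c j ≡ false → eqF i j ≡ false
  eqF-apart c i j ci cj with eqF i j in e
  ... | false = refl
  ... | true with eqF-≡ i j e
  ...   | refl = contradiction (trans (sym ci) cj) λ ()

  eqF-apart′ : ∀ {n} (c : Vec Bool n) i j → lookup c i ≡ false → lookup c j ≡ true → eqF i j ≡ false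
  eqF-apart′ c i j ci cj = trans (eqF-sym i j) (eqF-apart c j i cj ci)

  includedOn : ∀ {n} → (c S W : Vec Bool n) → Bool
  includedOn c S W = count (λ k → lookup c k ∧ lookup S k ∧ not (lookup W k)) ≡ᵇ 0

  cardOn : ∀ {n} → (W c : Vec Bool n) → ℕ
  cardOn W c = count (λ k → lookup W k ∧ lookup c k)

  Above : ∀ {n} → ℕ → (c S W : Vec Bool n) → Bool
  Above m c S W = includedOn c S W ∧ (cardOn W c ≡ᵇ m + cardOn S c)

  count-cardOn : ∀ {n} (V c : Vec Bool n) → count (λ k → lookup c k ∧ lookup V k) ≡ cardOn V c
  count-cardOn V c = count-cong (λ k → ∧-comm (lookup c k) (lookup V k))

  includedOn-true : ∀ {n} (c V T : Vec Bool n) → (∀ k → (lookup c k ∧ lookup V k ∧ not (lookup T k)) ≡ false) → includedOn c V T ≡ true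
  includedOn-true c V T h = cong (_≡ᵇ 0) (count-zero _ h)

  includedOn-false : ∀ {n} (c V T : Vec Bool n) k → (lookup c k ∧ lookup V k ∧ not (lookup T k)) ≡ true → includedOn c V T ≡ false
  includedOn-false c V T k h = count-pos _ k h

  includedOn-cardOn-≤ : ∀ {n} (c S W : Vec Bool n) → includedOn c S W ≡ true → cardOn S c ≤ cardOn W c
  includedOn-cardOn-≤ c S W e = ≤-trans (≤-reflexive (count-split _ (lookup W))) (≤-trans (≤-reflexive (cong (count (λ k → (lookup S k ∧ lookup c k) ∧ lookup W k) +_) z)) (≤-trans (≤-reflexive (+-identityʳ _)) (count-mono _ _ h)))
    where
    z : count (λ k → (lookup S k ∧ lookup c k) ∧ not (lookup W k)) ≡ 0
    z = trans (count-cong (λ k → p (lookup S k) (lookup c k) (lookup W k))) (≡ᵇ⇒≡ _ 0 (subst B.T (sym e) _))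
      where p : ∀ s c w → (s ∧ c) ∧ not w ≡ c ∧ s ∧ not w
            p true true w = refl
            p true false w = refl
            p false true w = refl
            p false false w = refl
    h : ∀ k → ((lookup S k ∧ lookup c k) ∧ lookup W k) ≡ true → (lookup W k ∧ lookup c k) ≡ true
    h k = p (lookup S k) (lookup c k) (lookup W k)
      where p : ∀ s c w → ((s ∧ c) ∧ w) ≡ true → (w ∧ c) ≡ true
            p true true true _ = refl
            p true false w ()
            p false c w ()
            p true true false ()

  Above1-includedOn : ∀ {n} (c V T : Vec Bool n) → cardOn T c ≡ suc (cardOn V c) → Above 1 c V T ≡ includedOn c V T
  Above1-includedOn c V T e = trans (cong (λ t → includedOn c V T ∧ (t ≡ᵇ suc (cardOn V c))) e) (trans (cong (includedOn c V T ∧_) (≡ᵇ-refl (suc (cardOn V c)))) (∧-identityʳ (includedOn c V T)))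

  cardOn-set : ∀ {n} (V c : Vec Bool n) i b → cardOn (set V i b) c + ⟦ lookup V i ∧ lookup c i ⟧ ≡ cardOn V c + ⟦ b ∧ lookup c i ⟧
  cardOn-set {n} V c i b = trans (ΣF-update n i (λ k → ⟦ lookup (set V i b) k ∧ lookup c k ⟧) (λ k → ⟦ lookup V k ∧ lookup c k ⟧) h)
    (cong (λ t → cardOn V c + ⟦ t ∧ lookup c i ⟧) (trans (lookup-set V i i b) (cong (λ t → if t then b else lookup V i) (eqF-refl i))))
    where
    h : ∀ k → eqF i k ≡ false → ⟦ lookup (set V i b) k ∧ lookup c k ⟧ ≡ ⟦ lookup V k ∧ lookup c k ⟧
    h k e = cong (λ t → ⟦ t ∧ lookup c k ⟧) (trans (lookup-set V i k b) (cong (λ t → if t then b else lookup V k) e))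

  cardOn-add : ∀ {n} (V c : Vec Bool n) i → lookup c i ≡ true → lookup V i ≡ false → cardOn (set V i true) c ≡ suc (cardOn V c)
  cardOn-add V c i ci vi = trans (sym (+-identityʳ _)) (trans (cong (λ t → cardOn (set V i true) c + ⟦ t ∧ lookup c i ⟧) (sym vi)) (trans (cardOn-set V c i true) (trans (cong (λ t → cardOn V c + ⟦ t ⟧) ci) (+-comm _ 1))))

  cardOn-del : ∀ {n} (V c : Vec Bool n) i → lookup c i ≡ true → lookup V i ≡ true → suc (cardOn (set V i false) c) ≡ cardOn V c
  cardOn-del V c i ci vi = trans (+-comm 1 _) (trans (cong (λ t → cardOn (set V i false) c + ⟦ t ⟧) (sym ci)) (trans (cong (λ t → cardOn (set V i false) c + ⟦ t ∧ lookup c i ⟧) (sym vi)) (trans (cardOn-set V c i false) (+-identityʳ _))))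

  cardOn-outside : ∀ {n} (W m : Vec Bool n) i b → lookup m i ≡ false → cardOn (set W i b) m ≡ cardOn W m
  cardOn-outside W m i b mi = +-cancelʳ-≡ 0 _ _ (trans (cong (cardOn (set W i b) m +_) (sym (z (lookup W i)))) (trans (cardOn-set W m i b) (cong (cardOn W m +_) (z b))))
    where
    z : ∀ t → ⟦ t ∧ lookup m i ⟧ ≡ 0
    z t = trans (cong (λ u → ⟦ t ∧ u ⟧) mi) (cong ⟦_⟧ (∧-zeroʳ t))

  count-all : ∀ k → count {k} (λ _ → true) ≡ k
  count-all zero = refl
  count-all (suc k) = cong suc (count-all k)

  lookup-xor : ∀ {m} (s t : Vec Bool m) k → lookup (xorV s t) k ≡ (lookup s k xor lookup t k)
  lookup-xor s t k = lookup-zipWith _xor_ k s t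

  pred-≡ᵇ-split : ∀ s a b D → suc (s + (a + b)) ≡ D → (s ≡ᵇ D ∸ 1) ≡ ((a ≡ᵇ 0) ∧ (b ≡ᵇ 0))
  pred-≡ᵇ-split s zero zero D e rewrite sym e = trans (cong (s ≡ᵇ_) (+-identityʳ s)) (≡ᵇ-refl s)
  pred-≡ᵇ-split s zero (suc b) D e rewrite sym e = does-≢ s (s + suc b) (λ q → 0≢1+n (+-cancelˡ-≡ s 0 (suc b) (trans (+-identityʳ s) q)))
  pred-≡ᵇ-split s (suc a) b D e rewrite sym e = does-≢ s (s + suc (a + b)) (λ q → 0≢1+n (+-cancelˡ-≡ s 0 (suc (a + b)) (trans (+-identityʳ s) q)))

  ΣS-mono : ∀ m (F G : Vec Bool m → ℕ) → (∀ s → F s ≤ G s) → ΣS m F ≤ ΣS m G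
  ΣS-mono zero F G h = h []
  ΣS-mono (suc m) F G h = +-mono-≤ (ΣS-mono m _ _ (λ s → h (true ∷ s))) (ΣS-mono m _ _ (λ s → h (false ∷ s)))

  ⟦∧⟧* : ∀ a b X → ⟦ a ∧ b ⟧ * X ≡ ⟦ a ⟧ * (⟦ b ⟧ * X)
  ⟦∧⟧* a b X = trans (cong (_* X) (⟦∧⟧ a b)) (*-assoc ⟦ a ⟧ ⟦ b ⟧ X)

  count-fill : ∀ {n} (m B : Vec Bool n) e → lookup m e ≡ true → lookup B e ≡ false →
    suc (count (λ k → lookup m k ∧ not (lookup (set B e true) k))) ≡ count (λ k → lookup m k ∧ not (lookup B k))
  count-fill {n} m B e me be = trans (+-comm 1 _) (trans (cong (λ t → ΣF n f + ⟦ t ⟧) (sym g1)) (trans (ΣF-update n e f g h) (trans (cong (λ t → ΣF n g + ⟦ t ⟧) f0) (+-identityʳ _))))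
    where
    f = λ k → ⟦ lookup m k ∧ not (lookup (set B e true) k) ⟧
    g = λ k → ⟦ lookup m k ∧ not (lookup B k) ⟧
    h : ∀ k → eqF e k ≡ false → f k ≡ g k
    h k ek = cong (λ t → ⟦ lookup m k ∧ not t ⟧) (lookup-set-other B e k true ek)
    g1 : (lookup m e ∧ not (lookup B e)) ≡ true
    g1 = cong₂ (λ u v → u ∧ not v) me be
    f0 : (lookup m e ∧ not (lookup (set B e true) e)) ≡ false
    f0 = trans (cong (λ t → lookup m e ∧ not t) (lookup-set-same B e true)) (∧-zeroʳ (lookup m e))

  extendOn : ∀ {n} j (m B : Vec Bool n) → j ≤ count (λ k → lookup m k ∧ not (lookup B k)) →
    Σ (Vec Bool n) (λ B' → (∀ k → lookup m k ≡ false → lookup B' k ≡ lookup B k) × (cardOn B' m ≡ j + cardOn B m))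
  extendOn zero m B _ = B , (λ _ _ → refl) , refl
  extendOn (suc j) m B le = B' , ag , cd
    where
    fe = witness (λ k → lookup m k ∧ not (lookup B k)) (≤-trans (s≤s z≤n) le)
    e = proj₁ fe
    me = ∧-true₁ (proj₂ fe)
    be = not-true (∧-true₂ (proj₂ fe))
    B1 = set B e true
    le1 : j ≤ count (λ k → lookup m k ∧ not (lookup B1 k))
    le1 = ≤-pred (subst (suc j ≤_) (sym (count-fill m B e me be)) le)
    r = extendOn j m B1 le1
    B' = proj₁ r
    ag : ∀ k → lookup m k ≡ false → lookup B' k ≡ lookup B k
    ag k mk = trans (proj₁ (proj₂ r) k mk) (lookup-set-other B e k true (eqF-apart m e k me mk))
    cd : cardOn B' m ≡ suc j + cardOn B m
    cd = trans (proj₂ (proj₂ r)) (trans (cong (j +_) (cardOn-add B m e me be)) (+-suc j _))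

  AgreeOn : ∀ {n} → (c V V' : Vec Bool n) → Set
  AgreeOn c V V' = ∀ k → lookup c k ≡ true → lookup V k ≡ lookup V' k

  count-agreeOn : ∀ {n} (c V V' : Vec Bool n) (f : Fin n → Bool → Bool → Bool) → (∀ k v → f k false v ≡ false) →
    AgreeOn c V V' → count (λ k → f k (lookup c k) (lookup V k)) ≡ count (λ k → f k (lookup c k) (lookup V' k))
  count-agreeOn c V V' f f0 ag = count-cong h
    where
    h : ∀ k → f k (lookup c k) (lookup V k) ≡ f k (lookup c k) (lookup V' k)
    h k with lookup c k in e
    ... | true = cong (f k true) (ag k e)
    ... | false = trans (f0 k _) (sym (f0 k _))

  Above-agreeˡ : ∀ {n} m (c V V' T : Vec Bool n) → AgreeOn c V V' → Above m c V T ≡ Above m c V' T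
  Above-agreeˡ m c V V' T ag = cong₂ _∧_
    (cong (_≡ᵇ 0) (count-agreeOn c V V' (λ k ck vk → ck ∧ vk ∧ not (lookup T k)) (λ _ _ → refl) ag))
    (cong (λ t → cardOn T c ≡ᵇ m + t) (trans (count-cong (λ k → ∧-comm (lookup V k) (lookup c k))) (trans (count-agreeOn c V V' (λ _ → _∧_) (λ _ _ → refl) ag) (count-cong (λ k → ∧-comm (lookup c k) (lookup V' k))))))

  Above-agreeʳ : ∀ {n} m (c T V V' : Vec Bool n) → AgreeOn c V V' → Above m c T V ≡ Above m c T V'
  Above-agreeʳ m c T V V' ag = cong₂ _∧_
    (cong (_≡ᵇ 0) (count-agreeOn c V V' (λ k ck vk → ck ∧ lookup T k ∧ not vk) (λ _ _ → refl) ag))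
    (cong (λ t → t ≡ᵇ m + cardOn T c) (trans (count-cong (λ k → ∧-comm (lookup V k) (lookup c k))) (trans (count-agreeOn c V V' (λ _ → _∧_) (λ _ _ → refl) ag) (count-cong (λ k → ∧-comm (lookup c k) (lookup V' k))))))

  ΣS-cong : ∀ n {F G : Vec Bool n → ℕ} → (∀ s → F s ≡ G s) → ΣS n F ≡ ΣS n G
  ΣS-cong zero e = e []
  ΣS-cong (suc n) e = cong₂ _+_ (ΣS-cong n (λ s → e (true ∷ s))) (ΣS-cong n (λ s → e (false ∷ s)))

  ΣS-zero : ∀ n (F : Vec Bool n → ℕ) → (∀ s → F s ≡ 0) → ΣS n F ≡ 0
  ΣS-zero zero F e = e []
  ΣS-zero (suc n) F e = cong₂ _+_ (ΣS-zero n _ (λ s → e (true ∷ s))) (ΣS-zero n _ (λ s → e (false ∷ s)))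

  ΣS-xor : ∀ n (x : Vec Bool n) (F : Vec Bool n → ℕ) → ΣS n F ≡ ΣS n (λ W → F (xorV W x))
  ΣS-xor zero [] F = refl
  ΣS-xor (suc n) (false ∷ x) F = cong₂ _+_ (ΣS-xor n x (λ W → F (true ∷ W))) (ΣS-xor n x (λ W → F (false ∷ W)))
  ΣS-xor (suc n) (true ∷ x) F = trans (+-comm (ΣS n (λ W → F (true ∷ W))) _) (cong₂ _+_ (ΣS-xor n x (λ W → F (false ∷ W))) (ΣS-xor n x (λ W → F (true ∷ W))))

  ΣS-point : ∀ m (t : Vec Bool m) (X : ℕ) → ΣS m (λ s → ⟦ does (≡-dec _≟B_ s t) ⟧ * X) ≡ X
  ΣS-point zero [] X = +-identityʳ X
  ΣS-point (suc m) (true ∷ t) X = trans (cong₂ _+_ (ΣS-point m t X) (ΣS-zero m _ (λ _ → refl))) (+-identityʳ X)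
  ΣS-point (suc m) (false ∷ t) X = trans (cong₂ _+_ (ΣS-zero m _ (λ _ → refl)) (ΣS-point m t X)) refl

  superset-not-smaller : ∀ {n} (c S W : Vec Bool n) (X : ℕ) → ⟦ includedOn c S W ∧ (suc (cardOn W c) ≡ᵇ cardOn S c) ⟧ * X ≡ 0
  superset-not-smaller c S W X with includedOn c S W in e
  ... | false = refl
  ... | true with suc (cardOn W c) ≡ᵇ cardOn S c in e2
  ...   | false = refl
  ...   | true = ⊥-elim (1+n≰n (≤-trans (≤-reflexive (≡ᵇ⇒≡ _ _ (subst B.T (sym e2) _))) (includedOn-cardOn-≤ c S W e)))

  superset-not-smaller′ : ∀ {n} (A : Bool) (c S W : Vec Bool n) (X : ℕ) → ⟦ A ⟧ * (⟦ includedOn c S W ∧ (suc (cardOn W c) ≡ᵇ cardOn S c) ⟧ * X) ≡ 0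
  superset-not-smaller′ A c S W X = trans (cong (⟦ A ⟧ *_) (superset-not-smaller c S W X)) (*-zeroʳ ⟦ A ⟧)

  ΣS-above₀₀ : ∀ {n} (c S : Vec Bool n) (G : Vec Bool n → ℕ) →
    ΣS n (λ W → ⟦ Above 0 c S W ⟧ * (⟦ Above 0 (notV c) S W ⟧ * G W)) ≡ G S
  ΣS-above₀₀ [] [] G = trans (+-identityʳ _) (+-identityʳ _)
  ΣS-above₀₀ {suc n} (true ∷ c) (true ∷ S) G = trans (cong₂ _+_ (ΣS-above₀₀ c S (λ W → G (true ∷ W))) (ΣS-zero n _ (λ _ → refl))) (+-identityʳ _)
  ΣS-above₀₀ {suc n} (true ∷ c) (false ∷ S) G = cong₂ _+_ (ΣS-zero n _ (λ W → superset-not-smaller c S W _)) (ΣS-above₀₀ c S (λ W → G (false ∷ W)))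
  ΣS-above₀₀ {suc n} (false ∷ c) (true ∷ S) G = trans (cong₂ _+_ (ΣS-above₀₀ c S (λ W → G (true ∷ W))) (ΣS-zero n _ (λ W → *-zeroʳ ⟦ (Above 0 (false ∷ c) (true ∷ S) (false ∷ W)) ⟧))) (+-identityʳ _)
  ΣS-above₀₀ {suc n} (false ∷ c) (false ∷ S) G = cong₂ _+_ (ΣS-zero n _ (λ W → trans (cong (⟦ Above 0 (false ∷ c) (false ∷ S) (true ∷ W) ⟧ *_) (superset-not-smaller (notV c) S W _)) (*-zeroʳ ⟦ Above 0 (false ∷ c) (false ∷ S) (true ∷ W) ⟧))) (ΣS-above₀₀ c S (λ W → G (false ∷ W)))

  ΣS-above₁₀ : ∀ {n} (c S : Vec Bool n) (G : Vec Bool n → ℕ) →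
    ΣS n (λ W → ⟦ Above 1 c S W ⟧ * (⟦ Above 0 (notV c) S W ⟧ * G W)) ≡
    ΣF n (λ a → ⟦ lookup c a ∧ not (lookup S a) ⟧ * G (set S a true))
  ΣS-above₁₀ [] [] G = refl
  ΣS-above₁₀ {suc n} (true ∷ c) (true ∷ S) G = trans (cong₂ _+_ (ΣS-above₁₀ c S (λ W → G (true ∷ W))) (ΣS-zero n _ (λ _ → refl))) (+-identityʳ _)
  ΣS-above₁₀ {suc n} (true ∷ c) (false ∷ S) G = cong₂ _+_ (trans (ΣS-above₀₀ c S (λ W → G (true ∷ W))) (sym (*-identityˡ _))) (ΣS-above₁₀ c S (λ W → G (false ∷ W)))
  ΣS-above₁₀ {suc n} (false ∷ c) (true ∷ S) G = trans (cong₂ _+_ (ΣS-above₁₀ c S (λ W → G (true ∷ W))) (ΣS-zero n _ (λ W → *-zeroʳ ⟦ (Above 1 (false ∷ c) (true ∷ S) (false ∷ W)) ⟧))) (+-identityʳ _)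
  ΣS-above₁₀ {suc n} (false ∷ c) (false ∷ S) G = cong₂ _+_ (ΣS-zero n _ (λ W → superset-not-smaller′ (Above 1 (false ∷ c) (false ∷ S) (true ∷ W)) (notV c) S W (G (true ∷ W)))) (ΣS-above₁₀ c S (λ W → G (false ∷ W)))

  ΣS-above₀₁ : ∀ {n} (c S : Vec Bool n) (G : Vec Bool n → ℕ) →
    ΣS n (λ W → ⟦ Above 0 c S W ⟧ * (⟦ Above 1 (notV c) S W ⟧ * G W)) ≡
    ΣF n (λ b → ⟦ not (lookup c b) ∧ not (lookup S b) ⟧ * G (set S b true))
  ΣS-above₀₁ [] [] G = refl
  ΣS-above₀₁ {suc n} (true ∷ c) (true ∷ S) G = trans (cong₂ _+_ (ΣS-above₀₁ c S (λ W → G (true ∷ W))) (ΣS-zero n _ (λ _ → refl))) (+-identityʳ _)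
  ΣS-above₀₁ {suc n} (true ∷ c) (false ∷ S) G = cong₂ _+_ (ΣS-zero n _ (λ W → superset-not-smaller c S W _)) (ΣS-above₀₁ c S (λ W → G (false ∷ W)))
  ΣS-above₀₁ {suc n} (false ∷ c) (true ∷ S) G = trans (cong₂ _+_ (ΣS-above₀₁ c S (λ W → G (true ∷ W))) (ΣS-zero n _ (λ W → *-zeroʳ ⟦ (Above 0 (false ∷ c) (true ∷ S) (false ∷ W)) ⟧))) (+-identityʳ _)
  ΣS-above₀₁ {suc n} (false ∷ c) (false ∷ S) G = cong₂ _+_ (trans (ΣS-above₀₀ c S (λ W → G (true ∷ W))) (sym (*-identityˡ _))) (ΣS-above₀₁ c S (λ W → G (false ∷ W)))

  ΣS-above₁₁ : ∀ {n} (c S : Vec Bool n) (G : Vec Bool n → ℕ) →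
    ΣS n (λ W → ⟦ Above 1 c S W ⟧ * (⟦ Above 1 (notV c) S W ⟧ * G W)) ≡
    ΣF n (λ a → ⟦ lookup c a ∧ not (lookup S a) ⟧ *
      ΣF n (λ b → ⟦ not (lookup c b) ∧ not (lookup S b) ⟧ * G (set (set S a true) b true)))
  ΣS-above₁₁ [] [] G = refl
  ΣS-above₁₁ {suc n} (true ∷ c) (true ∷ S) G = trans (cong₂ _+_ (ΣS-above₁₁ c S (λ W → G (true ∷ W))) (ΣS-zero n _ (λ _ → refl))) (+-identityʳ _)
  ΣS-above₁₁ {suc n} (true ∷ c) (false ∷ S) G = cong₂ _+_ (trans (ΣS-above₀₁ c S (λ W → G (true ∷ W))) (sym (*-identityˡ _))) (ΣS-above₁₁ c S (λ W → G (false ∷ W)))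
  ΣS-above₁₁ {suc n} (false ∷ c) (true ∷ S) G = trans (cong₂ _+_ (ΣS-above₁₁ c S (λ W → G (true ∷ W))) (ΣS-zero n _ (λ W → *-zeroʳ ⟦ (Above 1 (false ∷ c) (true ∷ S) (false ∷ W)) ⟧))) (+-identityʳ _)
  ΣS-above₁₁ {suc n} (false ∷ c) (false ∷ S) G = trans (cong₂ _+_ (ΣS-above₁₀ c S (λ W → G (true ∷ W))) (ΣS-above₁₁ c S (λ W → G (false ∷ W)))) (ΣF-distr n (λ a → ⟦ lookup c a ∧ not (lookup S a) ⟧) (λ a → G (true ∷ set S a true)) (λ a → ΣF n (λ b → ⟦ not (lookup c b) ∧ not (lookup S b) ⟧ * G (false ∷ set (set S a true) b true))))

  ΣS-below₀₀ : ∀ {n} (c S : Vec Bool n) (G : Vec Bool n → ℕ) →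
    ΣS n (λ W → ⟦ Above 0 c W S ⟧ * (⟦ Above 0 (notV c) W S ⟧ * G W)) ≡ G S
  ΣS-below₀₀ [] [] G = trans (+-identityʳ _) (+-identityʳ _)
  ΣS-below₀₀ {suc n} (true ∷ c) (true ∷ S) G = trans (cong₂ _+_ (ΣS-below₀₀ c S (λ W → G (true ∷ W))) (ΣS-zero n _ (λ W → superset-not-smaller c W S _))) (+-identityʳ _)
  ΣS-below₀₀ {suc n} (true ∷ c) (false ∷ S) G = cong₂ _+_ (ΣS-zero n _ (λ _ → refl)) (ΣS-below₀₀ c S (λ W → G (false ∷ W)))
  ΣS-below₀₀ {suc n} (false ∷ c) (true ∷ S) G = trans (cong₂ _+_ (ΣS-below₀₀ c S (λ W → G (true ∷ W))) (ΣS-zero n _ (λ W → superset-not-smaller′ (Above 0 (false ∷ c) (false ∷ W) (true ∷ S)) (notV c) W S (G (false ∷ W))))) (+-identityʳ _)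
  ΣS-below₀₀ {suc n} (false ∷ c) (false ∷ S) G = cong₂ _+_ (ΣS-zero n _ (λ W → *-zeroʳ ⟦ (Above 0 (false ∷ c) (true ∷ W) (false ∷ S)) ⟧)) (ΣS-below₀₀ c S (λ W → G (false ∷ W)))

  ΣS-below₁₀ : ∀ {n} (c S : Vec Bool n) (G : Vec Bool n → ℕ) →
    ΣS n (λ W → ⟦ Above 1 c W S ⟧ * (⟦ Above 0 (notV c) W S ⟧ * G W)) ≡
    ΣF n (λ a → ⟦ lookup c a ∧ lookup S a ⟧ * G (set S a false))
  ΣS-below₁₀ [] [] G = refl
  ΣS-below₁₀ {suc n} (true ∷ c) (true ∷ S) G = trans (cong₂ _+_ (ΣS-below₁₀ c S (λ W → G (true ∷ W))) (trans (ΣS-below₀₀ c S (λ W → G (false ∷ W))) (sym (*-identityˡ (G (false ∷ S)))))) (+-comm (ΣF n (λ a → ⟦ lookup c a ∧ lookup S a ⟧ * G (true ∷ set S a false))) _)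
  ΣS-below₁₀ {suc n} (true ∷ c) (false ∷ S) G = cong₂ _+_ (ΣS-zero n _ (λ _ → refl)) (ΣS-below₁₀ c S (λ W → G (false ∷ W)))
  ΣS-below₁₀ {suc n} (false ∷ c) (true ∷ S) G = trans (cong₂ _+_ (ΣS-below₁₀ c S (λ W → G (true ∷ W))) (ΣS-zero n _ (λ W → superset-not-smaller′ (Above 1 (false ∷ c) (false ∷ W) (true ∷ S)) (notV c) W S (G (false ∷ W))))) (+-identityʳ _)
  ΣS-below₁₀ {suc n} (false ∷ c) (false ∷ S) G = cong₂ _+_ (ΣS-zero n _ (λ W → *-zeroʳ ⟦ (Above 1 (false ∷ c) (true ∷ W) (false ∷ S)) ⟧)) (ΣS-below₁₀ c S (λ W → G (false ∷ W)))

  ΣS-below₀₁ : ∀ {n} (c S : Vec Bool n) (G : Vec Bool n → ℕ) →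
    ΣS n (λ W → ⟦ Above 0 c W S ⟧ * (⟦ Above 1 (notV c) W S ⟧ * G W)) ≡
    ΣF n (λ b → ⟦ not (lookup c b) ∧ lookup S b ⟧ * G (set S b false))
  ΣS-below₀₁ [] [] G = refl
  ΣS-below₀₁ {suc n} (true ∷ c) (true ∷ S) G = trans (cong₂ _+_ (ΣS-below₀₁ c S (λ W → G (true ∷ W))) (ΣS-zero n _ (λ W → superset-not-smaller c W S _))) (+-identityʳ _)
  ΣS-below₀₁ {suc n} (true ∷ c) (false ∷ S) G = cong₂ _+_ (ΣS-zero n _ (λ _ → refl)) (ΣS-below₀₁ c S (λ W → G (false ∷ W)))
  ΣS-below₀₁ {suc n} (false ∷ c) (true ∷ S) G = trans (cong₂ _+_ (ΣS-below₀₁ c S (λ W → G (true ∷ W))) (trans (ΣS-below₀₀ c S (λ W → G (false ∷ W))) (sym (*-identityˡ (G (false ∷ S)))))) (+-comm (ΣF n (λ b → ⟦ not (lookup c b) ∧ lookup S b ⟧ * G (true ∷ set S b false))) _)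
  ΣS-below₀₁ {suc n} (false ∷ c) (false ∷ S) G = cong₂ _+_ (ΣS-zero n _ (λ W → *-zeroʳ ⟦ (Above 0 (false ∷ c) (true ∷ W) (false ∷ S)) ⟧)) (ΣS-below₀₁ c S (λ W → G (false ∷ W)))

  ΣS-below₁₁ : ∀ {n} (c S : Vec Bool n) (G : Vec Bool n → ℕ) →
    ΣS n (λ W → ⟦ Above 1 c W S ⟧ * (⟦ Above 1 (notV c) W S ⟧ * G W)) ≡
    ΣF n (λ a → ⟦ lookup c a ∧ lookup S a ⟧ *
      ΣF n (λ b → ⟦ not (lookup c b) ∧ lookup S b ⟧ * G (set (set S a false) b false)))
  ΣS-below₁₁ [] [] G = refl
  ΣS-below₁₁ {suc n} (true ∷ c) (true ∷ S) G = trans (cong₂ _+_ (ΣS-below₁₁ c S (λ W → G (true ∷ W))) (trans (ΣS-below₀₁ c S (λ W → G (false ∷ W))) (sym (*-identityˡ _)))) (+-comm (ΣF n (λ a → ⟦ lookup c a ∧ lookup S a ⟧ * ΣF n (λ b → ⟦ not (lookup c b) ∧ lookup S b ⟧ * G (true ∷ set (set S a false) b false)))) _)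
  ΣS-below₁₁ {suc n} (true ∷ c) (false ∷ S) G = cong₂ _+_ (ΣS-zero n _ (λ _ → refl)) (ΣS-below₁₁ c S (λ W → G (false ∷ W)))
  ΣS-below₁₁ {suc n} (false ∷ c) (true ∷ S) G = trans (cong₂ _+_ (ΣS-below₁₁ c S (λ W → G (true ∷ W))) (ΣS-below₁₀ c S (λ W → G (false ∷ W)))) (trans (+-comm (ΣF n (λ a → ⟦ lookup c a ∧ lookup S a ⟧ * ΣF n (λ b → ⟦ not (lookup c b) ∧ lookup S b ⟧ * G (true ∷ set (set S a false) b false)))) _) (ΣF-distr n (λ a → ⟦ lookup c a ∧ lookup S a ⟧) (λ a → G (false ∷ set S a false)) (λ a → ΣF n (λ b → ⟦ not (lookup c b) ∧ lookup S b ⟧ * G (true ∷ set (set S a false) b false)))))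
  ΣS-below₁₁ {suc n} (false ∷ c) (false ∷ S) G = cong₂ _+_ (ΣS-zero n _ (λ W → *-zeroʳ ⟦ (Above 1 (false ∷ c) (true ∷ W) (false ∷ S)) ⟧)) (ΣS-below₁₁ c S (λ W → G (false ∷ W)))

  data Step : Set where
    up down : Step

  avail : Step → Bool → Bool
  avail up   x = not x
  avail down x = x

  toggled : Step → Bool
  toggled up   = true
  toggled down = false

  Reaches : ∀ {n} → Step → (c V T : Vec Bool n) → Bool
  Reaches up   c V T = Above 1 c V T
  Reaches down c V T = Above 1 c T V

  Reaches-agreeˡ : ∀ {n} o (c V V' T : Vec Bool n) → AgreeOn c V V' → Reaches o c V T ≡ Reaches o c V' T
  Reaches-agreeˡ up   c V V' T ag = Above-agreeˡ 1 c V V' T ag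
  Reaches-agreeˡ down c V V' T ag = Above-agreeʳ 1 c T V V' ag

  Reaches-agreeʳ : ∀ {n} o (c V T T' : Vec Bool n) → AgreeOn c T T' → Reaches o c V T ≡ Reaches o c V T'
  Reaches-agreeʳ up   c V T T' ag = Above-agreeʳ 1 c V T T' ag
  Reaches-agreeʳ down c V T T' ag = Above-agreeˡ 1 c T T' V ag

  -- walks α β o c S T counts walks S → S₁ → S₂ → T with steps α, β, o in the subset lattice of the
  -- mask c; walks⊗ counts them in the product of the lattices of c and of its complement, where every
  -- step moves one element inside c and one outside.
  walks : ∀ {n} (α β o : Step) (c S T : Vec Bool n) → ℕ
  walks {n} α β o c S T = ΣF n (λ a → ⟦ lookup c a ∧ avail α (lookup S a) ⟧ *
    ΣF n (λ d → ⟦ lookup c d ∧ avail β (lookup (set S a (toggled α)) d) ⟧ * ⟦ Reaches o c (set (set S a (toggled α)) d (toggled β)) T ⟧))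

  tail⊗ : ∀ {n} (β o : Step) (c U T : Vec Bool n) → ℕ
  tail⊗ {n} β o c U T = ΣF n (λ d → ⟦ lookup c d ∧ avail β (lookup U d) ⟧ *
    ΣF n (λ e → ⟦ not (lookup c e) ∧ avail β (lookup U e) ⟧ *
      ⟦ Reaches o c (set (set U d (toggled β)) e (toggled β)) T ∧ Reaches o (notV c) (set (set U d (toggled β)) e (toggled β)) T ⟧))

  walks⊗ : ∀ {n} (α β o : Step) (c S T : Vec Bool n) → ℕ
  walks⊗ {n} α β o c S T = ΣF n (λ a → ⟦ lookup c a ∧ avail α (lookup S a) ⟧ *
    ΣF n (λ b → ⟦ not (lookup c b) ∧ avail α (lookup S b) ⟧ * tail⊗ β o c (set (set S a (toggled α)) b (toggled α)) T))

  cardOn-agree : ∀ {m} (msk V V' : Vec Bool m) → AgreeOn msk V V' → cardOn V msk ≡ cardOn V' msk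
  cardOn-agree msk V V' ag = count-cong pw
    where
    pw : ∀ j → (lookup V j ∧ lookup msk j) ≡ (lookup V' j ∧ lookup msk j)
    pw j with lookup msk j in e
    ... | true = cong (_∧ true) (ag j e)
    ... | false = trans (∧-comm (lookup V j) false) (∧-comm false (lookup V' j))

  ag-refl : ∀ {m} (msk V : Vec Bool m) → AgreeOn msk V V
  ag-refl msk V j _ = refl

  ag-skip : ∀ {m} (msk V V' : Vec Bool m) i b → AgreeOn msk V V' → lookup msk i ≡ false → AgreeOn msk (set V i b) V'
  ag-skip msk V V' i b ag mi j mj = trans (lookup-set-other V i j b (eqF-apart′ msk i j mi mj)) (ag j mj)

  ag-both : ∀ {m} (msk V V' : Vec Bool m) i b → AgreeOn msk V V' → AgreeOn msk (set V i b) (set V' i b)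
  ag-both msk V V' i b ag j mj = trans (lookup-set V i j b) (trans (cong (if eqF i j then b else_) (ag j mj)) (sym (lookup-set V' i j b)))

  walks-agreeʳ : ∀ {m} α β o (msk S T T' : Vec Bool m) → AgreeOn msk T T' → walks α β o msk S T ≡ walks α β o msk S T'
  walks-agreeʳ {m} α β o msk S T T' ag = ΣF-cong m (λ a → cong (⟦ lookup msk a ∧ avail α (lookup S a) ⟧ *_) (ΣF-cong m (λ d → cong (⟦ lookup msk d ∧ avail β (lookup (set S a (toggled α)) d) ⟧ *_) (cong ⟦_⟧ (Reaches-agreeʳ o msk (set (set S a (toggled α)) d (toggled β)) T T' ag)))))

  module _ {n} (α β o : Step) (c S T : Vec Bool n) where
    private
      nα = toggled α
      nβ = toggled β

      insideStep : Fin n → Fin n → ℕ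
      insideStep a d = ⟦ lookup c d ∧ avail β (lookup (set S a nα) d) ⟧ * ⟦ Reaches o c (set (set S a nα) d nβ) T ⟧

      insideTail : Fin n → ℕ
      insideTail a = ΣF n (insideStep a)

      outsideStep : Fin n → Fin n → ℕ
      outsideStep b e = ⟦ lookup (notV c) e ∧ avail β (lookup (set S b nα) e) ⟧ * ⟦ Reaches o (notV c) (set (set S b nα) e nβ) T ⟧

      outsideTail : Fin n → ℕ
      outsideTail b = ΣF n (outsideStep b)

      insideFirst : Fin n → ℕ
      insideFirst a = ⟦ lookup c a ∧ avail α (lookup S a) ⟧
      outsideFirst : Fin n → ℕ
      outsideFirst b = ⟦ not (lookup c b) ∧ avail α (lookup S b) ⟧

    tail⊗-factor : ∀ a b → lookup c a ≡ true → lookup c b ≡ false →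
      tail⊗ β o c (set (set S a nα) b nα) T ≡ insideTail a * outsideTail b
    tail⊗-factor a b ca cb = trans (ΣF-cong n step) (ΣF-*ʳ n (outsideTail b) (insideStep a))
      where
      U = set (set S a nα) b nα
      Ud : ∀ d → lookup c d ≡ true → lookup U d ≡ lookup (set S a nα) d
      Ud d cd = trans (lookup-set (set S a nα) b d nα) (cong (λ t → if t then nα else lookup (set S a nα) d) (eqF-apart′ c b d cb cd))
      Ue : ∀ e → lookup c e ≡ false → lookup U e ≡ lookup (set S b nα) e
      Ue e ce = trans (lookup-set (set S a nα) b e nα) (trans (cong (λ t → if eqF b e then nα else t) (trans (lookup-set S a e nα) (cong (λ t → if t then nα else lookup S e) (eqF-apart c a e ca ce)))) (sym (lookup-set S b e nα)))
      step : ∀ d → ⟦ lookup c d ∧ avail β (lookup U d) ⟧ *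
        ΣF n (λ e → ⟦ not (lookup c e) ∧ avail β (lookup U e) ⟧ *
          ⟦ Reaches o c (set (set U d nβ) e nβ) T ∧ Reaches o (notV c) (set (set U d nβ) e nβ) T ⟧)
        ≡ insideStep a d * outsideTail b
      step d with lookup c d in cd
      ... | false = refl
      ... | true = begin
          ⟦ avail β (lookup U d) ⟧ * ΣF n (λ e → ⟦ not (lookup c e) ∧ avail β (lookup U e) ⟧ * ⟦ X e ∧ Y e ⟧)
        ≡⟨ cong₂ (λ t s → ⟦ avail β t ⟧ * s) (Ud d cd) (ΣF-cong n inner) ⟩
          ⟦ avail β (lookup (set S a nα) d) ⟧ * ΣF n (λ e → ⟦ X' ⟧ * outsideStep b e)
        ≡⟨ cong (⟦ avail β (lookup (set S a nα) d) ⟧ *_) (ΣF-*ˡ n ⟦ X' ⟧ (outsideStep b)) ⟩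
          ⟦ avail β (lookup (set S a nα) d) ⟧ * (⟦ X' ⟧ * outsideTail b)
        ≡⟨ sym (*-assoc ⟦ avail β (lookup (set S a nα) d) ⟧ ⟦ X' ⟧ (outsideTail b)) ⟩
          (⟦ avail β (lookup (set S a nα) d) ⟧ * ⟦ X' ⟧) * outsideTail b ∎
        where
        open ≡-Reasoning
        X = λ e → Reaches o c (set (set U d nβ) e nβ) T
        Y = λ e → Reaches o (notV c) (set (set U d nβ) e nβ) T
        X' = Reaches o c (set (set S a nα) d nβ) T
        inner : ∀ e → ⟦ not (lookup c e) ∧ avail β (lookup U e) ⟧ * ⟦ X e ∧ Y e ⟧ ≡ ⟦ X' ⟧ * outsideStep b e
        inner e with lookup c e in ce
        ... | true = sym (trans (cong (λ t → ⟦ X' ⟧ * (⟦ t ∧ avail β (lookup (set S b nα) e) ⟧ * ⟦ Reaches o (notV c) (set (set S b nα) e nβ) T ⟧)) (trans (lookup-notV c e) (cong not ce))) (*-zeroʳ ⟦ X' ⟧))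
        ... | false = begin
            ⟦ avail β (lookup U e) ⟧ * ⟦ X e ∧ Y e ⟧
          ≡⟨ cong₂ (λ t s → ⟦ avail β t ⟧ * s) (Ue e ce) (⟦∧⟧ (X e) (Y e)) ⟩
            B' * (⟦ X e ⟧ * ⟦ Y e ⟧)
          ≡⟨ cong₂ (λ t s → B' * (⟦ t ⟧ * ⟦ s ⟧)) agX agY ⟩
            B' * (⟦ X' ⟧ * ⟦ Y' ⟧)
          ≡⟨ sym (*-assoc B' ⟦ X' ⟧ ⟦ Y' ⟧) ⟩
            (B' * ⟦ X' ⟧) * ⟦ Y' ⟧
          ≡⟨ cong (_* ⟦ Y' ⟧) (*-comm B' ⟦ X' ⟧) ⟩
            (⟦ X' ⟧ * B') * ⟦ Y' ⟧
          ≡⟨ *-assoc ⟦ X' ⟧ B' ⟦ Y' ⟧ ⟩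
            ⟦ X' ⟧ * (B' * ⟦ Y' ⟧)
          ≡⟨ cong (λ t → ⟦ X' ⟧ * (⟦ t ∧ avail β (lookup (set S b nα) e) ⟧ * ⟦ Y' ⟧)) (sym (trans (lookup-notV c e) (cong not ce))) ⟩
            ⟦ X' ⟧ * outsideStep b e ∎
          where
          B' = ⟦ avail β (lookup (set S b nα) e) ⟧
          Y' = Reaches o (notV c) (set (set S b nα) e nβ) T
          agX : X e ≡ X'
          agX = Reaches-agreeˡ o c _ _ T (λ k ck → trans (lookup-set (set U d nβ) e k nβ)
            (trans (cong (λ t → if t then nβ else lookup (set U d nβ) k) (eqF-apart′ c e k ce ck))
            (trans (lookup-set U d k nβ) (trans (cong (λ t → if eqF d k then nβ else t) (Ud k ck)) (sym (lookup-set (set S a nα) d k nβ))))))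
          agY : Y e ≡ Y'
          agY = Reaches-agreeˡ o (notV c) _ _ T (λ k nck → let ck = not-true (trans (sym (lookup-notV c k)) nck) in
            trans (lookup-set (set U d nβ) e k nβ)
            (trans (cong (λ t → if eqF e k then nβ else t) (trans (lookup-set U d k nβ) (trans (cong (λ t → if t then nβ else lookup U k) (eqF-apart c d k cd ck)) (Ue k ck))))
            (sym (lookup-set (set S b nα) e k nβ))))

    walks⊗-factor : walks⊗ α β o c S T ≡ walks α β o c S T * walks α β o (notV c) S T
    walks⊗-factor = begin
        walks⊗ α β o c S T
      ≡⟨ ΣF-cong-guarded n (λ a → lookup c a ∧ avail α (lookup S a)) _ (λ a → ΣF n (λ b → outsideFirst b * (insideTail a * outsideTail b)))
           (λ a ga → ΣF-cong-guarded n (λ b → not (lookup c b) ∧ avail α (lookup S b)) _ (λ b → insideTail a * outsideTail b)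
             (λ b gb → tail⊗-factor a b (∧-true₁ ga) (not-true (∧-true₁ gb)))) ⟩
        ΣF n (λ a → insideFirst a * ΣF n (λ b → outsideFirst b * (insideTail a * outsideTail b)))
      ≡⟨ ΣF-cong n (λ a → cong (insideFirst a *_) (trans (ΣF-cong n (λ b → trans (sym (*-assoc (outsideFirst b) (insideTail a) (outsideTail b))) (trans (cong (_* outsideTail b) (*-comm (outsideFirst b) (insideTail a))) (*-assoc (insideTail a) (outsideFirst b) (outsideTail b))))) (ΣF-*ˡ n (insideTail a) (λ b → outsideFirst b * outsideTail b)))) ⟩
        ΣF n (λ a → insideFirst a * (insideTail a * Z))
      ≡⟨ ΣF-cong n (λ a → sym (*-assoc (insideFirst a) (insideTail a) Z)) ⟩
        ΣF n (λ a → (insideFirst a * insideTail a) * Z)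
      ≡⟨ ΣF-*ʳ n Z (λ a → insideFirst a * insideTail a) ⟩
        walks α β o c S T * Z
      ≡⟨ cong (walks α β o c S T *_) (ΣF-cong n (λ b → cong (λ t → ⟦ t ∧ avail α (lookup S b) ⟧ * outsideTail b) (sym (lookup-notV c b)))) ⟩
        walks α β o c S T * walks α β o (notV c) S T ∎
      where
      open ≡-Reasoning
      Z = ΣF n (λ b → outsideFirst b * outsideTail b)

  module Cover {n} (c S : Vec Bool n) (p : Fin n) (cp : lookup c p ≡ true) (sp : lookup S p ≡ false) where
    T = set S p true

    module UpDownUp where

      first : Fin n → Bool
      first a = lookup c a ∧ not (lookup S a)
      second : Fin n → Fin n → Bool
      second a d = lookup c d ∧ lookup (set S a true) d

      included-a≡p : ∀ ck ed ea sk → (ck ∧ (if ed then false else (if ea then true else sk)) ∧ not (if ea then true else sk)) ≡ false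
      included-a≡p false ed ea sk = refl
      included-a≡p true true ea sk = refl
      included-a≡p true false true sk = refl
      included-a≡p true false false true = refl
      included-a≡p true false false false = refl

      included-a≡d : ∀ ck ea ep sk → (ck ∧ (if ea then false else (if ea then true else sk)) ∧ not (if ep then true else sk)) ≡ false
      included-a≡d false ea ep sk = refl
      included-a≡d true true ep sk = refl
      included-a≡d true false true true = refl
      included-a≡d true false true false = refl
      included-a≡d true false false true = refl
      included-a≡d true false false false = refl

      final≡ : ∀ a d → first a ≡ true → second a d ≡ true →
        ⟦ Above 1 c (set (set S a true) d false) T ⟧ ≡ ⟦ eqF a p ∨ eqF a d ⟧
      final≡ a d g1 g2 = trans (cong ⟦_⟧ (Above1-includedOn c V T card)) (cong ⟦_⟧ (main (eqF a p) refl (eqF a d) refl))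
        where
        V = set (set S a true) d false
        ca = ∧-true₁ g1
        sa = not-true (∧-true₂ g1)
        cd = ∧-true₁ g2
        sad = ∧-true₂ g2
        card : cardOn T c ≡ suc (cardOn V c)
        card = trans (cardOn-add S c p cp sp) (cong suc (sym (suc-injective (trans (cardOn-del (set S a true) c d cd sad) (cardOn-add S c a ca sa)))))
        main : ∀ b1 → eqF a p ≡ b1 → ∀ b2 → eqF a d ≡ b2 → includedOn c V T ≡ (b1 ∨ b2)
        main true e1 b2 e2 with eqF-≡ a p e1
        ... | refl = includedOn-true c V T (λ k → trans (cong₂ (λ u w → lookup c k ∧ u ∧ not w) (lookup-set² S a true d false k) (lookup-set S a k true)) (included-a≡p (lookup c k) (eqF d k) (eqF a k) (lookup S k)))
        main false e1 true e2 with eqF-≡ a d e2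
        ... | refl = includedOn-true c V T (λ k → trans (cong₂ (λ u w → lookup c k ∧ u ∧ not w) (lookup-set² S a true a false k) (lookup-set S p k true)) (included-a≡d (lookup c k) (eqF a k) (eqF p k) (lookup S k)))
        main false e1 false e2 = includedOn-false c V T a (trans (cong₂ (λ u w → lookup c a ∧ u ∧ not w) Va Ta) (cong (λ u → u ∧ true) ca))
          where
          Va : lookup V a ≡ true
          Va = trans (lookup-set² S a true d false a) (cong₂ (λ u w → if u then false else (if w then true else lookup S a)) (trans (eqF-sym d a) e2) (eqF-refl a))
          Ta : lookup T a ≡ false
          Ta = trans (lookup-set S p a true) (trans (cong (λ u → if u then true else lookup S a) (trans (eqF-sym p a) e1)) sa)

      h : Fin n → ℕ
      h a = if eqF a p then suc (cardOn S c) else 1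

      inner : ∀ a → first a ≡ true → ΣF n (λ d → ⟦ second a d ⟧ * ⟦ Above 1 c (set (set S a true) d false) T ⟧) ≡ h a
      inner a g1 = trans (ΣF-cong-guarded n (second a) _ _ (λ d g2 → final≡ a d g1 g2)) (ev (eqF a p) refl)
        where
        ev : ∀ b → eqF a p ≡ b → ΣF n (λ d → ⟦ second a d ⟧ * ⟦ b ∨ eqF a d ⟧) ≡ (if b then suc (cardOn S c) else 1)
        ev true e = trans (ΣF-const1 n (second a)) (trans (count-cardOn (set S a true) c) (cardOn-add S c a (∧-true₁ g1) (not-true (∧-true₂ g1))))
        ev false e = trans (ΣF-point′ n (second a) a) (trans (cong (λ t → ⟦ lookup c a ∧ t ⟧) (lookup-set-same S a true)) (cong (λ t → ⟦ t ∧ true ⟧) (∧-true₁ g1)))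

      walks-count : walks up down up c S T ≡ cardOn S c + count first
      walks-count = begin
          walks up down up c S T
        ≡⟨ ΣF-cong-guarded n first _ h inner ⟩
          ΣF n (λ a → ⟦ first a ⟧ * h a)
        ≡⟨ split-guard n first h p g1p ⟩
          h p + ΣF n (λ a → ⟦ first a ∧ not (eqF p a) ⟧ * h a)
        ≡⟨ cong₂ _+_ (cong (λ t → if t then suc (cardOn S c) else 1) (eqF-refl p)) (trans (ΣF-cong-guarded n _ h (λ _ → 1) rest) (ΣF-const1 n _)) ⟩
          suc (cardOn S c) + count (λ a → first a ∧ not (eqF p a))
        ≡⟨ sym (+-suc (cardOn S c) _) ⟩
          cardOn S c + suc (count (λ a → first a ∧ not (eqF p a)))
        ≡⟨ cong (cardOn S c +_) (sym (count-remove first p g1p)) ⟩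
          cardOn S c + count first ∎
        where
        open ≡-Reasoning
        g1p : first p ≡ true
        g1p = trans (cong₂ (λ u w → u ∧ not w) cp sp) refl
        rest : ∀ a → (first a ∧ not (eqF p a)) ≡ true → h a ≡ 1
        rest a g = cong (λ t → if t then suc (cardOn S c) else 1) (trans (eqF-sym a p) (not-true (∧-true₂ {first a} g)))

    module DownUpUp where

      first : Fin n → Bool
      first a = lookup c a ∧ lookup S a
      second : Fin n → Fin n → Bool
      second a d = lookup c d ∧ not (lookup (set S a false) d)

      included-a≡d : ∀ ck ea ep sk → (ea ≡ true → sk ≡ true) → (ck ∧ (if ea then true else (if ea then false else sk)) ∧ not (if ep then true else sk)) ≡ false
      included-a≡d false ea ep sk _ = refl
      included-a≡d true true true sk _ = refl
      included-a≡d true true false sk f rewrite f refl = refl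
      included-a≡d true false true true _ = refl
      included-a≡d true false true false _ = refl
      included-a≡d true false false true _ = refl
      included-a≡d true false false false _ = refl

      included-p≡d : ∀ ck ep ea sk → (ck ∧ (if ep then true else (if ea then false else sk)) ∧ not (if ep then true else sk)) ≡ false
      included-p≡d false ep ea sk = refl
      included-p≡d true true ea sk = refl
      included-p≡d true false true sk = refl
      included-p≡d true false false true = refl
      included-p≡d true false false false = refl

      final≡ : ∀ a d → first a ≡ true → second a d ≡ true →
        ⟦ Above 1 c (set (set S a false) d true) T ⟧ ≡ ⟦ eqF a d ∨ eqF p d ⟧
      final≡ a d g1 g2 = trans (cong ⟦_⟧ (Above1-includedOn c V T card)) (cong ⟦_⟧ (main (eqF a d) refl (eqF p d) refl))
        where
        V = set (set S a false) d true
        ca = ∧-true₁ g1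
        sa = ∧-true₂ g1
        cd = ∧-true₁ g2
        sad = not-true (∧-true₂ g2)
        card : cardOn T c ≡ suc (cardOn V c)
        card = trans (cardOn-add S c p cp sp) (cong suc (trans (sym (cardOn-del S c a ca sa)) (sym (cardOn-add (set S a false) c d cd sad))))
        main : ∀ b1 → eqF a d ≡ b1 → ∀ b2 → eqF p d ≡ b2 → includedOn c V T ≡ (b1 ∨ b2)
        main true e1 b2 e2 with eqF-≡ a d e1
        ... | refl = includedOn-true c V T (λ k → trans (cong₂ (λ u w → lookup c k ∧ u ∧ not w) (lookup-set² S a false a true k) (lookup-set S p k true))
            (included-a≡d (lookup c k) (eqF a k) (eqF p k) (lookup S k) (λ e → subst (λ t → lookup S t ≡ true) (eqF-≡ a k e) sa)))
        main false e1 true e2 with eqF-≡ p d e2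
        ... | refl = includedOn-true c V T (λ k → trans (cong₂ (λ u w → lookup c k ∧ u ∧ not w) (lookup-set² S a false p true k) (lookup-set S p k true))
            (included-p≡d (lookup c k) (eqF p k) (eqF a k) (lookup S k)))
        main false e1 false e2 = includedOn-false c V T d (trans (cong₂ (λ u w → lookup c d ∧ u ∧ not w) Vd Td) (cong (λ u → u ∧ true) cd))
          where
          Vd : lookup V d ≡ true
          Vd = lookup-set-same (set S a false) d true
          Sd : lookup S d ≡ false
          Sd = trans (sym (lookup-set-other S a d false e1)) sad
          Td : lookup T d ≡ false
          Td = trans (lookup-set-other S p d true e2) Sd

      inner : ∀ a → first a ≡ true → ΣF n (λ d → ⟦ second a d ⟧ * ⟦ Above 1 c (set (set S a false) d true) T ⟧) ≡ 2
      inner a g1 = trans (ΣF-cong-guarded n (second a) _ _ (λ d g2 → final≡ a d g1 g2))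
        (trans (ΣF-two-points n (second a) a p (eqF-apart S a p (∧-true₂ g1) sp)) (cong₂ _+_ g2a g2p))
        where
        g2a : ⟦ second a a ⟧ ≡ 1
        g2a = trans (cong (λ t → ⟦ t ∧ not (lookup (set S a false) a) ⟧) (∧-true₁ g1)) (cong (λ t → ⟦ not t ⟧) (lookup-set-same S a false))
        g2p : ⟦ second a p ⟧ ≡ 1
        g2p = cong₂ (λ t u → ⟦ t ∧ not u ⟧) cp (trans (lookup-set-other S a p false (eqF-apart S a p (∧-true₂ g1) sp)) sp)

      walks-count : walks down up up c S T ≡ cardOn S c * 2
      walks-count = trans (ΣF-cong-guarded n first _ (λ _ → 2) inner) (trans (ΣF-*ʳ n 2 (λ a → ⟦ first a ⟧)) (cong (_* 2) (count-cardOn S c)))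

    module UpUpDown where

      first : Fin n → Bool
      first a = lookup c a ∧ not (lookup S a)
      second : Fin n → Fin n → Bool
      second a d = lookup c d ∧ not (lookup (set S a true) d)

      included-a≡p : ∀ ck ea ed sk → (ck ∧ (if ea then true else sk) ∧ not (if ed then true else (if ea then true else sk))) ≡ false
      included-a≡p false ea ed sk = refl
      included-a≡p true true true sk = refl
      included-a≡p true true false sk = refl
      included-a≡p true false true true = refl
      included-a≡p true false true false = refl
      included-a≡p true false false true = refl
      included-a≡p true false false false = refl

      included-p≡d : ∀ ck ed ea sk → (ck ∧ (if ed then true else sk) ∧ not (if ed then true else (if ea then true else sk))) ≡ false
      included-p≡d false ed ea sk = refl
      included-p≡d true true ea sk = refl
      included-p≡d true false true true = refl
      included-p≡d true false true false = refl
      included-p≡d true false false true = refl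
      included-p≡d true false false false = refl

      final≡ : ∀ a d → first a ≡ true → second a d ≡ true →
        ⟦ Above 1 c T (set (set S a true) d true) ⟧ ≡ ⟦ eqF a p ∨ eqF p d ⟧
      final≡ a d g1 g2 = trans (cong ⟦_⟧ (Above1-includedOn c T W card)) (cong ⟦_⟧ (main (eqF a p) refl (eqF p d) refl))
        where
        W = set (set S a true) d true
        ca = ∧-true₁ g1
        sa = not-true (∧-true₂ g1)
        cd = ∧-true₁ g2
        sad = not-true (∧-true₂ g2)
        card : cardOn W c ≡ suc (cardOn T c)
        card = trans (cardOn-add (set S a true) c d cd sad) (cong suc (trans (cardOn-add S c a ca sa) (sym (cardOn-add S c p cp sp))))
        main : ∀ b1 → eqF a p ≡ b1 → ∀ b2 → eqF p d ≡ b2 → includedOn c T W ≡ (b1 ∨ b2)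
        main true e1 b2 e2 with eqF-≡ a p e1
        ... | refl = includedOn-true c T W (λ k → trans (cong₂ (λ u w → lookup c k ∧ u ∧ not w) (lookup-set S a k true) (lookup-set² S a true d true k))
            (included-a≡p (lookup c k) (eqF a k) (eqF d k) (lookup S k)))
        main false e1 true e2 with eqF-≡ p d e2
        ... | refl = includedOn-true c T W (λ k → trans (cong₂ (λ u w → lookup c k ∧ u ∧ not w) (lookup-set S p k true) (lookup-set² S a true p true k))
            (included-p≡d (lookup c k) (eqF p k) (eqF a k) (lookup S k)))
        main false e1 false e2 = includedOn-false c T W p (trans (cong₂ (λ u w → lookup c p ∧ u ∧ not w) (lookup-set-same S p true) Wp) (cong (λ u → u ∧ true) cp))
          where
          Wp : lookup W p ≡ false
          Wp = trans (lookup-set² S a true d true p) (trans (cong₂ (λ u w → if u then true else (if w then true else lookup S p)) (trans (eqF-sym d p) e2) e1) sp)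

      M = count (λ a → first a ∧ not (eqF p a))

      h : Fin n → ℕ
      h a = if eqF a p then M else 1

      inner : ∀ a → first a ≡ true → ΣF n (λ d → ⟦ second a d ⟧ * ⟦ Above 1 c T (set (set S a true) d true) ⟧) ≡ h a
      inner a g1 = trans (ΣF-cong-guarded n (second a) _ _ (λ d g2 → final≡ a d g1 g2)) (ev (eqF a p) refl)
        where
        ev : ∀ b → eqF a p ≡ b → ΣF n (λ d → ⟦ second a d ⟧ * ⟦ b ∨ eqF p d ⟧) ≡ (if b then M else 1)
        ev true e with eqF-≡ a p e
        ... | refl = trans (ΣF-const1 n (second a)) (count-cong pw)
          where
          pw : ∀ k → second a k ≡ (first k ∧ not (eqF a k))
          pw k = trans (cong (λ t → lookup c k ∧ not t) (lookup-set S a k true)) (bb (lookup c k) (eqF a k) (lookup S k))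
            where bb : ∀ ck e sk → (ck ∧ not (if e then true else sk)) ≡ ((ck ∧ not sk) ∧ not e)
                  bb true true true = refl
                  bb true true false = refl
                  bb true false true = refl
                  bb true false false = refl
                  bb false e sk = refl
        ev false e = trans (ΣF-point′ n (second a) p) (cong₂ (λ t u → ⟦ t ∧ not u ⟧) cp (trans (lookup-set-other S a p true e) sp))

      walks-count : walks up up down c S T ≡ M + M
      walks-count = begin
          walks up up down c S T
        ≡⟨ ΣF-cong-guarded n first _ h inner ⟩
          ΣF n (λ a → ⟦ first a ⟧ * h a)
        ≡⟨ split-guard n first h p g1p ⟩
          h p + ΣF n (λ a → ⟦ first a ∧ not (eqF p a) ⟧ * h a)
        ≡⟨ cong₂ _+_ (cong (λ t → if t then M else 1) (eqF-refl p)) (trans (ΣF-cong-guarded n _ h (λ _ → 1) rest) (ΣF-const1 n _)) ⟩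
          M + M ∎
        where
        open ≡-Reasoning
        g1p : first p ≡ true
        g1p = trans (cong₂ (λ u w → u ∧ not w) cp sp) refl
        rest : ∀ a → (first a ∧ not (eqF p a)) ≡ true → h a ≡ 1
        rest a g = cong (λ t → if t then M else 1) (trans (eqF-sym a p) (not-true (∧-true₂ {first a} g)))

      M-prop : count first ≡ suc M
      M-prop = count-remove first p (trans (cong₂ (λ u w → u ∧ not w) cp sp) refl)

  module Far {n} (c S : Vec Bool n) (q r s : Fin n)
    (cq : lookup c q ≡ true) (sq : lookup S q ≡ true)
    (cr : lookup c r ≡ true) (sr : lookup S r ≡ false)
    (cs : lookup c s ≡ true) (ss : lookup S s ≡ false)
    (rs : eqF r s ≡ false) where

    T = set (set (set S q false) r true) s true

    qr : eqF q r ≡ false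
    qr = eqF-apart S q r sq sr
    qs : eqF q s ≡ false
    qs = eqF-apart S q s sq ss
    sr' : eqF s r ≡ false
    sr' = trans (eqF-sym s r) rs

    Tq : lookup T q ≡ false
    Tq = trans (lookup-set³ S q false r true s true q) (trans (cong₂ (λ u w → if u then true else (if w then true else (if eqF q q then false else lookup S q))) (trans (eqF-sym s q) qs) (trans (eqF-sym r q) qr)) (cong (λ u → if u then false else lookup S q) (eqF-refl q)))
    Tr : lookup T r ≡ true
    Tr = trans (lookup-set³ S q false r true s true r) (cong₂ (λ u w → if u then true else (if w then true else (if eqF q r then false else lookup S r))) sr' (eqF-refl r))
    Ts : lookup T s ≡ true
    Ts = trans (lookup-set³ S q false r true s true s) (cong (λ u → if u then true else (if eqF r s then true else (if eqF q s then false else lookup S s))) (eqF-refl s))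
    Tk : ∀ k → eqF s k ≡ false → eqF r k ≡ false → eqF q k ≡ false → lookup T k ≡ lookup S k
    Tk k e1 e2 e3 = trans (lookup-set³ S q false r true s true k) (trans (cong₂ (λ u w → if u then true else (if w then true else (if eqF q k then false else lookup S k))) e1 e2) (cong (λ u → if u then false else lookup S k) e3))

    cardT : cardOn T c ≡ suc (cardOn S c)
    cardT = trans (cardOn-add (set (set S q false) r true) c s cs T2s)
      (cong suc (trans (cardOn-add (set S q false) c r cr T1r) (cardOn-del S c q cq sq)))
      where
      T1r : lookup (set S q false) r ≡ false
      T1r = trans (lookup-set-other S q r false qr) sr
      T2s : lookup (set (set S q false) r true) s ≡ false
      T2s = trans (lookup-set-other (set S q false) r s true rs) (trans (lookup-set-other S q s false qs) ss)

    module UpDownUp where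
      first : Fin n → Bool
      first a = lookup c a ∧ not (lookup S a)
      second : Fin n → Fin n → Bool
      second a d = lookup c d ∧ lookup (set S a true) d

      included-a≡r : ∀ ck eq er es sk → (ck ∧ (if eq then false else (if er then true else sk)) ∧ not (if es then true else (if er then true else (if eq then false else sk)))) ≡ false
      included-a≡r false eq er es sk = refl
      included-a≡r true true er es sk = refl
      included-a≡r true false true true sk = refl
      included-a≡r true false true false sk = refl
      included-a≡r true false false true true = refl
      included-a≡r true false false true false = refl
      included-a≡r true false false false true = refl
      included-a≡r true false false false false = refl

      included-a≡s : ∀ ck eq er es sk → (ck ∧ (if eq then false else (if es then true else sk)) ∧ not (if es then true else (if er then true else (if eq then false else sk)))) ≡ false
      included-a≡s false eq er es sk = refl
      included-a≡s true true er es sk = refl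
      included-a≡s true false er true sk = refl
      included-a≡s true false true false true = refl
      included-a≡s true false true false false = refl
      included-a≡s true false false false true = refl
      included-a≡s true false false false false = refl

      final≡ : ∀ a d → first a ≡ true → second a d ≡ true →
        ⟦ Above 1 c (set (set S a true) d false) T ⟧ ≡ ⟦ (eqF r a ∨ eqF s a) ∧ eqF q d ⟧
      final≡ a d g1 g2 = trans (cong ⟦_⟧ (Above1-includedOn c V T card)) (cong ⟦_⟧ (main (eqF r a) refl (eqF s a) refl (eqF q d) refl))
        where
        V = set (set S a true) d false
        ca = ∧-true₁ g1
        sa = not-true (∧-true₂ g1)
        cd = ∧-true₁ g2
        sad = ∧-true₂ g2
        aq : eqF a q ≡ false
        aq = trans (eqF-sym a q) (eqF-apart S q a sq sa)
        card : cardOn T c ≡ suc (cardOn V c)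
        card = trans cardT (cong suc (sym (suc-injective (trans (cardOn-del (set S a true) c d cd sad) (cardOn-add S c a ca sa)))))
        main : ∀ b1 → eqF r a ≡ b1 → ∀ b2 → eqF s a ≡ b2 → ∀ b3 → eqF q d ≡ b3 → includedOn c V T ≡ ((b1 ∨ b2) ∧ b3)
        main b1 e1 b2 e2 false e3 = trans (includedOn-false c V T q (trans (cong₂ (λ u w → lookup c q ∧ u ∧ not w) Vq Tq) (cong (λ u → u ∧ true) cq))) (sym (∧-zeroʳ (b1 ∨ b2)))
          where
          Vq : lookup V q ≡ true
          Vq = trans (lookup-set² S a true d false q) (trans (cong₂ (λ u w → if u then false else (if w then true else lookup S q)) (trans (eqF-sym d q) e3) aq) sq)
        main true e1 b2 e2 true e3 with eqF-≡ r a e1 | eqF-≡ q d e3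
        ... | refl | refl = includedOn-true c V T (λ k → trans (cong₂ (λ u w → lookup c k ∧ u ∧ not w) (lookup-set² S r true q false k) (lookup-set³ S q false r true s true k)) (included-a≡r (lookup c k) (eqF q k) (eqF r k) (eqF s k) (lookup S k)))
        main false e1 true e2 true e3 with eqF-≡ s a e2 | eqF-≡ q d e3
        ... | refl | refl = includedOn-true c V T (λ k → trans (cong₂ (λ u w → lookup c k ∧ u ∧ not w) (lookup-set² S s true q false k) (lookup-set³ S q false r true s true k)) (included-a≡s (lookup c k) (eqF q k) (eqF r k) (eqF s k) (lookup S k)))
        main false e1 false e2 true e3 with eqF-≡ q d e3
        ... | refl = includedOn-false c V T a (trans (cong₂ (λ u w → lookup c a ∧ u ∧ not w) Va Ta) (cong (λ u → u ∧ true) ca))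
          where
          Va : lookup V a ≡ true
          Va = trans (lookup-set² S a true q false a) (cong₂ (λ u w → if u then false else (if w then true else lookup S a)) (trans (eqF-sym q a) aq) (eqF-refl a))
          Ta : lookup T a ≡ false
          Ta = trans (Tk a e2 e1 (trans (eqF-sym q a) aq)) sa

      inner : ∀ a → first a ≡ true → ΣF n (λ d → ⟦ second a d ⟧ * ⟦ Above 1 c (set (set S a true) d false) T ⟧) ≡ ⟦ eqF r a ∨ eqF s a ⟧
      inner a g1 = trans (ΣF-cong-guarded n (second a) _ _ (λ d g2 → final≡ a d g1 g2)) (ev (eqF r a ∨ eqF s a))
        where
        ev : ∀ b → ΣF n (λ d → ⟦ second a d ⟧ * ⟦ b ∧ eqF q d ⟧) ≡ ⟦ b ⟧
        ev true = trans (ΣF-point′ n (second a) q) (cong₂ (λ u w → ⟦ u ∧ w ⟧) cq (trans (lookup-set-other S a q true (trans (eqF-sym a q) (eqF-apart S q a sq (not-true (∧-true₂ g1))))) sq))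
        ev false = ΣF-zero' n _ (λ d → *-zeroʳ ⟦ second a d ⟧)

      walks-count : walks up down up c S T ≡ 2
      walks-count = trans (ΣF-cong-guarded n first _ _ inner) (trans (ΣF-two-points n first r s rs) (cong₂ (λ u w → ⟦ u ⟧ + ⟦ w ⟧) (trans (cong₂ (λ u w → u ∧ not w) cr sr) refl) (trans (cong₂ (λ u w → u ∧ not w) cs ss) refl)))

    module DownUpUp where
      first : Fin n → Bool
      first a = lookup c a ∧ lookup S a
      second : Fin n → Fin n → Bool
      second a d = lookup c d ∧ not (lookup (set S a false) d)

      if-same : ∀ x → (if x then true else true) ≡ true
      if-same true = refl
      if-same false = refl

      included-d≡r : ∀ ck eq er es sk → (ck ∧ (if er then true else (if eq then false else sk)) ∧ not (if es then true else (if er then true else (if eq then false else sk)))) ≡ false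
      included-d≡r false eq er es sk = refl
      included-d≡r true eq true true sk = refl
      included-d≡r true eq true false sk = refl
      included-d≡r true true false es sk = refl
      included-d≡r true false false true true = refl
      included-d≡r true false false true false = refl
      included-d≡r true false false false true = refl
      included-d≡r true false false false false = refl

      included-d≡s : ∀ ck eq er es sk → (ck ∧ (if es then true else (if eq then false else sk)) ∧ not (if es then true else (if er then true else (if eq then false else sk)))) ≡ false
      included-d≡s false eq er es sk = refl
      included-d≡s true eq er true sk = refl
      included-d≡s true true er false sk = refl
      included-d≡s true false true false true = refl
      included-d≡s true false true false false = refl
      included-d≡s true false false false true = refl
      included-d≡s true false false false false = refl

      final≡ : ∀ a d → first a ≡ true → second a d ≡ true →
        ⟦ Above 1 c (set (set S a false) d true) T ⟧ ≡ ⟦ eqF q a ∧ (eqF r d ∨ eqF s d) ⟧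
      final≡ a d g1 g2 = trans (cong ⟦_⟧ (Above1-includedOn c V T card)) (cong ⟦_⟧ (main (eqF q a) refl (eqF r d) refl (eqF s d) refl))
        where
        V = set (set S a false) d true
        ca = ∧-true₁ g1
        sa = ∧-true₂ g1
        cd = ∧-true₁ g2
        sad = not-true (∧-true₂ g2)
        card : cardOn T c ≡ suc (cardOn V c)
        card = trans cardT (cong suc (trans (sym (cardOn-del S c a ca sa)) (sym (cardOn-add (set S a false) c d cd sad))))
        main : ∀ b1 → eqF q a ≡ b1 → ∀ b2 → eqF r d ≡ b2 → ∀ b3 → eqF s d ≡ b3 → includedOn c V T ≡ (b1 ∧ (b2 ∨ b3))
        main false e1 b2 e2 b3 e3 = includedOn-false c V T q (trans (cong₂ (λ u w → lookup c q ∧ u ∧ not w) Vq Tq) (cong (λ u → u ∧ true) cq))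
          where
          Vq : lookup V q ≡ true
          Vq = trans (lookup-set² S a false d true q) (trans (cong₂ (λ u w → if eqF d q then true else (if u then false else w)) (trans (eqF-sym a q) e1) sq) (if-same (eqF d q)))
        main true e1 true e2 b3 e3 with eqF-≡ q a e1 | eqF-≡ r d e2
        ... | refl | refl = includedOn-true c V T (λ k → trans (cong₂ (λ u w → lookup c k ∧ u ∧ not w) (lookup-set² S q false r true k) (lookup-set³ S q false r true s true k)) (included-d≡r (lookup c k) (eqF q k) (eqF r k) (eqF s k) (lookup S k)))
        main true e1 false e2 true e3 with eqF-≡ q a e1 | eqF-≡ s d e3
        ... | refl | refl = includedOn-true c V T (λ k → trans (cong₂ (λ u w → lookup c k ∧ u ∧ not w) (lookup-set² S q false s true k) (lookup-set³ S q false r true s true k)) (included-d≡s (lookup c k) (eqF q k) (eqF r k) (eqF s k) (lookup S k)))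
        main true e1 false e2 false e3 with eqF-≡ q a e1
        ... | refl = includedOn-false c V T d (trans (cong₂ (λ u w → lookup c d ∧ u ∧ not w) (lookup-set-same (set S q false) d true) (Td (eqF q d) refl)) (cong (λ u → u ∧ true) cd))
          where
          Td : ∀ b → eqF q d ≡ b → lookup T d ≡ false
          Td true e with eqF-≡ q d e
          ... | refl = Tq
          Td false e = trans (Tk d e3 e2 e) (trans (sym (lookup-set-other S q d false e)) sad)

      inner : ∀ a → first a ≡ true → ΣF n (λ d → ⟦ second a d ⟧ * ⟦ Above 1 c (set (set S a false) d true) T ⟧) ≡ ⟦ eqF q a ⟧ * 2
      inner a g1 = trans (ΣF-cong-guarded n (second a) _ _ (λ d g2 → final≡ a d g1 g2)) (ev (eqF q a))
        where
        sa = ∧-true₂ g1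
        ev : ∀ b → ΣF n (λ d → ⟦ second a d ⟧ * ⟦ b ∧ (eqF r d ∨ eqF s d) ⟧) ≡ ⟦ b ⟧ * 2
        ev true = trans (ΣF-two-points n (second a) r s rs) (cong₂ _+_
          (cong₂ (λ u w → ⟦ u ∧ not w ⟧) cr (trans (lookup-set-other S a r false (eqF-apart S a r sa sr)) sr))
          (cong₂ (λ u w → ⟦ u ∧ not w ⟧) cs (trans (lookup-set-other S a s false (eqF-apart S a s sa ss)) ss)))
        ev false = ΣF-zero' n _ (λ d → *-zeroʳ ⟦ second a d ⟧)

      walks-count : walks down up up c S T ≡ 2
      walks-count = trans (ΣF-cong-guarded n first _ _ inner) (trans (ΣF-cong n (λ a → trans (sym (*-assoc ⟦ first a ⟧ ⟦ eqF q a ⟧ 2)) (trans (cong (_* 2) (*-comm ⟦ first a ⟧ ⟦ eqF q a ⟧)) (*-assoc ⟦ eqF q a ⟧ ⟦ first a ⟧ 2))))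
        (trans (ΣF-point n q (λ a → ⟦ first a ⟧ * 2)) (cong (λ u → ⟦ u ⟧ * 2) (trans (cong₂ _∧_ cq sq) refl))))

    module UpUpDown where
      first : Fin n → Bool
      first a = lookup c a ∧ not (lookup S a)
      second : Fin n → Fin n → Bool
      second a d = lookup c d ∧ not (lookup (set S a true) d)

      included-rs : ∀ ck eq er es sk → (ck ∧ (if es then true else (if er then true else (if eq then false else sk))) ∧ not (if es then true else (if er then true else sk))) ≡ false
      included-rs false eq er es sk = refl
      included-rs true eq er true sk = refl
      included-rs true eq true false sk = refl
      included-rs true true false false sk = refl
      included-rs true false false false true = refl
      included-rs true false false false false = refl

      included-sr : ∀ ck eq er es sk → (ck ∧ (if es then true else (if er then true else (if eq then false else sk))) ∧ not (if er then true else (if es then true else sk))) ≡ false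
      included-sr false eq er es sk = refl
      included-sr true true true true true = refl
      included-sr true true true true false = refl
      included-sr true true true false true = refl
      included-sr true true true false false = refl
      included-sr true true false true true = refl
      included-sr true true false true false = refl
      included-sr true true false false true = refl
      included-sr true true false false false = refl
      included-sr true false true true true = refl
      included-sr true false true true false = refl
      included-sr true false true false true = refl
      included-sr true false true false false = refl
      included-sr true false false true true = refl
      included-sr true false false true false = refl
      included-sr true false false false true = refl
      included-sr true false false false false = refl

      final≡ : ∀ a d → first a ≡ true → second a d ≡ true →
        ⟦ Above 1 c T (set (set S a true) d true) ⟧ ≡ ⟦ (eqF r a ∧ eqF s d) ∨ (eqF s a ∧ eqF r d) ⟧
      final≡ a d g1 g2 = trans (cong ⟦_⟧ (Above1-includedOn c T W card)) (cong ⟦_⟧ (main (eqF r a) refl (eqF s d) refl (eqF s a) refl (eqF r d) refl))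
        where
        W = set (set S a true) d true
        ca = ∧-true₁ g1
        sa = not-true (∧-true₂ g1)
        cd = ∧-true₁ g2
        sad = not-true (∧-true₂ g2)
        card : cardOn W c ≡ suc (cardOn T c)
        card = trans (cardOn-add (set S a true) c d cd sad) (cong suc (trans (cardOn-add S c a ca sa) (sym cardT)))
        Wfalse : ∀ k → eqF d k ≡ false → eqF a k ≡ false → lookup S k ≡ false → lookup W k ≡ false
        Wfalse k e1 e2 e3 = trans (lookup-set² S a true d true k) (trans (cong₂ (λ u w → if u then true else (if w then true else lookup S k)) e1 e2) e3)
        main : ∀ b1 → eqF r a ≡ b1 → ∀ b2 → eqF s d ≡ b2 → ∀ b3 → eqF s a ≡ b3 → ∀ b4 → eqF r d ≡ b4 →
          includedOn c T W ≡ ((b1 ∧ b2) ∨ (b3 ∧ b4))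
        main true e1 true e2 b3 e3 b4 e4 with eqF-≡ r a e1 | eqF-≡ s d e2
        ... | refl | refl = includedOn-true c T W (λ k → trans (cong₂ (λ u w → lookup c k ∧ u ∧ not w) (lookup-set³ S q false r true s true k) (lookup-set² S r true s true k)) (included-rs (lookup c k) (eqF q k) (eqF r k) (eqF s k) (lookup S k)))
        main true e1 false e2 true e3 b4 e4 with eqF-≡ r a e1 | eqF-≡ s a e3
        ... | refl | refl = contradiction (trans (sym (eqF-refl r)) rs) λ ()
        main true e1 false e2 false e3 b4 e4 = includedOn-false c T W s (trans (cong₂ (λ u w → lookup c s ∧ u ∧ not w) Ts (Wfalse s (trans (eqF-sym d s) e2) (trans (eqF-sym a s) e3) ss)) (cong (λ u → u ∧ true) cs))
        main false e1 b2 e2 true e3 true e4 with eqF-≡ s a e3 | eqF-≡ r d e4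
        ... | refl | refl = includedOn-true c T W (λ k → trans (cong₂ (λ u w → lookup c k ∧ u ∧ not w) (lookup-set³ S q false r true s true k) (lookup-set² S s true r true k)) (included-sr (lookup c k) (eqF q k) (eqF r k) (eqF s k) (lookup S k)))
        main false e1 b2 e2 b3 e3 false e4 = trans (includedOn-false c T W r (trans (cong₂ (λ u w → lookup c r ∧ u ∧ not w) Tr (Wfalse r (trans (eqF-sym d r) e4) (trans (eqF-sym a r) e1) sr)) (cong (λ u → u ∧ true) cr))) (sym (∧-zeroʳ b3))
        main false e1 b2 e2 false e3 true e4 with eqF-≡ r d e4
        ... | refl = includedOn-false c T W s (trans (cong₂ (λ u w → lookup c s ∧ u ∧ not w) Ts (Wfalse s rs (trans (eqF-sym a s) e3) ss)) (cong (λ u → u ∧ true) cs))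

      inner : ∀ a → first a ≡ true → ΣF n (λ d → ⟦ second a d ⟧ * ⟦ Above 1 c T (set (set S a true) d true) ⟧) ≡ ⟦ eqF r a ∨ eqF s a ⟧
      inner a g1 = trans (ΣF-cong-guarded n (second a) _ _ (λ d g2 → final≡ a d g1 g2)) (ev (eqF r a) refl (eqF s a) refl)
        where
        ev : ∀ b1 → eqF r a ≡ b1 → ∀ b3 → eqF s a ≡ b3 → ΣF n (λ d → ⟦ second a d ⟧ * ⟦ (b1 ∧ eqF s d) ∨ (b3 ∧ eqF r d) ⟧) ≡ ⟦ b1 ∨ b3 ⟧
        ev true e1 true e3 with eqF-≡ r a e1 | eqF-≡ s a e3
        ... | refl | refl = contradiction (trans (sym (eqF-refl r)) rs) λ ()
        ev true e1 false e3 = trans (ΣF-cong n (λ d → cong (λ u → ⟦ second a d ⟧ * ⟦ u ⟧) (∨-identityʳ (eqF s d)))) (trans (ΣF-point′ n (second a) s)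
          (cong₂ (λ u w → ⟦ u ∧ not w ⟧) cs (trans (lookup-set-other S a s true (trans (eqF-sym a s) e3)) ss)))
        ev false e1 true e3 = trans (ΣF-point′ n (second a) r) (cong₂ (λ u w → ⟦ u ∧ not w ⟧) cr (trans (lookup-set-other S a r true (trans (eqF-sym a r) e1)) sr))
        ev false e1 false e3 = ΣF-zero' n _ (λ d → *-zeroʳ ⟦ second a d ⟧)

      walks-count : walks up up down c S T ≡ 2
      walks-count = trans (ΣF-cong-guarded n first _ _ inner) (trans (ΣF-two-points n first r s rs) (cong₂ (λ u w → ⟦ u ⟧ + ⟦ w ⟧) (trans (cong₂ (λ u w → u ∧ not w) cr sr) refl) (trans (cong₂ (λ u w → u ∧ not w) cs ss) refl)))

module JohnsonGraph where

  open import Data.Nat as ℕ using (ℕ; zero; suc; _+_; _*_; _∸_; _≤_; _<_; z≤n; s≤s; _≡ᵇ_)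
  open import Data.Nat.Properties
  open import Data.Bool as B using (Bool; true; false; if_then_else_; _∧_; _∨_; not; _xor_)
  open import Data.Bool.Properties using (∧-comm; ∧-identityʳ; ∧-zeroʳ; ∨-zeroʳ) renaming (_≟_ to _≟B_)
  open import Data.Fin using (Fin)
  open import Data.Fin.Subset using (Subset; ∣_∣; _∩_)
  open import Data.Vec as Vec using (Vec; []; _∷_; lookup)
  open import Data.Vec.Properties using (≡-dec; lookup-replicate)
  open import Data.List using (List; []; _∷_; _++_; map; foldr; length; mapMaybe)
  open import Data.List.Relation.Unary.Any using (here; there)
  open import Data.List.Membership.Propositional using (_∈_)
  open import Data.List.Membership.Propositional.Properties using (∈-++⁺ˡ; ∈-++⁺ʳ; ∈-map⁺)
  open import Data.Maybe using (Maybe; just; nothing; maybe′)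
  open import Data.Product using (Σ; _×_; _,_; proj₁; proj₂)
  open import Data.Empty using (⊥; ⊥-elim)
  open import Relation.Binary.PropositionalEquality
  open import Relation.Nullary using (¬_; yes; no; does; Dec)
  open import Data.Nat.Solver using (module +-*-Solver)

  open BooleanLattice

  sumL : ∀ {A : Set} → (A → ℕ) → List A → ℕ
  sumL h L = foldr (λ a acc → h a + acc) 0 L

  sumL-++ : ∀ {A : Set} (h : A → ℕ) L M → sumL h (L ++ M) ≡ sumL h L + sumL h M
  sumL-++ h [] M = refl
  sumL-++ h (a ∷ L) M = trans (cong (h a +_) (sumL-++ h L M)) (sym (+-assoc (h a) _ _))

  sumL-map : ∀ {A B : Set} (h : B → ℕ) (f : A → B) L → sumL h (map f L) ≡ sumL (λ a → h (f a)) L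
  sumL-map h f [] = refl
  sumL-map h f (a ∷ L) = cong (h (f a) +_) (sumL-map h f L)

  sumL-all : ∀ n (h : Vec Bool n → ℕ) → sumL h (allSubsets n) ≡ ΣS n h
  sumL-all zero h = +-identityʳ _
  sumL-all (suc n) h = trans (sumL-++ h (map (true ∷_) (allSubsets n)) (map (false ∷_) (allSubsets n))) (cong₂ _+_ (trans (sumL-map h (true ∷_) (allSubsets n)) (sumL-all n (λ s → h (true ∷ s)))) (trans (sumL-map h (false ∷_) (allSubsets n)) (sumL-all n (λ s → h (false ∷ s)))))

  sumL-mapMaybe : ∀ {A B : Set} (f : A → Maybe B) (g : B → ℕ) L →
    foldr (λ v acc → g v + acc) 0 (mapMaybe f L) ≡ sumL (λ s → maybe′ g 0 (f s)) L
  sumL-mapMaybe f g [] = refl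
  sumL-mapMaybe f g (a ∷ L) with f a
  ... | just b = cong (g b +_) (sumL-mapMaybe f g L)
  ... | nothing = sumL-mapMaybe f g L

  all-in : ∀ n (s : Vec Bool n) → s ∈ allSubsets n
  all-in zero [] = here refl
  all-in (suc n) (true ∷ s) = ∈-++⁺ˡ {xs = map (true ∷_) (allSubsets n)} {ys = map (false ∷_) (allSubsets n)} (∈-map⁺ (true ∷_) {xs = allSubsets n} (all-in n s))
  all-in (suc n) (false ∷ s) = ∈-++⁺ʳ (map (true ∷_) (allSubsets n)) {ys = map (false ∷_) (allSubsets n)} (∈-map⁺ (false ∷_) {xs = allSubsets n} (all-in n s))

  ∈-mapMaybe : ∀ {A B : Set} (f : A → Maybe B) L a b → a ∈ L → f a ≡ just b → b ∈ mapMaybe f L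
  ∈-mapMaybe f (a ∷ L) a b (here refl) e with f a
  ∈-mapMaybe f (a ∷ L) a b (here refl) refl | just .b = here refl
  ∈-mapMaybe f (a' ∷ L) a b (there m) e with f a'
  ... | just b' = there (∈-mapMaybe f L a b m e)
  ... | nothing = ∈-mapMaybe f L a b m e

  leb : ℕ → ℕ → Bool
  leb zero k = true
  leb (suc m) zero = false
  leb (suc m) (suc k) = leb m k

  leb-true : ∀ m k → leb m k ≡ true → m ≤ k
  leb-true zero k _ = z≤n
  leb-true (suc m) (suc k) e = s≤s (leb-true m k e)

  leb-≤ : ∀ m k → m ≤ k → leb m k ≡ true
  leb-≤ zero k _ = refl
  leb-≤ (suc m) (suc k) (s≤s p) = leb-≤ m k p

  leb-false : ∀ m k → leb m k ≡ false → k < m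
  leb-false zero k ()
  leb-false (suc m) zero _ = s≤s z≤n
  leb-false (suc m) (suc k) e = s≤s (leb-false m k e)

  leb-> : ∀ m k → k < m → leb m k ≡ false
  leb-> (suc m) zero _ = refl
  leb-> (suc m) (suc k) (s≤s p) = leb-> m k p

  ecc-lb : ∀ (Γ : Graph) (g : Graph.Vtx Γ → ℕ) L w → w ∈ L → g w ≤ foldr (λ y acc → g y ℕ.⊔ acc) 0 L
  ecc-lb Γ g (v ∷ L) w (here refl) = m≤m⊔n (g w) _
  ecc-lb Γ g (v ∷ L) w (there m) = ≤-trans (ecc-lb Γ g L w m) (m≤n⊔m (g v) _)

  module LayerDistance (Γ : Graph) (x : Graph.Vtx Γ) (ℓ : Graph.Vtx Γ → ℕ)
    (eqV≡layer0 : ∀ y → Graph.eqV Γ x y ≡ (ℓ y ≡ᵇ 0))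
    (adj-ℓ-≤ : ∀ w y → Graph.adj Γ w y ≡ true → ℓ y ≤ suc (ℓ w))
    (ℓ-step : ∀ y m → ℓ y ≡ suc m → Σ (Graph.Vtx Γ) (λ w → (w ∈ Graph.verts Γ) × (ℓ w ≡ m) × (Graph.adj Γ w y ≡ true)))
    (ℓ<size : ∀ y → ℓ y < length (Graph.verts Γ)) where

    open Graph Γ

    anyL-true : ∀ (p : Vtx → Bool) L w → w ∈ L → p w ≡ true → foldr (λ v acc → p v ∨ acc) false L ≡ true
    anyL-true p (v ∷ L) w (here refl) e = cong (_∨ foldr (λ v acc → p v ∨ acc) false L) e
    anyL-true p (v ∷ L) w (there m) e = trans (cong (p v ∨_) (anyL-true p L w m e)) (∨-zeroʳ (p v))

    anyL-false : ∀ (p : Vtx → Bool) L → (∀ w → p w ≡ false) → foldr (λ v acc → p v ∨ acc) false L ≡ false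
    anyL-false p [] h = refl
    anyL-false p (v ∷ L) h = trans (cong₂ _∨_ (h v) (anyL-false p L h)) refl

    reach≡leb : ∀ k y → reach Γ x k y ≡ leb (ℓ y) k
    reach≡leb zero y = trans (eqV≡layer0 y) (z (ℓ y))
      where z : ∀ m → (m ≡ᵇ 0) ≡ leb m 0
            z zero = refl
            z (suc m) = refl
    reach≡leb (suc k) y = trans (cong (_∨ anyV Γ (λ w → reach Γ x k w ∧ adj w y)) (reach≡leb k y)) (go (leb (ℓ y) k) refl)
      where
      go : ∀ b → leb (ℓ y) k ≡ b → (b ∨ anyV Γ (λ w → reach Γ x k w ∧ adj w y)) ≡ leb (ℓ y) (suc k)
      go true e = sym (leb-≤ (ℓ y) (suc k) (≤-trans (leb-true (ℓ y) k e) (n≤1+n k)))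
      go false e with ℓ y ℕ.≟ suc k
      ... | yes eq = trans (anyL-true _ verts w wm (trans (cong₂ _∧_ (trans (reach≡leb k w) (leb-≤ (ℓ w) k (≤-reflexive lw))) ad) refl)) (sym (leb-≤ (ℓ y) (suc k) (≤-reflexive eq)))
        where
        st = ℓ-step y k eq
        w = proj₁ st
        wm = proj₁ (proj₂ st)
        lw = proj₁ (proj₂ (proj₂ st))
        ad = proj₂ (proj₂ (proj₂ st))
      ... | no ne = trans (anyL-false _ verts pf) (sym (leb-> (ℓ y) (suc k) big))
        where
        gt : k < ℓ y
        gt = leb-false (ℓ y) k e
        big : suc k < ℓ y
        big = ≤∧≢⇒< gt (λ q → ne (sym q))
        pf : ∀ w → (reach Γ x k w ∧ adj w y) ≡ false
        pf w with reach Γ x k w in r | adj w y in a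
        ... | false | _ = refl
        ... | true | false = refl
        ... | true | true = ⊥-elim (<⇒≱ big (≤-trans (adj-ℓ-≤ w y a) (s≤s (leb-true (ℓ w) k (trans (sym (reach≡leb k w)) r)))))

    firstTrue-cong : ∀ (p q : ℕ → Bool) b → (∀ k → p k ≡ q k) → firstTrue Γ p b ≡ firstTrue Γ q b
    firstTrue-cong p q zero e = refl
    firstTrue-cong p q (suc b) e rewrite e 0 = cong (λ t → if q 0 then 0 else suc t) (firstTrue-cong (λ k → p (suc k)) (λ k → q (suc k)) b (λ k → e (suc k)))

    firstTrue-leb : ∀ m b → m < b → firstTrue Γ (λ k → leb m k) b ≡ m
    firstTrue-leb zero (suc b) _ = refl
    firstTrue-leb (suc m) (suc b) (s≤s p) = cong suc (firstTrue-leb m b p)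

    dist≡ℓ : ∀ y → dist Γ x y ≡ ℓ y
    dist≡ℓ y = trans (firstTrue-cong _ _ (length verts) (λ k → reach≡leb k y)) (firstTrue-leb (ℓ y) (length verts) (ℓ<size y))

  -- The filter `keep` of `Johnson` is local to its where-block; read it back off `verts`.
  keepVertex : ∀ n D → Subset n → Maybe (JVtx n D)
  keepVertex n D = proj₁ (h n D)
    where
    h : ∀ n D → Σ (Subset n → Maybe (JVtx n D)) (λ k → mapMaybe k (allSubsets n) ≡ Graph.verts (Johnson n D))
    h n D = _ , refl

  keepVertex-yes : ∀ n D (s : Subset n) (p : ∣ s ∣ ≡ D) → keepVertex n D s ≡ just (s , p)
  keepVertex-yes n D s p with ∣ s ∣ ℕ.≟ D
  ... | yes q = cong (λ r → just (s , r)) (≡-irrelevant q p)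
  ... | no q = ⊥-elim (q p)

  keepVertex-no : ∀ n D (s : Subset n) → ¬ (∣ s ∣ ≡ D) → keepVertex n D s ≡ nothing
  keepVertex-no n D s np with ∣ s ∣ ℕ.≟ D
  ... | yes q = ⊥-elim (np q)
  ... | no q = refl

  module Layers (n D : ℕ) (x : JVtx n D) where
    c : Vec Bool n
    c = proj₁ x
    Γ = Johnson n D
    V = JVtx n D
    vs = Graph.verts Γ

    ℓ : V → ℕ
    ℓ v = count (λ k → lookup (proj₁ v) k ∧ not (lookup c k))

    size≡D : ∀ (v : V) → count (lookup (proj₁ v)) ≡ D
    size≡D v = trans (sym (card≡count (proj₁ v))) (proj₂ v)

    ∈verts : ∀ (v : V) → v ∈ vs
    ∈verts v = ∈-mapMaybe (keepVertex n D) (allSubsets n) (proj₁ v) v (all-in n (proj₁ v)) (keepVertex-yes n D (proj₁ v) (proj₂ v))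

    difference-sym : ∀ (u v : Vec Bool n) → count (lookup u) ≡ count (lookup v) →
      count (λ k → lookup u k ∧ not (lookup v k)) ≡ count (λ k → lookup v k ∧ not (lookup u k))
    difference-sym u v e = +-cancelˡ-≡ (count (λ k → lookup u k ∧ lookup v k)) _ _
      (trans (sym (count-split (lookup u) (lookup v))) (trans e (trans (count-split (lookup v) (lookup u)) (cong (_+ count (λ k → lookup v k ∧ not (lookup u k))) (count-cong (λ k → ∧-comm (lookup v k) (lookup u k)))))))

    ℓ-complement : ∀ (v : V) → ℓ v ≡ count (λ k → lookup c k ∧ not (lookup (proj₁ v) k))
    ℓ-complement v = difference-sym (proj₁ v) c (trans (size≡D v) (sym (size≡D x)))

    eqV≡layer0 : ∀ y → Graph.eqV Γ x y ≡ (ℓ y ≡ᵇ 0)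
    eqV≡layer0 y with ≡-dec _≟B_ c (proj₁ y)
    ... | yes eq = sym (cong (_≡ᵇ 0) (count-zero _ (λ k → subst (λ t → (lookup t k ∧ not (lookup c k)) ≡ false) eq (bb (lookup c k)))))
      where bb : ∀ b → (b ∧ not b) ≡ false
            bb true = refl
            bb false = refl
    ... | no ne with ℓ y in e
    ...   | suc _ = refl
    ...   | zero = ⊥-elim (ne (vec-ext c (proj₁ y) (λ k → pw k (count-zero⇒ _ e k) (count-zero⇒ _ (trans (sym (ℓ-complement y)) e) k))))
      where
      bb : ∀ a b → (a ∧ not b) ≡ false → (b ∧ not a) ≡ false → b ≡ a
      bb true true _ _ = refl
      bb false false _ _ = refl
      bb true false () _
      bb false true _ ()
      pw : ∀ k → (lookup (proj₁ y) k ∧ not (lookup c k)) ≡ false → (lookup c k ∧ not (lookup (proj₁ y) k)) ≡ false → lookup c k ≡ lookup (proj₁ y) k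
      pw k e1 e2 = bb (lookup (proj₁ y) k) (lookup c k) e1 e2

    adj-card : ∀ (w y : V) → Graph.adj Γ w y ≡ true → count (λ k → lookup (proj₁ w) k ∧ lookup (proj₁ y) k) ≡ D ∸ 1
    adj-card w y e = trans (sym (card∩≡count (proj₁ w) (proj₁ y))) (does-true _ _ e)

    adj-ℓ-≤ : ∀ w y → Graph.adj Γ w y ≡ true → ℓ y ≤ suc (ℓ w)
    adj-ℓ-≤ w y e = begin
        ℓ y
      ≡⟨ count-split (λ k → Y k ∧ not (C k)) W ⟩
        count (λ k → (Y k ∧ not (C k)) ∧ W k) + count (λ k → (Y k ∧ not (C k)) ∧ not (W k))
      ≤⟨ +-mono-≤ (count-mono _ _ (λ k → p1 (Y k) (C k) (W k))) (count-mono _ _ (λ k → p2 (Y k) (C k) (W k))) ⟩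
        ℓ w + count (λ k → Y k ∧ not (W k))
      ≤⟨ +-monoʳ-≤ (ℓ w) yw ⟩
        ℓ w + 1
      ≡⟨ +-comm (ℓ w) 1 ⟩
        suc (ℓ w) ∎
      where
      open ≤-Reasoning
      Y = lookup (proj₁ y)
      W = lookup (proj₁ w)
      C = lookup c
      p1 : ∀ a b d → ((a ∧ not b) ∧ d) ≡ true → (d ∧ not b) ≡ true
      p1 true false true _ = refl
      p2 : ∀ a b d → ((a ∧ not b) ∧ not d) ≡ true → (a ∧ not d) ≡ true
      p2 true false false _ = refl
      tot : count (λ k → Y k ∧ not (W k)) + (D ∸ 1) ≡ D
      tot = trans (+-comm _ (D ∸ 1)) (trans (cong (_+ count (λ k → Y k ∧ not (W k))) (trans (sym (adj-card w y e)) (count-cong (λ k → ∧-comm (W k) (Y k))))) (trans (sym (count-split Y W)) (size≡D y)))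
      yw : count (λ k → Y k ∧ not (W k)) ≤ 1
      yw = lem _ D tot
        where lem : ∀ m D → m + (D ∸ 1) ≡ D → m ≤ 1
              lem m zero e = ≤-trans (≤-reflexive (trans (sym (+-identityʳ m)) e)) z≤n
              lem m (suc D) e = ≤-reflexive (+-cancelʳ-≡ D m 1 e)

    cardOn-complement : ∀ (W : Vec Bool n) → count (λ k → lookup W k ∧ not (lookup c k)) ≡ cardOn W (notV c)
    cardOn-complement W = count-cong (λ k → cong (lookup W k ∧_) (sym (lookup-notV c k)))

    swap : (y : V) (a b : Fin n) → lookup (proj₁ y) a ≡ true → lookup (proj₁ y) b ≡ false → Σ V (λ w → (proj₁ w ≡ set (set (proj₁ y) a false) b true) × (Graph.adj Γ w y ≡ true))
    swap y a b ya yb = w , refl , adjw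
      where
      Y = lookup (proj₁ y)
      ab : eqF a b ≡ false
      ab = eqF-apart (proj₁ y) a b ya yb
      ya' : lookup (set (proj₁ y) a false) b ≡ false
      ya' = trans (lookup-set-other (proj₁ y) a b false ab) yb
      wv = set (set (proj₁ y) a false) b true
      cw : count (lookup wv) ≡ D
      cw = +-cancelʳ-≡ 0 _ _ (trans (cong (λ t → count (lookup wv) + ⟦ t ⟧) (sym ya')) (trans (count-set (set (proj₁ y) a false) b true)
             (trans (cong (λ t → count (lookup (set (proj₁ y) a false)) + ⟦ t ⟧) (sym ya)) (trans (count-set (proj₁ y) a false) (cong (_+ 0) (size≡D y))))))
      w : V
      w = wv , trans (card≡count wv) cw
      yy : cardOn (proj₁ y) (proj₁ y) ≡ D
      yy = trans (count-cong (λ k → bb (Y k))) (size≡D y)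
        where bb : ∀ t → (t ∧ t) ≡ t
              bb true = refl
              bb false = refl
      cwy : cardOn wv (proj₁ y) ≡ D ∸ 1
      cwy = trans (cardOn-outside (set (proj₁ y) a false) (proj₁ y) b true yb) (cong ℕ.pred (trans (cardOn-del (proj₁ y) (proj₁ y) a ya ya) yy))
      adjw : Graph.adj Γ w y ≡ true
      adjw = trans (cong (_≡ᵇ D ∸ 1) (trans (card∩≡count wv (proj₁ y)) cwy)) (≡ᵇ-refl (D ∸ 1))

    ℓ-step : ∀ y m → ℓ y ≡ suc m → Σ V (λ w → (w ∈ vs) × (ℓ w ≡ m) × (Graph.adj Γ w y ≡ true))
    ℓ-step y m e = w , ∈verts w , lw , proj₂ (proj₂ (swap y a b ya yb))
      where
      Y = lookup (proj₁ y)
      C = lookup c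
      fa = find (λ k → Y k ∧ not (C k)) (λ z → 0≢1+n (trans (sym z) e))
      a = proj₁ fa
      ya = ∧-true₁ (proj₂ fa)
      ca = not-true (∧-true₂ (proj₂ fa))
      fb = find (λ k → C k ∧ not (Y k)) (λ z → 0≢1+n (trans (sym z) (trans (sym (ℓ-complement y)) e)))
      b = proj₁ fb
      cb = ∧-true₁ (proj₂ fb)
      yb = not-true (∧-true₂ (proj₂ fb))
      w = proj₁ (swap y a b ya yb)
      lw : ℓ w ≡ m
      lw = trans (cardOn-complement (proj₁ w)) (trans (cardOn-outside (set (proj₁ y) a false) (notV c) b true (trans (lookup-notV c b) (cong not cb)))
             (suc-injective (trans (cardOn-del (proj₁ y) (notV c) a (trans (lookup-notV c a) (cong not ca)) ya) (trans (sym (cardOn-complement (proj₁ y))) e))))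

    -- δ y has x ∖ y inside x and y ∖ x outside x, both of size ℓ y.
    δ : Vec Bool n → Vec Bool n
    δ s = xorV s c

    Raise : Vec Bool n → Vec Bool n → Bool
    Raise S W = Above 1 c S W ∧ Above 1 (notV c) S W

    Above-card : ∀ m (d S W : Vec Bool n) → Above m d S W ≡ true → cardOn W d ≡ m + cardOn S d
    Above-card m d S W e = ≡ᵇ⇒≡ _ _ (subst B.T (sym (∧-true₂ {includedOn d S W} e)) _)

    count-complement : count (λ k → lookup (notV c) k) + D ≡ n
    count-complement = trans (+-comm _ D) (trans (cong₂ _+_ (sym (size≡D x)) (count-cong (lookup-notV c))) (trans (sym (count-split (λ _ → true) (lookup c))) (count-all n)))

    xor-invol : ∀ (W : Vec Bool n) → xorV (xorV W c) c ≡ W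
    xor-invol W = vec-ext _ _ (λ k → trans (lookup-xor (xorV W c) c k) (trans (cong (_xor lookup c k) (lookup-xor W c k)) (bb (lookup W k) (lookup c k))))
      where bb : ∀ a b → ((a xor b) xor b) ≡ a
            bb true true = refl
            bb true false = refl
            bb false true = refl
            bb false false = refl

    δc-x : ∀ (s : Vec Bool n) → cardOn (δ s) c ≡ count (λ k → lookup c k ∧ not (lookup s k))
    δc-x s = count-cong (λ k → trans (cong (_∧ lookup c k) (lookup-xor s c k)) (bb (lookup s k) (lookup c k)))
      where bb : ∀ a b → ((a xor b) ∧ b) ≡ (b ∧ not a)
            bb true true = refl
            bb true false = refl
            bb false true = refl
            bb false false = refl

    δc-o : ∀ (s : Vec Bool n) → cardOn (δ s) (notV c) ≡ count (λ k → lookup s k ∧ not (lookup c k))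
    δc-o s = count-cong (λ k → trans (cong₂ _∧_ (lookup-xor s c k) (lookup-notV c k)) (bb (lookup s k) (lookup c k)))
      where bb : ∀ a b → ((a xor b) ∧ not b) ≡ (a ∧ not b)
            bb true true = refl
            bb true false = refl
            bb false true = refl
            bb false false = refl

    δV-x : ∀ (v : V) → cardOn (δ (proj₁ v)) c ≡ ℓ v
    δV-x v = trans (δc-x (proj₁ v)) (sym (ℓ-complement v))

    δV-o : ∀ (v : V) → cardOn (δ (proj₁ v)) (notV c) ≡ ℓ v
    δV-o v = δc-o (proj₁ v)

    balanced : ∀ (W : Vec Bool n) → cardOn W c ≡ cardOn W (notV c) → count (lookup (xorV W c)) ≡ D
    balanced W e = begin
        count (lookup (xorV W c))
      ≡⟨ count-split (lookup (xorV W c)) (lookup c) ⟩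
        count (λ k → lookup (xorV W c) k ∧ lookup c k) + count (λ k → lookup (xorV W c) k ∧ not (lookup c k))
      ≡⟨ cong₂ _+_ (count-cong (λ k → trans (cong (_∧ lookup c k) (lookup-xor W c k)) (b1 (lookup W k) (lookup c k)))) (trans (count-cong (λ k → trans (cong (_∧ not (lookup c k)) (lookup-xor W c k)) (trans (b2 (lookup W k) (lookup c k)) (cong (lookup W k ∧_) (sym (lookup-notV c k)))))) (sym e)) ⟩
        count (λ k → lookup c k ∧ not (lookup W k)) + cardOn W c
      ≡⟨ +-comm _ (cardOn W c) ⟩
        cardOn W c + count (λ k → lookup c k ∧ not (lookup W k))
      ≡⟨ cong (_+ count (λ k → lookup c k ∧ not (lookup W k))) (count-cong (λ k → ∧-comm (lookup W k) (lookup c k))) ⟩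
        count (λ k → lookup c k ∧ lookup W k) + count (λ k → lookup c k ∧ not (lookup W k))
      ≡⟨ sym (count-split (lookup c) (lookup W)) ⟩
        count (lookup c)
      ≡⟨ size≡D x ⟩
        D ∎
      where
      open ≡-Reasoning
      b1 : ∀ a b → ((a xor b) ∧ b) ≡ (b ∧ not a)
      b1 true true = refl
      b1 true false = refl
      b1 false true = refl
      b1 false false = refl
      b2 : ∀ a b → ((a xor b) ∧ not b) ≡ (a ∧ not b)
      b2 true true = refl
      b2 true false = refl
      b2 false true = refl
      b2 false false = refl

    vertexOf : (W : Vec Bool n) → cardOn W c ≡ cardOn W (notV c) → V
    vertexOf W b = xorV W c , trans (card≡count (xorV W c)) (balanced W b)

    ℓ-vertexOf : ∀ W b → ℓ (vertexOf W b) ≡ cardOn W (notV c)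
    ℓ-vertexOf W b = trans (sym (δc-o (xorV W c))) (cong (λ t → cardOn t (notV c)) (xor-invol W))

    Raise-balanced : ∀ (y : V) (W : Vec Bool n) → Raise (δ (proj₁ y)) W ≡ true → count (lookup (xorV W c)) ≡ D
    Raise-balanced y W e = balanced W (trans (Above-card 1 c (δ (proj₁ y)) W (∧-true₁ e)) (trans (cong suc (trans (δV-x y) (sym (δV-o y)))) (sym (Above-card 1 (notV c) (δ (proj₁ y)) W (∧-true₂ {Above 1 c (δ (proj₁ y)) W} e)))))

    Raise-balanced′ : ∀ (y : V) (W : Vec Bool n) → Raise W (δ (proj₁ y)) ≡ true → count (lookup (xorV W c)) ≡ D
    Raise-balanced′ y W e = balanced W (suc-injective (trans (sym (Above-card 1 c W (δ (proj₁ y)) (∧-true₁ e))) (trans (trans (δV-x y) (sym (δV-o y))) (Above-card 1 (notV c) W (δ (proj₁ y)) (∧-true₂ {Above 1 c W (δ (proj₁ y))} e)))))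

    Γf = flatGraph Γ x

    Lb : V → V → Bool
    Lb y w = Graph.adj Γf y w ∧ does (suc (dist Γf x y) ℕ.≟ dist Γf x w)

    ΣV : (V → ℕ) → ℕ
    ΣV g = foldr (λ v acc → g v + acc) 0 vs

    ΣV≡ΣS : (g : V → ℕ) (G : Vec Bool n → ℕ) → (∀ s p → g (s , p) ≡ G s) → (∀ s → ¬ (∣ s ∣ ≡ D) → G s ≡ 0) → ΣV g ≡ ΣS n G
    ΣV≡ΣS g G h1 h2 = trans (sumL-mapMaybe (keepVertex n D) g (allSubsets n)) (trans (sumL-all n _) (ΣS-cong n pw))
      where
      pw' : ∀ s → Dec (∣ s ∣ ≡ D) → maybe′ g 0 (keepVertex n D s) ≡ G s
      pw' s (yes p) = trans (cong (maybe′ g 0) (keepVertex-yes n D s p)) (h1 s p)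
      pw' s (no np) = trans (cong (maybe′ g 0) (keepVertex-no n D s np)) (sym (h2 s np))
      pw : ∀ s → maybe′ g 0 (keepVertex n D s) ≡ G s
      pw s = pw' s (∣ s ∣ ℕ.≟ D)

    Raise-size : ∀ (y : V) s → ¬ (∣ s ∣ ≡ D) → Raise (δ (proj₁ y)) (δ s) ≡ false
    Raise-size y s np with Raise (δ (proj₁ y)) (δ s) in e
    ... | false = refl
    ... | true = ⊥-elim (np (trans (card≡count s) (subst (λ t → count (lookup t) ≡ D) (xor-invol s) (Raise-balanced y (δ s) e))))

    Raise-size′ : ∀ (y : V) s → ¬ (∣ s ∣ ≡ D) → Raise (δ s) (δ (proj₁ y)) ≡ false
    Raise-size′ y s np with Raise (δ s) (δ (proj₁ y)) in e
    ... | false = refl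
    ... | true = ⊥-elim (np (trans (card≡count s) (subst (λ t → count (lookup t) ≡ D) (xor-invol s) (Raise-balanced′ y (δ s) e))))

    module Bound (D3 : 3 ≤ D) (nD : 2 * D ≤ n) where
      open ≤-Reasoning
      δx0 : ∀ k → lookup (δ c) k ≡ false
      δx0 k = trans (lookup-xor c c k) (bb (lookup c k))
        where bb : ∀ b → (b xor b) ≡ false
              bb true = refl
              bb false = refl
      D≤complement : D ≤ count (λ k → not (lookup c k))
      D≤complement = +-cancelʳ-≤ D D _ (≤-trans (≤-trans (≤-reflexive (sym (trans (cong (D +_) (+-identityʳ D)) refl))) nD) (≤-reflexive (trans (sym count-complement) (cong (_+ D) (count-cong (lookup-notV c))))))
      D≤count-complement : D ≤ count (lookup (notV c))
      D≤count-complement = ≤-trans D≤complement (≤-reflexive (sym (count-cong (lookup-notV c))))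

      balancedSet : ∀ k → k ≤ D → Σ (Vec Bool n) (λ S → (cardOn S c ≡ k) × (cardOn S (notV c) ≡ k))
      balancedSet k k≤D = proj₁ outside , S∩c , S∩nc
        where
        nc = notV c
        nc⇒¬c : ∀ j → lookup nc j ≡ true → lookup c j ≡ false
        nc⇒¬c j e = not-true (trans (sym (lookup-notV c j)) e)
        ∅ = Vec.replicate n false
        inside = extendOn k c ∅ (≤-trans k≤D (≤-reflexive (trans (sym (size≡D x))
                   (count-cong (λ j → trans (sym (∧-identityʳ (lookup c j))) (cong (λ t → lookup c j ∧ not t) (sym (lookup-replicate j false))))))))
        S₁ = proj₁ inside
        S₁-outside : ∀ j → lookup c j ≡ false → lookup S₁ j ≡ false
        S₁-outside j e = trans (proj₁ (proj₂ inside) j e) (lookup-replicate j false)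
        S₁∩nc : cardOn S₁ nc ≡ 0
        S₁∩nc = count-zero _ pw
          where
          pw : ∀ j → (lookup S₁ j ∧ lookup nc j) ≡ false
          pw j with lookup nc j in e
          ... | true = cong (_∧ true) (S₁-outside j (nc⇒¬c j e))
          ... | false = ∧-zeroʳ _
        free-outside : ∀ j → lookup nc j ≡ (lookup nc j ∧ not (lookup S₁ j))
        free-outside j with lookup nc j in e
        ... | true = sym (cong not (S₁-outside j (nc⇒¬c j e)))
        ... | false = refl
        outside = extendOn k nc S₁ (≤-trans (≤-trans k≤D D≤count-complement) (≤-reflexive (count-cong free-outside)))
        S∩c : cardOn (proj₁ outside) c ≡ k
        S∩c = trans (cardOn-agree c (proj₁ outside) S₁ (λ j cj → proj₁ (proj₂ outside) j (trans (lookup-notV c j) (cong not cj))))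
                (trans (proj₂ (proj₂ inside)) (trans (cong (k +_) (count-zero _ (λ j → cong (_∧ lookup c j) (lookup-replicate j false)))) (+-identityʳ k)))
        S∩nc : cardOn (proj₁ outside) nc ≡ k
        S∩nc = trans (proj₂ (proj₂ outside)) (trans (cong (k +_) S₁∩nc) (+-identityʳ k))

      ℓ<size : ∀ (y : V) → ℓ y < length vs
      ℓ<size y = begin-strict
          ℓ y
        ≤⟨ count-mono (λ k → lookup (proj₁ y) k ∧ not (lookup c k)) (lookup (proj₁ y)) (λ k → ∧-true₁) ⟩
          count (lookup (proj₁ y))
        ≡⟨ size≡D y ⟩
          D
        <⟨ D<D*complement ⟩
          D * count (λ k → not (lookup c k))
        ≡⟨ cong₂ _*_ (sym (size≡D x)) refl ⟩
          count (lookup c) * count (λ k → not (lookup c k))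
        ≡⟨ sym (ΣF-*ʳ n _ (λ a → ⟦ lookup c a ⟧)) ⟩
          ΣF n (λ a → ⟦ lookup c a ⟧ * count (λ k → not (lookup c k)))
        ≡⟨ ΣF-cong n (λ a → cong₂ _*_ (cong ⟦_⟧ (sym (trans (cong (λ t → lookup c a ∧ not t) (δx0 a)) (∧-identityʳ _)))) (ΣF-cong n (λ b → trans (sym (*-identityʳ _)) (cong (λ t → ⟦ t ⟧ * 1) (sym (trans (cong (λ t → not (lookup c b) ∧ not t) (δx0 b)) (∧-identityʳ _))))))) ⟩
          ΣF n (λ a → ⟦ lookup c a ∧ not (lookup (δ c) a) ⟧ * ΣF n (λ b → ⟦ not (lookup c b) ∧ not (lookup (δ c) b) ⟧ * 1))
        ≡⟨ sym (ΣS-above₁₁ c (δ c) (λ _ → 1)) ⟩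
          ΣS n (λ W → ⟦ Above 1 c (δ c) W ⟧ * (⟦ Above 1 (notV c) (δ c) W ⟧ * 1))
        ≡⟨ ΣS-cong n (λ W → sym (⟦∧⟧* (Above 1 c (δ c) W) _ 1)) ⟩
          ΣS n (λ W → ⟦ Raise (δ c) W ⟧ * 1)
        ≡⟨ ΣS-xor n c _ ⟩
          ΣS n (λ s → ⟦ Raise (δ c) (δ s) ⟧ * 1)
        ≤⟨ ΣS-mono n _ _ pw ⟩
          ΣS n (λ s → maybe′ (λ _ → 1) 0 (keepVertex n D s))
        ≡⟨ sym (trans (sumL-mapMaybe (keepVertex n D) (λ _ → 1) (allSubsets n)) (sumL-all n _)) ⟩
          ΣV (λ _ → 1)
        ≡⟨ refl ⟩
          length vs ∎
        where
        D<D*complement : D < D * count (λ k → not (lookup c k))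
        D<D*complement = begin-strict
            D
          <⟨ m<m*n D 2 {{ℕ.>-nonZero (≤-trans (s≤s z≤n) D3)}} (s≤s (s≤s z≤n)) ⟩
            D * 2
          ≤⟨ *-monoʳ-≤ D (≤-trans (s≤s (s≤s z≤n)) (≤-trans D3 D≤complement)) ⟩
            D * count (λ k → not (lookup c k)) ∎
        ⟦⟧≤1 : ∀ b → ⟦ b ⟧ * 1 ≤ 1
        ⟦⟧≤1 true = ≤-refl
        ⟦⟧≤1 false = z≤n
        pw' : ∀ s → Dec (∣ s ∣ ≡ D) → ⟦ Raise (δ c) (δ s) ⟧ * 1 ≤ maybe′ (λ _ → 1) 0 (keepVertex n D s)
        pw' s (yes p) = ≤-trans (⟦⟧≤1 (Raise (δ c) (δ s))) (≤-reflexive (sym (cong (maybe′ (λ _ → 1) 0) (keepVertex-yes n D s p))))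
        pw' s (no np) = ≤-trans (≤-reflexive (cong (λ t → ⟦ t ⟧ * 1) (Raise-size x s np))) z≤n
        pw : ∀ s → ⟦ Raise (δ c) (δ s) ⟧ * 1 ≤ maybe′ (λ _ → 1) 0 (keepVertex n D s)
        pw s = pw' s (∣ s ∣ ℕ.≟ D)

      johnson-not-bipartite : ¬ Bipartite Γ
      johnson-not-bipartite (col , h) = tri (col x) (col v) (col w) (λ e → h v x avx (sym e)) (λ e → h w v awv (sym e)) (λ e → h w x awx (sym e))
        where
        ea = witness (lookup c) (≤-trans (s≤s z≤n) (≤-trans D3 (≤-reflexive (sym (size≡D x)))))
        a = proj₁ ea
        ca = proj₂ ea
        eb = twoWitnesses (lookup (notV c)) (≤-trans (≤-trans (s≤s (s≤s z≤n)) D3) D≤count-complement)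
        b = proj₁ eb
        b' = proj₁ (proj₂ eb)
        cb : lookup c b ≡ false
        cb = not-true (trans (sym (lookup-notV c b)) (proj₁ (proj₂ (proj₂ eb))))
        cb' : lookup c b' ≡ false
        cb' = not-true (trans (sym (lookup-notV c b')) (proj₁ (proj₂ (proj₂ (proj₂ eb)))))
        bb' = proj₂ (proj₂ (proj₂ (proj₂ eb)))
        sv = swap x a b ca cb
        v = proj₁ sv
        avx = proj₂ (proj₂ sv)
        vb : lookup (proj₁ v) b ≡ true
        vb = trans (cong (λ t → lookup t b) (proj₁ (proj₂ sv))) (lookup-set-same (set c a false) b true)
        vb' : lookup (proj₁ v) b' ≡ false
        vb' = trans (cong (λ t → lookup t b') (proj₁ (proj₂ sv))) (trans (lookup-set-other (set c a false) b b' true bb') (trans (lookup-set-other c a b' false (eqF-apart c a b' ca cb')) cb'))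
        sw = swap v b b' vb vb'
        w = proj₁ sw
        awv = proj₂ (proj₂ sw)
        sw' = swap x a b' ca cb'
        wvec : proj₁ w ≡ proj₁ (proj₁ sw')
        wvec = trans (proj₁ (proj₂ sw)) (trans (cong (λ t → set (set t b false) b' true) (proj₁ (proj₂ sv)))
          (trans (cong (λ t → set t b' true) (trans (set-set (set c a false) b true false) (set-id (set c a false) b false (trans (lookup-set-other c a b false (eqF-apart c a b ca cb)) cb)))) (sym (proj₁ (proj₂ sw')))))
        awx : Graph.adj Γ w x ≡ true
        awx = trans (cong (λ t → does (∣ t ∩ c ∣ ℕ.≟ D ∸ 1)) wvec) (proj₂ (proj₂ sw'))
        tri : ∀ (p q r : Bool) → ¬ (p ≡ q) → ¬ (q ≡ r) → ¬ (p ≡ r) → ⊥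
        tri true true r h1 h2 h3 = h1 refl
        tri false false r h1 h2 h3 = h1 refl
        tri true false true h1 h2 h3 = h3 refl
        tri true false false h1 h2 h3 = h2 refl
        tri false true true h1 h2 h3 = h2 refl
        tri false true false h1 h2 h3 = h3 refl

  module Distances (n D : ℕ) (x : JVtx n D) (D3 : 3 ≤ D) (nD : 2 * D ≤ n) where
    open Layers n D x
    open Bound D3 nD

    module DJ = LayerDistance Γ x ℓ eqV≡layer0 adj-ℓ-≤ ℓ-step ℓ<size

    distJ : ∀ v → dist Γ x v ≡ ℓ v
    distJ = DJ.dist≡ℓ

    adjᶠ-ℓ-≤ : ∀ w y → Graph.adj Γf w y ≡ true → ℓ y ≤ suc (ℓ w)
    adjᶠ-ℓ-≤ w y e = adj-ℓ-≤ w y (∧-true₁ e)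

    ℓ-stepᶠ : ∀ y m → ℓ y ≡ suc m → Σ V (λ w → (w ∈ vs) × (ℓ w ≡ m) × (Graph.adj Γf w y ≡ true))
    ℓ-stepᶠ y m e = w , mem , lw , trans (cong₂ (λ u v → u ∧ not v) aw (trans (cong₂ _≡ᵇ_ (trans (distJ w) lw) (trans (distJ y) e)) (does-≢ m (suc m) (λ q → 1+n≢n (sym q))))) refl
      where
      st = ℓ-step y m e
      w = proj₁ st
      mem = proj₁ (proj₂ st)
      lw = proj₁ (proj₂ (proj₂ st))
      aw = proj₂ (proj₂ (proj₂ st))

    module DF = LayerDistance Γf x ℓ eqV≡layer0 adjᶠ-ℓ-≤ ℓ-stepᶠ ℓ<size

    distF : ∀ v → dist Γf x v ≡ ℓ v
    distF = DF.dist≡ℓ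

    Lb≡Raise : ∀ y w → Lb y w ≡ Raise (δ (proj₁ y)) (δ (proj₁ w))
    Lb≡Raise y w = trans Lb-unfold (trans (decide (ℓ w ℕ.≟ suc (ℓ y))) (sym Raise-unfold))
      where
      Y = lookup (proj₁ y)
      W = lookup (proj₁ w)
      C = lookup c
      AJ = Graph.adj Γ y w
      α = count (λ k → lookup c k ∧ lookup (δ (proj₁ y)) k ∧ not (lookup (δ (proj₁ w)) k))
      β = count (λ k → lookup (notV c) k ∧ lookup (δ (proj₁ y)) k ∧ not (lookup (δ (proj₁ w)) k))
      Lb-unfold : Lb y w ≡ ((AJ ∧ not (ℓ y ≡ᵇ ℓ w)) ∧ (suc (ℓ y) ≡ᵇ ℓ w))
      Lb-unfold = cong₂ (λ p q → (AJ ∧ not p) ∧ q) (cong₂ _≡ᵇ_ (distJ y) (distJ w)) (cong₂ (λ a b → suc a ≡ᵇ b) (distF y) (distF w))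
      Raise-unfold : Raise (δ (proj₁ y)) (δ (proj₁ w)) ≡ (((α ≡ᵇ 0) ∧ (ℓ w ≡ᵇ suc (ℓ y))) ∧ ((β ≡ᵇ 0) ∧ (ℓ w ≡ᵇ suc (ℓ y))))
      Raise-unfold = cong₂ (λ p q → ((α ≡ᵇ 0) ∧ p) ∧ ((β ≡ᵇ 0) ∧ q)) (cong₂ (λ a b → a ≡ᵇ suc b) (δV-x w) (δV-x y)) (cong₂ (λ a b → a ≡ᵇ suc b) (δV-o w) (δV-o y))
      α' : α ≡ count (λ k → (W k ∧ C k) ∧ not (Y k))
      α' = count-cong (λ k → trans (cong₂ (λ u v → C k ∧ u ∧ not v) (lookup-xor (proj₁ y) c k) (lookup-xor (proj₁ w) c k)) (bb (Y k) (W k) (C k)))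
        where bb : ∀ y w c → (c ∧ (y xor c) ∧ not (w xor c)) ≡ ((w ∧ c) ∧ not y)
              bb true true true = refl
              bb true true false = refl
              bb true false true = refl
              bb true false false = refl
              bb false true true = refl
              bb false true false = refl
              bb false false true = refl
              bb false false false = refl
      β' : β ≡ count (λ k → (Y k ∧ not (C k)) ∧ not (W k))
      β' = count-cong (λ k → trans (cong₂ (λ u v → u ∧ v) (lookup-notV c k) (cong₂ (λ u v → u ∧ not v) (lookup-xor (proj₁ y) c k) (lookup-xor (proj₁ w) c k))) (bb (Y k) (W k) (C k)))
        where bb : ∀ y w c → (not c ∧ (y xor c) ∧ not (w xor c)) ≡ ((y ∧ not c) ∧ not w)
              bb true true true = refl
              bb true true false = refl
              bb true false true = refl
              bb true false false = refl
              bb false true true = refl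
              bb false true false = refl
              bb false false true = refl
              bb false false false = refl
      P = count (λ k → (Y k ∧ W k) ∧ C k)
      Q = count (λ k → (Y k ∧ W k) ∧ not (C k))
      size-identity : ℓ w ≡ suc (ℓ y) → suc (count (λ k → Y k ∧ W k) + (α + β)) ≡ D
      size-identity lw = begin
          suc (count (λ k → Y k ∧ W k) + (α + β))
        ≡⟨ cong₂ (λ u v → suc (u + v)) (count-split (λ k → Y k ∧ W k) C) (cong₂ _+_ α' β') ⟩
          suc ((P + Q) + (count (λ k → (W k ∧ C k) ∧ not (Y k)) + count (λ k → (Y k ∧ not (C k)) ∧ not (W k))))
        ≡⟨ solve 4 (λ P Q a b → con 1 :+ ((P :+ Q) :+ (a :+ b)) := (P :+ a) :+ (con 1 :+ (Q :+ b))) refl P Q (count (λ k → (W k ∧ C k) ∧ not (Y k))) (count (λ k → (Y k ∧ not (C k)) ∧ not (W k))) ⟩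
          (P + count (λ k → (W k ∧ C k) ∧ not (Y k))) + suc (Q + count (λ k → (Y k ∧ not (C k)) ∧ not (W k)))
        ≡⟨ cong₂ (λ u v → (u + count (λ k → (W k ∧ C k) ∧ not (Y k))) + suc (v + count (λ k → (Y k ∧ not (C k)) ∧ not (W k)))) (count-cong (λ k → b1 (Y k) (W k) (C k))) (count-cong (λ k → b2 (Y k) (W k) (C k))) ⟩
          (count (λ k → (W k ∧ C k) ∧ Y k) + count (λ k → (W k ∧ C k) ∧ not (Y k))) + suc (count (λ k → (Y k ∧ not (C k)) ∧ W k) + count (λ k → (Y k ∧ not (C k)) ∧ not (W k)))
        ≡⟨ cong₂ (λ u v → u + suc v) (sym (count-split (λ k → W k ∧ C k) Y)) (sym (count-split (λ k → Y k ∧ not (C k)) W)) ⟩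
          count (λ k → W k ∧ C k) + suc (ℓ y)
        ≡⟨ cong (count (λ k → W k ∧ C k) +_) (sym lw) ⟩
          count (λ k → W k ∧ C k) + ℓ w
        ≡⟨ sym (count-split W C) ⟩
          count W
        ≡⟨ size≡D w ⟩
          D ∎
        where
        open ≡-Reasoning
        open +-*-Solver using (solve; _:+_; _:=_; con)
        b1 : ∀ y w c → ((y ∧ w) ∧ c) ≡ ((w ∧ c) ∧ y)
        b1 true true true = refl
        b1 true true false = refl
        b1 true false c = refl
        b1 false true true = refl
        b1 false true false = refl
        b1 false false c = refl
        b2 : ∀ y w c → ((y ∧ w) ∧ not c) ≡ ((y ∧ not c) ∧ w)
        b2 true true true = refl
        b2 true true false = refl
        b2 true false true = refl
        b2 true false false = refl
        b2 false w c = refl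
      decide : Dec (ℓ w ≡ suc (ℓ y)) → ((AJ ∧ not (ℓ y ≡ᵇ ℓ w)) ∧ (suc (ℓ y) ≡ᵇ ℓ w)) ≡ (((α ≡ᵇ 0) ∧ (ℓ w ≡ᵇ suc (ℓ y))) ∧ ((β ≡ᵇ 0) ∧ (ℓ w ≡ᵇ suc (ℓ y))))
      decide (yes e) rewrite e | ≡ᵇ-refl (ℓ y) | does-≢ (ℓ y) (suc (ℓ y)) (λ q → 1+n≢n (sym q)) =
        trans (∧-identityʳ (AJ ∧ true)) (trans (∧-identityʳ AJ) (trans (cong (_≡ᵇ D ∸ 1) (card∩≡count (proj₁ y) (proj₁ w)))
          (trans (pred-≡ᵇ-split (count (λ k → Y k ∧ W k)) α β D (size-identity e)) (sym (cong₂ _∧_ (∧-identityʳ (α ≡ᵇ 0)) (∧-identityʳ (β ≡ᵇ 0)))))))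
      decide (no ne) = trans (trans (cong ((AJ ∧ not (ℓ y ≡ᵇ ℓ w)) ∧_) (does-≢ (suc (ℓ y)) (ℓ w) (λ q → ne (sym q)))) (∧-zeroʳ _))
        (sym (trans (cong (λ t → ((α ≡ᵇ 0) ∧ t) ∧ ((β ≡ᵇ 0) ∧ t)) (does-≢ (ℓ w) (suc (ℓ y)) ne)) (cong (_∧ ((β ≡ᵇ 0) ∧ false)) (∧-zeroʳ (α ≡ᵇ 0)))))

    ΣV-raise : ∀ (y : V) (H : Vec Bool n → ℕ) →
      ΣV (λ w → ⟦ Lb y w ⟧ * H (δ (proj₁ w))) ≡
      ΣF n (λ a → ⟦ lookup c a ∧ not (lookup (δ (proj₁ y)) a) ⟧ *
        ΣF n (λ b → ⟦ not (lookup c b) ∧ not (lookup (δ (proj₁ y)) b) ⟧ * H (set (set (δ (proj₁ y)) a true) b true)))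
    ΣV-raise y H = trans (ΣV≡ΣS _ (λ s → ⟦ Raise S (δ s) ⟧ * H (δ s)) (λ s p → cong (λ t → ⟦ t ⟧ * H (δ s)) (Lb≡Raise y (s , p))) (λ s np → cong (λ t → ⟦ t ⟧ * H (δ s)) (Raise-size y s np)))
      (trans (sym (ΣS-xor n c (λ W → ⟦ Raise S W ⟧ * H W))) (trans (ΣS-cong n (λ W → ⟦∧⟧* (Above 1 c S W) (Above 1 (notV c) S W) (H W))) (ΣS-above₁₁ c S H)))
      where S = δ (proj₁ y)

    ΣV-lower : ∀ (y : V) (H : Vec Bool n → ℕ) →
      ΣV (λ w → ⟦ Lb w y ⟧ * H (δ (proj₁ w))) ≡
      ΣF n (λ a → ⟦ lookup c a ∧ lookup (δ (proj₁ y)) a ⟧ *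
        ΣF n (λ b → ⟦ not (lookup c b) ∧ lookup (δ (proj₁ y)) b ⟧ * H (set (set (δ (proj₁ y)) a false) b false)))
    ΣV-lower y H = trans (ΣV≡ΣS _ (λ s → ⟦ Raise (δ s) S ⟧ * H (δ s)) (λ s p → cong (λ t → ⟦ t ⟧ * H (δ s)) (Lb≡Raise (s , p) y)) (λ s np → cong (λ t → ⟦ t ⟧ * H (δ s)) (Raise-size′ y s np)))
      (trans (sym (ΣS-xor n c (λ W → ⟦ Raise W S ⟧ * H W))) (trans (ΣS-cong n (λ W → ⟦∧⟧* (Above 1 c W S) (Above 1 (notV c) W S) (H W))) (ΣS-below₁₁ c S H)))
      where S = δ (proj₁ y)

    vertex-≡ : ∀ (v w : V) → proj₁ v ≡ proj₁ w → v ≡ w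
    vertex-≡ (s , p) (.s , q) refl = cong (s ,_) (≡-irrelevant p q)

    ΣV-diagonal : ∀ (h : V → ℕ) (z : V) i → ℓ z ≡ i →
      ΣV (λ w → h w * ⟦ Graph.eqV Γ w z ∧ does (dist Γf x w ℕ.≟ i) ⟧) ≡ h z
    ΣV-diagonal h z i lz = trans (ΣV≡ΣS _ (λ s → ⟦ does (≡-dec _≟B_ s (proj₁ z)) ⟧ * h z) h1 h2) (ΣS-point n (proj₁ z) (h z))
      where
      h1' : ∀ s p (d : Dec (s ≡ proj₁ z)) → h (s , p) * ⟦ does d ∧ (ℓ (s , p) ≡ᵇ i) ⟧ ≡ ⟦ does d ⟧ * h z
      h1' s p (yes e) = trans (cong (λ v → h v * ⟦ ℓ v ≡ᵇ i ⟧) (vertex-≡ (s , p) z e)) (trans (cong (λ t → h z * ⟦ t ≡ᵇ i ⟧) lz) (trans (cong (λ t → h z * ⟦ t ⟧) (≡ᵇ-refl i)) (trans (*-identityʳ (h z)) (sym (+-identityʳ (h z))))))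
      h1' s p (no _) = *-zeroʳ (h (s , p))
      h1 : ∀ s p → h (s , p) * ⟦ does (≡-dec _≟B_ s (proj₁ z)) ∧ does (dist Γf x (s , p) ℕ.≟ i) ⟧ ≡ ⟦ does (≡-dec _≟B_ s (proj₁ z)) ⟧ * h z
      h1 s p = trans (cong (λ t → h (s , p) * ⟦ does (≡-dec _≟B_ s (proj₁ z)) ∧ (t ≡ᵇ i) ⟧) (distF (s , p))) (h1' s p (≡-dec _≟B_ s (proj₁ z)))
      h2' : ∀ s → ¬ (∣ s ∣ ≡ D) → (d : Dec (s ≡ proj₁ z)) → ⟦ does d ⟧ * h z ≡ 0
      h2' s np (yes e) = ⊥-elim (np (trans (cong ∣_∣ e) (proj₂ z)))
      h2' s np (no _) = refl
      h2 : ∀ s → ¬ (∣ s ∣ ≡ D) → ⟦ does (≡-dec _≟B_ s (proj₁ z)) ⟧ * h z ≡ 0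
      h2 s np = h2' s np (≡-dec _≟B_ s (proj₁ z))

    ΣV-cong : ∀ {g h : V → ℕ} → (∀ v → g v ≡ h v) → ΣV g ≡ ΣV h
    ΣV-cong {g} {h} e = go vs
      where
      go : ∀ L → foldr (λ v acc → g v + acc) 0 L ≡ foldr (λ v acc → h v + acc) 0 L
      go [] = refl
      go (v ∷ L) = cong₂ _+_ (e v) (go L)

    cRLL cLRL cLLR : V → V → ℕ
    cRLL y z = ΣV (λ u → ⟦ Lb u y ⟧ * ΣV (λ v → ⟦ Lb u v ⟧ * ⟦ Lb v z ⟧))
    cLRL y z = ΣV (λ u → ⟦ Lb y u ⟧ * ΣV (λ v → ⟦ Lb v u ⟧ * ⟦ Lb v z ⟧))
    cLLR y z = ΣV (λ u → ⟦ Lb y u ⟧ * ΣV (λ v → ⟦ Lb u v ⟧ * ⟦ Lb z v ⟧))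

    cRLL≡walks⊗ : ∀ y z → cRLL y z ≡ walks⊗ down up up c (δ (proj₁ y)) (δ (proj₁ z))
    cRLL≡walks⊗ y z = trans (ΣV-cong (λ u → cong (⟦ Lb u y ⟧ *_) (inner u))) (ΣV-lower y (λ U → tail⊗ up up c U T))
      where
      T = δ (proj₁ z)
      inner : ∀ u → ΣV (λ v → ⟦ Lb u v ⟧ * ⟦ Lb v z ⟧) ≡ tail⊗ up up c (δ (proj₁ u)) T
      inner u = trans (ΣV-cong (λ v → cong (λ t → ⟦ Lb u v ⟧ * ⟦ t ⟧) (Lb≡Raise v z))) (ΣV-raise u (λ W → ⟦ Raise W T ⟧))

    cLRL≡walks⊗ : ∀ y z → cLRL y z ≡ walks⊗ up down up c (δ (proj₁ y)) (δ (proj₁ z))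
    cLRL≡walks⊗ y z = trans (ΣV-cong (λ u → cong (⟦ Lb y u ⟧ *_) (inner u))) (ΣV-raise y (λ U → tail⊗ down up c U T))
      where
      T = δ (proj₁ z)
      inner : ∀ u → ΣV (λ v → ⟦ Lb v u ⟧ * ⟦ Lb v z ⟧) ≡ tail⊗ down up c (δ (proj₁ u)) T
      inner u = trans (ΣV-cong (λ v → cong (λ t → ⟦ Lb v u ⟧ * ⟦ t ⟧) (Lb≡Raise v z))) (ΣV-lower u (λ W → ⟦ Raise W T ⟧))

    cLLR≡walks⊗ : ∀ y z → cLLR y z ≡ walks⊗ up up down c (δ (proj₁ y)) (δ (proj₁ z))
    cLLR≡walks⊗ y z = trans (ΣV-cong (λ u → cong (⟦ Lb y u ⟧ *_) (inner u))) (ΣV-raise y (λ U → tail⊗ up down c U T))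
      where
      T = δ (proj₁ z)
      inner : ∀ u → ΣV (λ v → ⟦ Lb u v ⟧ * ⟦ Lb z v ⟧) ≡ tail⊗ up down c (δ (proj₁ u)) T
      inner u = trans (ΣV-cong (λ v → cong (λ t → ⟦ Lb u v ⟧ * ⟦ t ⟧) (Lb≡Raise z v))) (ΣV-raise u (λ W → ⟦ Raise T W ⟧))

  -- y has δ-set S with k elements on each side.  The δ-set of zA is S - q' + r' + s' inside x and
  -- S - q + r + s outside; that of zB is S + r' inside and S - q + r + s outside.  Neither is adjacent
  -- to y, and the walk counts factor as 2·2 (both sides far), resp. (cover count)·2.
  module Configuration (n D : ℕ) (x : JVtx n D) (D3 : 3 ≤ D) (nD : 2 * D ≤ n) (k : ℕ) (k1 : 1 ≤ k) (kD : k + 2 ≤ D) where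
    open Layers n D x
    open Layers.Bound n D x D3 nD
    open Distances n D x D3 nD

    nc = notV c

    nc-c : ∀ j → lookup nc j ≡ true → lookup c j ≡ false
    nc-c j e = not-true (trans (sym (lookup-notV c j)) e)
    c-nc : ∀ j → lookup c j ≡ true → lookup nc j ≡ false
    c-nc j e = trans (lookup-notV c j) (cong not e)

    S = proj₁ (balancedSet k (≤-trans (m≤m+n k 2) kD))
    Sc : cardOn S c ≡ k
    Sc = proj₁ (proj₂ (balancedSet k (≤-trans (m≤m+n k 2) kD)))
    So : cardOn S nc ≡ k
    So = proj₂ (proj₂ (balancedSet k (≤-trans (m≤m+n k 2) kD)))

    N1 = count (λ a → lookup c a ∧ not (lookup S a))

    N1+k≡D : N1 + k ≡ D
    N1+k≡D = trans (+-comm _ k) (trans (cong (_+ count (λ j → lookup c j ∧ not (lookup S j))) (trans (sym Sc) (sym (count-cardOn S c)))) (trans (sym (count-split (lookup c) (lookup S))) (size≡D x)))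
    free-outside+k : count (λ j → lookup nc j ∧ not (lookup S j)) + k ≡ count (lookup nc)
    free-outside+k = trans (+-comm _ k) (trans (cong (_+ count (λ j → lookup nc j ∧ not (lookup S j))) (trans (sym So) (sym (count-cardOn S nc)))) (sym (count-split (lookup nc) (lookup S))))

    two≤ : ∀ a → a + k ≡ D → 2 ≤ a
    two≤ a e = +-cancelʳ-≤ k 2 a (≤-trans (≤-reflexive (+-comm 2 k)) (≤-trans kD (≤-reflexive (sym e))))
    two≤′ : ∀ a → D ≤ a + k → 2 ≤ a
    two≤′ a e = +-cancelʳ-≤ k 2 a (≤-trans (≤-reflexive (+-comm 2 k)) (≤-trans kD e))

    eq' = witness (λ j → lookup c j ∧ lookup S j) (≤-trans k1 (≤-reflexive (sym (trans (count-cardOn S c) Sc))))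
    q' = proj₁ eq'
    cq' : lookup c q' ≡ true
    cq' = ∧-true₁ (proj₂ eq')
    sq' : lookup S q' ≡ true
    sq' = ∧-true₂ {lookup c q'} (proj₂ eq')
    e2' = twoWitnesses (λ j → lookup c j ∧ not (lookup S j)) (two≤ _ N1+k≡D)
    r' = proj₁ e2'
    s' = proj₁ (proj₂ e2')
    cr' : lookup c r' ≡ true
    cr' = ∧-true₁ (proj₁ (proj₂ (proj₂ e2')))
    sr' : lookup S r' ≡ false
    sr' = not-true (∧-true₂ {lookup c r'} (proj₁ (proj₂ (proj₂ e2'))))
    cs' : lookup c s' ≡ true
    cs' = ∧-true₁ (proj₁ (proj₂ (proj₂ (proj₂ e2'))))
    ss' : lookup S s' ≡ false
    ss' = not-true (∧-true₂ {lookup c s'} (proj₁ (proj₂ (proj₂ (proj₂ e2')))))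
    r's' = proj₂ (proj₂ (proj₂ (proj₂ e2')))

    eq = witness (λ j → lookup nc j ∧ lookup S j) (≤-trans k1 (≤-reflexive (sym (trans (count-cardOn S nc) So))))
    q = proj₁ eq
    cq : lookup nc q ≡ true
    cq = ∧-true₁ (proj₂ eq)
    sq : lookup S q ≡ true
    sq = ∧-true₂ {lookup nc q} (proj₂ eq)
    e2 = twoWitnesses (λ j → lookup nc j ∧ not (lookup S j)) (two≤′ _ (≤-trans D≤count-complement (≤-reflexive (sym free-outside+k))))
    r = proj₁ e2
    s = proj₁ (proj₂ e2)
    cr : lookup nc r ≡ true
    cr = ∧-true₁ (proj₁ (proj₂ (proj₂ e2)))
    sr : lookup S r ≡ false
    sr = not-true (∧-true₂ {lookup nc r} (proj₁ (proj₂ (proj₂ e2))))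
    cs : lookup nc s ≡ true
    cs = ∧-true₁ (proj₁ (proj₂ (proj₂ (proj₂ e2))))
    ss : lookup S s ≡ false
    ss = not-true (∧-true₂ {lookup nc s} (proj₁ (proj₂ (proj₂ (proj₂ e2)))))
    rs = proj₂ (proj₂ (proj₂ (proj₂ e2)))

    module FX = Far c S q' r' s' cq' sq' cr' sr' cs' ss' r's'
    module FO = Far nc S q r s cq sq cr sr cs ss rs

    TB = set (set (set (set S r' true) q false) r true) s true
    TA = set (set (set FX.T q false) r true) s true

    X = set S r' true
    agTBc : AgreeOn c TB X
    agTBc = ag-skip c (set (set X q false) r true) X s true (ag-skip c (set X q false) X r true (ag-skip c X X q false (ag-refl c X) (nc-c q cq)) (nc-c r cr)) (nc-c s cs)
    agTBn : AgreeOn nc TB FO.T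
    agTBn = ag-both nc (set (set X q false) r true) (set (set S q false) r true) s true (ag-both nc (set X q false) (set S q false) r true (ag-both nc X S q false (ag-skip nc S S r' true (ag-refl nc S) (c-nc r' cr'))))
    Y = FX.T
    agTAc : AgreeOn c TA Y
    agTAc = ag-skip c (set (set Y q false) r true) Y s true (ag-skip c (set Y q false) Y r true (ag-skip c Y Y q false (ag-refl c Y) (nc-c q cq)) (nc-c r cr)) (nc-c s cs)
    agY : AgreeOn nc Y S
    agY = ag-skip nc (set (set S q' false) r' true) S s' true (ag-skip nc (set S q' false) S r' true (ag-skip nc S S q' false (ag-refl nc S) (c-nc q' cq')) (c-nc r' cr')) (c-nc s' cs')
    agTAn : AgreeOn nc TA FO.T
    agTAn = ag-both nc (set (set Y q false) r true) (set (set S q false) r true) s true (ag-both nc (set Y q false) (set S q false) r true (ag-both nc Y S q false agY))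

    TBc : cardOn TB c ≡ suc k
    TBc = trans (cardOn-agree c TB X agTBc) (trans (cardOn-add S c r' cr' sr') (cong suc Sc))
    TBn : cardOn TB nc ≡ suc k
    TBn = trans (cardOn-agree nc TB FO.T agTBn) (trans FO.cardT (cong suc So))
    TAc : cardOn TA c ≡ suc k
    TAc = trans (cardOn-agree c TA FX.T agTAc) (trans FX.cardT (cong suc Sc))
    TAn : cardOn TA nc ≡ suc k
    TAn = trans (cardOn-agree nc TA FO.T agTAn) (trans FO.cardT (cong suc So))

    y zA zB : V
    y = vertexOf S (trans Sc (sym So))
    zA = vertexOf TA (trans TAc (sym TAn))
    zB = vertexOf TB (trans TBc (sym TBn))

    ℓzA : ℓ zA ≡ suc k
    ℓzA = trans (ℓ-vertexOf TA (trans TAc (sym TAn))) TAn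
    ℓzB : ℓ zB ≡ suc k
    ℓzB = trans (ℓ-vertexOf TB (trans TBc (sym TBn))) TBn

    Tq : ∀ (Z : Vec Bool n) → lookup (set (set (set Z q false) r true) s true) q ≡ false
    Tq Z = trans (lookup-set-other (set (set Z q false) r true) s q true (trans (eqF-sym s q) FO.qs)) (trans (lookup-set-other (set Z q false) r q true (trans (eqF-sym r q) FO.qr)) (lookup-set-same Z q false))

    Raise-false : ∀ (Z : Vec Bool n) → Raise S (set (set (set Z q false) r true) s true) ≡ false
    Raise-false Z = trans (cong (Above 1 c S T ∧_) (cong (_∧ (cardOn T nc ≡ᵇ 1 + cardOn S nc)) (includedOn-false nc S T q (trans (cong₂ (λ u v → u ∧ v ∧ not (lookup T q)) cq sq) (cong not (Tq Z)))))) (∧-zeroʳ _)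
      where T = set (set (set Z q false) r true) s true

    LbA : Lb y zA ≡ false
    LbA = trans (Lb≡Raise y zA) (trans (cong₂ Raise (xor-invol S) (xor-invol TA)) (Raise-false FX.T))
    LbB : Lb y zB ≡ false
    LbB = trans (Lb≡Raise y zB) (trans (cong₂ Raise (xor-invol S) (xor-invol TB)) (Raise-false (set S r' true)))

    M = Cover.UpUpDown.M c S r' cr' sr'
    N1≡1+M : N1 ≡ suc M
    N1≡1+M = Cover.UpUpDown.M-prop c S r' cr' sr'

    B-RLL : cRLL y zB ≡ (k * 2) * 2
    B-RLL = trans (cRLL≡walks⊗ y zB) (trans (cong₂ (walks⊗ down up up c) (xor-invol S) (xor-invol TB)) (trans (walks⊗-factor down up up c S TB)
      (cong₂ _*_ (trans (walks-agreeʳ down up up c S TB X agTBc) (trans (Cover.DownUpUp.walks-count c S r' cr' sr') (cong (_* 2) Sc))) (trans (walks-agreeʳ down up up nc S TB FO.T agTBn) FO.DownUpUp.walks-count))))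
    B-LRL : cLRL y zB ≡ (k + N1) * 2
    B-LRL = trans (cLRL≡walks⊗ y zB) (trans (cong₂ (walks⊗ up down up c) (xor-invol S) (xor-invol TB)) (trans (walks⊗-factor up down up c S TB)
      (cong₂ _*_ (trans (walks-agreeʳ up down up c S TB X agTBc) (trans (Cover.UpDownUp.walks-count c S r' cr' sr') (cong (_+ N1) Sc))) (trans (walks-agreeʳ up down up nc S TB FO.T agTBn) FO.UpDownUp.walks-count))))
    B-LLR : cLLR y zB ≡ (M + M) * 2
    B-LLR = trans (cLLR≡walks⊗ y zB) (trans (cong₂ (walks⊗ up up down c) (xor-invol S) (xor-invol TB)) (trans (walks⊗-factor up up down c S TB)
      (cong₂ _*_ (trans (walks-agreeʳ up up down c S TB X agTBc) (Cover.UpUpDown.walks-count c S r' cr' sr')) (trans (walks-agreeʳ up up down nc S TB FO.T agTBn) FO.UpUpDown.walks-count))))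

    A-RLL : cRLL y zA ≡ 2 * 2
    A-RLL = trans (cRLL≡walks⊗ y zA) (trans (cong₂ (walks⊗ down up up c) (xor-invol S) (xor-invol TA)) (trans (walks⊗-factor down up up c S TA)
      (cong₂ _*_ (trans (walks-agreeʳ down up up c S TA FX.T agTAc) FX.DownUpUp.walks-count) (trans (walks-agreeʳ down up up nc S TA FO.T agTAn) FO.DownUpUp.walks-count))))
    A-LRL : cLRL y zA ≡ 2 * 2
    A-LRL = trans (cLRL≡walks⊗ y zA) (trans (cong₂ (walks⊗ up down up c) (xor-invol S) (xor-invol TA)) (trans (walks⊗-factor up down up c S TA)
      (cong₂ _*_ (trans (walks-agreeʳ up down up c S TA FX.T agTAc) FX.UpDownUp.walks-count) (trans (walks-agreeʳ up down up nc S TA FO.T agTAn) FO.UpDownUp.walks-count))))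
    A-LLR : cLLR y zA ≡ 2 * 2
    A-LLR = trans (cLLR≡walks⊗ y zA) (trans (cong₂ (walks⊗ up up down c) (xor-invol S) (xor-invol TA)) (trans (walks⊗-factor up up down c S TA)
      (cong₂ _*_ (trans (walks-agreeʳ up up down c S TA FX.T agTAc) FX.UpUpDown.walks-count) (trans (walks-agreeʳ up up down nc S TA FO.T agTAn) FO.UpUpDown.walks-count))))

  module Eccentricity (n D : ℕ) (x : JVtx n D) (D3 : 3 ≤ D) (nD : 2 * D ≤ n) where
    open Layers n D x
    open Layers.Bound n D x D3 nD
    open Distances n D x D3 nD

    far-vertex : Σ V (λ w → ℓ w ≡ D)
    far-vertex = vertexOf S (trans S∩c (sym S∩nc)) , trans (ℓ-vertexOf S (trans S∩c (sym S∩nc))) S∩nc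
      where
      S = proj₁ (balancedSet D ≤-refl)
      S∩c = proj₁ (proj₂ (balancedSet D ≤-refl))
      S∩nc = proj₂ (proj₂ (balancedSet D ≤-refl))

    D≤ecc : D ≤ ecc Γf x
    D≤ecc = ≤-trans (≤-reflexive (trans (sym (proj₂ far-vertex)) (sym (distF (proj₁ far-vertex))))) (ecc-lb Γf (dist Γf x) vs (proj₁ far-vertex) (∈verts (proj₁ far-vertex)))

module UniformStructureEquations where

  open import Data.Nat as ℕ using (ℕ; zero; suc; _≤_; z≤n; s≤s)
  import Data.Nat.Properties as ℕP
  open import Data.Nat.Solver using (module +-*-Solver)
  open import Data.Bool using (Bool; true; false; if_then_else_; _∧_)
  open import Data.List using (List; []; _∷_; foldr)
  open import Data.Product using (Σ; _,_; proj₁; proj₂)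
  open import Data.Sum using (_⊎_; inj₁; inj₂; [_,_])
  open import Data.Empty using (⊥)
  open import Relation.Nullary using (¬_; does; contradiction)
  import Relation.Binary.PropositionalEquality as P
  open BooleanLattice using (⟦_⟧; does-≢)
  open JohnsonGraph

  module FieldArithmetic {c ℓ : Level} (K : ACField c ℓ) where
    open ACField K
    open import Relation.Binary.Reasoning.Setoid setoid
    open import Algebra.Properties.CommutativeSemigroup +-commutativeSemigroup using () renaming (interchange to +-interchange)

    ι : ℕ → Carrier
    ι m = m • 1#

    ι-+ : ∀ a b → ι (a ℕ.+ b) ≈ ι a + ι b
    ι-+ zero b = sym (+-identityˡ _)
    ι-+ (suc a) b = trans (+-cong refl (ι-+ a b)) (sym (+-assoc _ _ _))

    ι-* : ∀ a b → ι (a ℕ.* b) ≈ ι a * ι b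
    ι-* zero b = sym (zeroˡ _)
    ι-* (suc a) b = begin
      ι (b ℕ.+ a ℕ.* b)      ≈⟨ ι-+ b (a ℕ.* b) ⟩
      ι b + ι (a ℕ.* b)      ≈⟨ +-cong (sym (*-identityˡ _)) (ι-* a b) ⟩
      1# * ι b + ι a * ι b   ≈⟨ sym (distribʳ _ _ _) ⟩
      (1# + ι a) * ι b       ∎

    ι-≡ : ∀ {a b} → a P.≡ b → ι a ≈ ι b
    ι-≡ P.refl = refl

    indicator : Bool → Carrier
    indicator b = if b then 1# else 0#

    indicator≈ι : ∀ b → indicator b ≈ ι ⟦ b ⟧
    indicator≈ι true = sym (+-identityʳ _)
    indicator≈ι false = refl

    indicator-* : ∀ a b → indicator a * indicator b ≈ ι (⟦ a ⟧ ℕ.* ⟦ b ⟧)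
    indicator-* a b = trans (*-cong (indicator≈ι a) (indicator≈ι b)) (sym (ι-* ⟦ a ⟧ ⟦ b ⟧))

    *ι-cancel : ∀ u m → u * ι (suc m) ≈ 0# → u ≈ 0#
    *ι-cancel u m e = begin
      u                             ≈⟨ sym (*-identityʳ u) ⟩
      u * 1#                        ≈⟨ *-cong refl (sym (proj₂ inv)) ⟩
      u * (ι (suc m) * proj₁ inv)   ≈⟨ sym (*-assoc u _ _) ⟩
      (u * ι (suc m)) * proj₁ inv   ≈⟨ *-cong e refl ⟩
      0# * proj₁ inv                ≈⟨ zeroˡ _ ⟩
      0#                            ∎
      where
      inv = inverse (ι (suc m)) (charZero m)

    module _ {A : Set} where
      ΣL : (A → Carrier) → List A → Carrier
      ΣL F L = foldr (λ v acc → F v + acc) 0# L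

      ΣLℕ : (A → ℕ) → List A → ℕ
      ΣLℕ g L = foldr (λ v acc → g v ℕ.+ acc) 0 L

      ΣL-ι : ∀ (g : A → ℕ) L → ΣL (λ v → ι (g v)) L ≈ ι (ΣLℕ g L)
      ΣL-ι g [] = refl
      ΣL-ι g (v ∷ L) = trans (+-cong refl (ΣL-ι g L)) (sym (ι-+ (g v) _))

      ΣL-cong : ∀ {F G : A → Carrier} L → (∀ v → F v ≈ G v) → ΣL F L ≈ ΣL G L
      ΣL-cong [] e = refl
      ΣL-cong (v ∷ L) e = +-cong (e v) (ΣL-cong L e)

      ΣL-+ : ∀ (F G : A → Carrier) L → ΣL (λ v → F v + G v) L ≈ ΣL F L + ΣL G L
      ΣL-+ F G [] = sym (+-identityʳ _)
      ΣL-+ F G (v ∷ L) = trans (+-cong refl (ΣL-+ F G L)) (+-interchange _ _ _ _)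

      ΣL-* : ∀ (a : Carrier) (F : A → Carrier) L → ΣL (λ v → a * F v) L ≈ a * ΣL F L
      ΣL-* a F [] = sym (zeroʳ a)
      ΣL-* a F (v ∷ L) = trans (+-cong refl (ΣL-* a F L)) (sym (distribˡ a _ _))

      ΣL-walks : ∀ (P : A → Bool) (Q : A → A → Bool) (R : A → Bool) L →
        ΣL (λ u → indicator (P u) * ΣL (λ v → indicator (Q u v) * indicator (R v)) L) L
          ≈ ι (ΣLℕ (λ u → ⟦ P u ⟧ ℕ.* ΣLℕ (λ v → ⟦ Q u v ⟧ ℕ.* ⟦ R v ⟧) L) L)
      ΣL-walks P Q R L = trans (ΣL-cong L inner) (ΣL-ι _ L)
        where
        inner : ∀ u → indicator (P u) * ΣL (λ v → indicator (Q u v) * indicator (R v)) L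
                      ≈ ι (⟦ P u ⟧ ℕ.* ΣLℕ (λ v → ⟦ Q u v ⟧ ℕ.* ⟦ R v ⟧) L)
        inner u = trans (*-cong (indicator≈ι (P u)) (trans (ΣL-cong L (λ v → indicator-* (Q u v) (R v))) (ΣL-ι _ L)))
                        (sym (ι-* ⟦ P u ⟧ _))

    -- The left-hand side of the identity at an entry with a RLL-, b LRL- and c′ LLR-walks.
    E : Carrier → Carrier → ℕ → ℕ → ℕ → Carrier
    E u v a b c′ = (u * ι a + ι b) + v * ι c′

    E-cong : ∀ u v {a b c′ a′ b′ c″} → a P.≡ a′ → b P.≡ b′ → c′ P.≡ c″ → E u v a b c′ ≈ E u v a′ b′ c″
    E-cong u v ea eb ec = +-cong (+-cong (*-cong refl (ι-≡ ea)) (ι-≡ eb)) (*-cong refl (ι-≡ ec))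

    E-+ : ∀ u v a b c′ a′ b′ c″ → E u v (a ℕ.+ a′) (b ℕ.+ b′) (c′ ℕ.+ c″) ≈ E u v a b c′ + E u v a′ b′ c″
    E-+ u v a b c′ a′ b′ c″ = begin
        (u * ι (a ℕ.+ a′) + ι (b ℕ.+ b′)) + v * ι (c′ ℕ.+ c″)
      ≈⟨ +-cong (+-cong (trans (*-cong refl (ι-+ a a′)) (distribˡ u _ _)) (ι-+ b b′))
                (trans (*-cong refl (ι-+ c′ c″)) (distribˡ v _ _)) ⟩
        ((u * ι a + u * ι a′) + (ι b + ι b′)) + (v * ι c′ + v * ι c″)
      ≈⟨ +-cong (+-interchange _ _ _ _) refl ⟩
        ((u * ι a + ι b) + (u * ι a′ + ι b′)) + (v * ι c′ + v * ι c″)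
      ≈⟨ +-interchange _ _ _ _ ⟩
        E u v a b c′ + E u v a′ b′ c″
      ∎

    E-* : ∀ u v a b c′ t → E u v (a ℕ.* t) (b ℕ.* t) (c′ ℕ.* t) ≈ E u v a b c′ * ι t
    E-* u v a b c′ t = begin
        (u * ι (a ℕ.* t) + ι (b ℕ.* t)) + v * ι (c′ ℕ.* t)
      ≈⟨ +-cong (+-cong (*-cong refl (ι-* a t)) (ι-* b t)) (*-cong refl (ι-* c′ t)) ⟩
        (u * (ι a * ι t) + ι b * ι t) + v * (ι c′ * ι t)
      ≈⟨ +-cong (+-cong (sym (*-assoc u _ _)) refl) (sym (*-assoc v _ _)) ⟩
        ((u * ι a) * ι t + ι b * ι t) + (v * ι c′) * ι t
      ≈⟨ sym (trans (distribʳ (ι t) _ _) (+-cong (distribʳ (ι t) _ _) refl)) ⟩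
        E u v a b c′ * ι t
      ∎

    E-difference : ∀ u v a b c′ a′ b′ c″ → E u v a b c′ ≈ 0# → E u v (a ℕ.+ a′) (b ℕ.+ b′) (c′ ℕ.+ c″) ≈ 0# →
      E u v a′ b′ c″ ≈ 0#
    E-difference u v a b c′ a′ b′ c″ e₀ e₁ = begin
      E u v a′ b′ c″                              ≈⟨ sym (+-identityˡ _) ⟩
      0# + E u v a′ b′ c″                         ≈⟨ +-cong (sym e₀) refl ⟩
      E u v a b c′ + E u v a′ b′ c″               ≈⟨ sym (E-+ u v a b c′ a′ b′ c″) ⟩
      E u v (a ℕ.+ a′) (b ℕ.+ b′) (c′ ℕ.+ c″)     ≈⟨ e₁ ⟩
      0#                                          ∎

    E-middle : ∀ u v b → E u v 0 b 0 ≈ ι b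
    E-middle u v b = trans (+-cong (trans (+-cong (zeroʳ u) refl) (+-identityˡ _)) (zeroʳ v)) (+-identityʳ _)

    E-left : ∀ u v a → E u v a 0 0 ≈ u * ι a
    E-left u v a = trans (+-cong (+-identityʳ _) (zeroʳ v)) (+-identityʳ _)

    E-right : ∀ u v c′ → E u v 0 0 c′ ≈ v * ι c′
    E-right u v c′ = trans (+-cong (trans (+-cong (zeroʳ u) refl) (+-identityˡ _)) refl) (+-identityˡ _)

  module MatrixEntries {c ℓ₁ : Level} (K : ACField c ℓ₁) (n D : ℕ) (x : JVtx n D) (D3 : 3 ≤ D) (nD : 2 ℕ.* D ≤ n) where
    open ACField K
    open FieldArithmetic K
    open Layers n D x
    open Distances n D x D3 nD
    open import Relation.Binary.Reasoning.Setoid setoid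

    Lm : V → V → Carrier
    Lm y z = indicator (Lb y z)

    InLayer : ℕ → V → V → Bool
    InLayer i w z = Graph.eqV Γ w z ∧ does (dist Γf x w ℕ.≟ i)

    RLL LRL LLR : V → V → Carrier
    RLL y w = ΣL (λ u → Lm u y * ΣL (λ v → Lm u v * Lm v w) vs) vs
    LRL y w = ΣL (λ u → Lm y u * ΣL (λ v → Lm v u * Lm v w) vs) vs
    LLR y w = ΣL (λ u → Lm y u * ΣL (λ v → Lm u v * Lm w v) vs) vs

    ΣL-layer : ∀ (g : V → ℕ) i z → ℓ z P.≡ i → ΣL (λ w → ι (g w ℕ.* ⟦ InLayer i w z ⟧)) vs ≈ ι (g z)
    ΣL-layer g i z ℓz = trans (ΣL-ι _ vs) (ι-≡ (ΣV-diagonal g z i ℓz))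

    lhs-entry : ∀ (u v : Carrier) i (y z : V) → ℓ z P.≡ i →
      ΣL (λ w → ((u * RLL y w + LRL y w) + v * LLR y w) * indicator (InLayer i w z)) vs
        ≈ E u v (cRLL y z) (cLRL y z) (cLLR y z)
    lhs-entry u v i y z ℓz = begin
        ΣL (λ w → ((u * RLL y w + LRL y w) + v * LLR y w) * indicator (InLayer i w z)) vs
      ≈⟨ ΣL-cong vs (λ w → trans (*-cong (counts w) (indicator≈ι (InLayer i w z))) (sym (E-* u v (cRLL y w) (cLRL y w) (cLLR y w) ⟦ InLayer i w z ⟧))) ⟩
        ΣL (λ w → (u * ι (A w) + ι (B w)) + v * ι (C w)) vs
      ≈⟨ trans (ΣL-+ _ _ vs) (+-cong (ΣL-+ _ _ vs) refl) ⟩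
        (ΣL (λ w → u * ι (A w)) vs + ΣL (λ w → ι (B w)) vs) + ΣL (λ w → v * ι (C w)) vs
      ≈⟨ +-cong (+-cong (trans (ΣL-* u _ vs) (*-cong refl (ΣL-layer (cRLL y) i z ℓz))) (ΣL-layer (cLRL y) i z ℓz))
                (trans (ΣL-* v _ vs) (*-cong refl (ΣL-layer (cLLR y) i z ℓz))) ⟩
        E u v (cRLL y z) (cLRL y z) (cLLR y z)
      ∎
      where
      A B C : V → ℕ
      A w = cRLL y w ℕ.* ⟦ InLayer i w z ⟧
      B w = cLRL y w ℕ.* ⟦ InLayer i w z ⟧
      C w = cLLR y w ℕ.* ⟦ InLayer i w z ⟧
      counts : ∀ w → (u * RLL y w + LRL y w) + v * LLR y w ≈ E u v (cRLL y w) (cLRL y w) (cLLR y w)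
      counts w = +-cong (+-cong (*-cong refl (ΣL-walks (λ u → Lb u y) Lb (λ v → Lb v w) vs))
                                (ΣL-walks (Lb y) (λ u v → Lb v u) (λ v → Lb v w) vs))
                        (*-cong refl (ΣL-walks (Lb y) Lb (λ v → Lb w v) vs))

    rhs-entry : ∀ (f : Carrier) i (y z : V) → ℓ z P.≡ i →
      ΣL (λ w → (f * Lm y w) * indicator (InLayer i w z)) vs ≈ f * ι ⟦ Lb y z ⟧
    rhs-entry f i y z ℓz = begin
      ΣL (λ w → (f * Lm y w) * indicator (InLayer i w z)) vs
        ≈⟨ ΣL-cong vs (λ w → trans (*-assoc f _ _) (*-cong refl (indicator-* (Lb y w) (InLayer i w z)))) ⟩
      ΣL (λ w → f * ι (⟦ Lb y w ⟧ ℕ.* ⟦ InLayer i w z ⟧)) vs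
        ≈⟨ trans (ΣL-* f _ vs) (*-cong refl (ΣL-layer (λ w → ⟦ Lb y w ⟧) i z ℓz)) ⟩
      f * ι ⟦ Lb y z ⟧
        ∎

  parity : ∀ m → Σ ℕ (λ j → (m P.≡ j ℕ.+ j) ⊎ (m P.≡ suc (j ℕ.+ j)))
  parity zero = 0 , inj₁ P.refl
  parity (suc m) with parity m
  ... | j , inj₁ e = j , inj₂ (P.cong suc e)
  ... | j , inj₂ e = suc j , inj₁ (P.trans (P.cong suc e) (P.cong suc (P.sym (ℕP.+-suc j j))))

  module NoUniformStructure {c ℓ₁ : Level} (K : ACField c ℓ₁) (n D : ℕ) (D3 : 3 ≤ D) (nD : 2 ℕ.* D ≤ n) (x : JVtx n D) where
    open ACField K
    open FieldArithmetic K
    open Layers n D x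
    open Distances n D x D3 nD
    open MatrixEntries K n D x D3 nD
    open Eccentricity n D x D3 nD using (D≤ecc)
    open +-*-Solver using (solve; _:+_; _:*_; _:=_; con)

    ε : ℕ
    ε = ecc Γf x

    module Relations (adm : AdmitsUniform K Γf x) where
      U : ℕ → ℕ → Carrier
      U = proj₁ adm

      e⁻ e⁺ : ℕ → Carrier
      e⁻ = eMinus K ε U
      e⁺ = ePlus K ε U

      e⁻-interior : ∀ i → 2 ≤ i → e⁻ i P.≡ U i (i ℕ.∸ 1)
      e⁻-interior i 2≤i = P.cong (λ b → if b then 0# else U i (i ℕ.∸ 1)) (does-≢ i 1 λ { P.refl → ℕP.<⇒≱ 2≤i ℕP.≤-refl })

      e⁺-interior : ∀ i → suc i ≤ ε → e⁺ i P.≡ U i (suc i)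
      e⁺-interior i i<ε = P.cong (λ b → if b then 0# else U i (suc i)) (does-≢ i ε (ℕP.<⇒≢ i<ε))

      vanishing-entry : ∀ i → 1 ≤ i → i ≤ ε → ∀ y z → ℓ z P.≡ i → Lb y z P.≡ false →
        E (e⁻ i) (e⁺ i) (cRLL y z) (cLRL y z) (cLLR y z) ≈ 0#
      vanishing-entry i 1≤i i≤ε y z ℓz nonadjacent = begin
        E (e⁻ i) (e⁺ i) (cRLL y z) (cLRL y z) (cLLR y z)
          ≈⟨ sym (lhs-entry (e⁻ i) (e⁺ i) i y z ℓz) ⟩
        ΣL (λ w → ((e⁻ i * RLL y w + LRL y w) + e⁺ i * LLR y w) * indicator (InLayer i w z)) vs
          ≈⟨ proj₂ (proj₂ (proj₂ adm)) i 1≤i i≤ε y z ⟩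
        ΣL (λ w → (proj₁ (proj₂ adm) i * Lm y w) * indicator (InLayer i w z)) vs
          ≈⟨ rhs-entry (proj₁ (proj₂ adm) i) i y z ℓz ⟩
        proj₁ (proj₂ adm) i * ι ⟦ Lb y z ⟧
          ≈⟨ *-cong refl (ι-≡ (P.cong ⟦_⟧ nonadjacent)) ⟩
        proj₁ (proj₂ adm) i * 0#
          ≈⟨ zeroʳ _ ⟩
        0#
          ∎
        where open import Relation.Binary.Reasoning.Setoid setoid

      module Layer (k : ℕ) (1≤k : 1 ≤ k) (k+2≤D : k ℕ.+ 2 ≤ D) where
        open Configuration n D x D3 nD k 1≤k k+2≤D

        k+2≤ε : suc (suc k) ≤ ε
        k+2≤ε = P.subst (_≤ ε) (ℕP.+-comm k 2) (ℕP.≤-trans k+2≤D D≤ecc)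

        k+1≤ε : suc k ≤ ε
        k+1≤ε = ℕP.≤-trans (ℕP.n≤1+n (suc k)) k+2≤ε

        far-relation : ∀ t → E (e⁻ (suc k)) (e⁺ (suc k)) (4 ℕ.* t) (4 ℕ.* t) (4 ℕ.* t) ≈ 0#
        far-relation t = trans (E-* _ _ 4 4 4 t) (trans (*-cong far refl) (zeroˡ _))
          where
          far : E (e⁻ (suc k)) (e⁺ (suc k)) 4 4 4 ≈ 0#
          far = trans (sym (E-cong _ _ A-RLL A-LRL A-LLR)) (vanishing-entry (suc k) (s≤s z≤n) k+1≤ε y zA ℓzA LbA)

        cover-relation : ∀ m → D P.≡ k ℕ.+ suc m → E (e⁻ (suc k)) (e⁺ (suc k)) (4 ℕ.* k) (2 ℕ.* D) (4 ℕ.* m) ≈ 0#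
        cover-relation m D≡ = trans (sym (E-cong _ _ RLL≡ LRL≡ LLR≡)) (vanishing-entry (suc k) (s≤s z≤n) k+1≤ε y zB ℓzB LbB)
          where
          N1≡ : N1 P.≡ suc m
          N1≡ = ℕP.+-cancelʳ-≡ k N1 (suc m) (P.trans N1+k≡D (P.trans D≡ (ℕP.+-comm k (suc m))))
          RLL≡ : cRLL y zB P.≡ 4 ℕ.* k
          RLL≡ = P.trans B-RLL (solve 1 (λ k → (k :* con 2) :* con 2 := con 4 :* k) P.refl k)
          LRL≡ : cLRL y zB P.≡ 2 ℕ.* D
          LRL≡ = P.trans B-LRL (P.trans (P.cong (ℕ._* 2) (P.trans (ℕP.+-comm k N1) N1+k≡D)) (ℕP.*-comm D 2))
          LLR≡ : cLLR y zB P.≡ 4 ℕ.* m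
          LLR≡ = P.trans B-LLR (P.trans (P.cong (λ t → (t ℕ.+ t) ℕ.* 2) (ℕP.suc-injective (P.trans (P.sym N1≡1+M) N1≡)))
                   (solve 1 (λ m → (m :+ m) :* con 2 := con 4 :* m) P.refl m))

      odd-impossible : ∀ k → 1 ≤ k → D P.≡ suc (k ℕ.+ k) → ⊥
      odd-impossible k 1≤k D≡ = charZero 1 (trans (sym (E-middle _ _ 2)) middle≈0)
        where
        open Layer k 1≤k (ℕP.≤-trans (ℕP.+-monoʳ-≤ k (s≤s 1≤k)) (ℕP.≤-reflexive (P.sym (P.trans D≡ (P.sym (ℕP.+-suc k k))))))
        middle≈0 : E (e⁻ (suc k)) (e⁺ (suc k)) 0 2 0 ≈ 0#
        middle≈0 = E-difference _ _ (4 ℕ.* k) (4 ℕ.* k) (4 ℕ.* k) 0 2 0 (far-relation k)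
          (trans (E-cong _ _ (ℕP.+-identityʳ (4 ℕ.* k)) (P.sym 2D≡) (ℕP.+-identityʳ (4 ℕ.* k))) (cover-relation k (P.trans D≡ (P.sym (ℕP.+-suc k k)))))
          where
          2D≡ : 2 ℕ.* D P.≡ 4 ℕ.* k ℕ.+ 2
          2D≡ = P.trans (P.cong (2 ℕ.*_) D≡) (solve 1 (λ k → con 2 :* (con 1 :+ (k :+ k)) := con 4 :* k :+ con 2) P.refl k)

      even-impossible : ∀ k → 1 ≤ k → D P.≡ suc k ℕ.+ suc k → ⊥
      even-impossible k 1≤k D≡ =
        [ (λ lower → lower (suc k) (s≤s 1≤k) Lower.k+1≤ε (P.subst (_≈ 0#) (e⁻-interior (suc k) (s≤s 1≤k)) lower≈0))
        , (λ upper → upper (suc (suc (suc k))) (s≤s (s≤s z≤n)) Upper.k+2≤ε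
                       (P.subst (_≈ 0#) (e⁺-interior (suc (suc k)) Upper.k+2≤ε) upper≈0))
        ] (ParameterMatrix.offdiag (proj₁ (proj₂ (proj₂ adm))))
        where
        D≡′ : D P.≡ k ℕ.+ suc (suc k)
        D≡′ = P.trans D≡ (P.sym (ℕP.+-suc k (suc k)))
        module Lower = Layer k 1≤k (ℕP.≤-trans (ℕP.+-monoʳ-≤ k (s≤s (s≤s z≤n))) (ℕP.≤-reflexive (P.sym D≡′)))
        module Upper = Layer (suc k) (s≤s z≤n) (ℕP.≤-trans (ℕP.+-monoʳ-≤ (suc k) (s≤s 1≤k)) (ℕP.≤-reflexive (P.sym D≡)))
        2D≡ : 2 ℕ.* D P.≡ 4 ℕ.* suc k
        2D≡ = P.trans (P.cong (2 ℕ.*_) D≡) (solve 1 (λ k → con 2 :* ((con 1 :+ k) :+ (con 1 :+ k)) := con 4 :* (con 1 :+ k)) P.refl k)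
        4k+4≡ : 4 ℕ.* k ℕ.+ 4 P.≡ 4 ℕ.* suc k
        4k+4≡ = solve 1 (λ k → con 4 :* k :+ con 4 := con 4 :* (con 1 :+ k)) P.refl k
        lower≈0 : e⁻ (suc k) ≈ 0#
        lower≈0 = *ι-cancel _ 3 (trans (sym (E-left _ _ 4)) (E-difference _ _ (4 ℕ.* k) (2 ℕ.* D) (4 ℕ.* suc k) 4 0 0
          (Lower.cover-relation (suc k) D≡′)
          (trans (E-cong _ _ 4k+4≡ (P.trans (ℕP.+-identityʳ (2 ℕ.* D)) 2D≡) (ℕP.+-identityʳ (4 ℕ.* suc k))) (Lower.far-relation (suc k)))))
        upper≈0 : e⁺ (suc (suc k)) ≈ 0#
        upper≈0 = *ι-cancel _ 3 (trans (sym (E-right _ _ 4)) (E-difference _ _ (4 ℕ.* suc k) (2 ℕ.* D) (4 ℕ.* k) 0 0 4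
          (Upper.cover-relation k D≡)
          (trans (E-cong _ _ (ℕP.+-identityʳ (4 ℕ.* suc k)) (P.trans (ℕP.+-identityʳ (2 ℕ.* D)) 2D≡) 4k+4≡) (Upper.far-relation (suc k)))))

    noUniformStructure : ¬ AdmitsUniform K Γf x
    noUniformStructure adm with parity D
    ... | zero , inj₁ D≡ = contradiction (P.subst (3 ≤_) D≡ D3) λ ()
    ... | zero , inj₂ D≡ = contradiction (P.subst (3 ≤_) D≡ D3) λ { (s≤s ()) }
    ... | suc zero , inj₁ D≡ = contradiction (P.subst (3 ≤_) D≡ D3) λ { (s≤s (s≤s ())) }
    ... | suc (suc k) , inj₁ D≡ = Relations.even-impossible adm (suc k) (s≤s z≤n) D≡
    ... | suc k , inj₂ D≡ = Relations.odd-impossible adm (suc k) (s≤s z≤n) D≡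

open import Data.Nat using (ℕ; _≤_; _*_)
open import Relation.Nullary using (¬_)
open import Data.Product using (_,_)

theorem9p4 : ∀ {c ℓ : Level} (K : ACField c ℓ) (n D : ℕ) → 3 ≤ D → 2 * D ≤ n →
    (x : Graph.Vtx (Johnson n D)) → ¬ SupportsUniform K (Johnson n D) x
theorem9p4 K n D 3≤D 2D≤n x (_ , flat) =
  NoUniformStructure.noUniformStructure K n D 3≤D 2D≤n x (flat (Layers.Bound.johnson-not-bipartite n D x 3≤D 2D≤n))
  where
  open JohnsonGraph
  open UniformStructureEquations
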